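{- Let $\Bbbk$ be a field of characteristic zero, $\beta\in\Bbbk^\times$, $b\in\Bbbk$, and let $A$ be the $\Bbbk$-algebra generated by $x,y,z$ subject to $$yz-zy=z,\qquad zx-\beta xz=b,\qquad xy-yx=x.$$ Then: (1) For all $m,n\in\mathbb{N}$, $y^nx^m=x^m(y-m)^n$, $z^ny^m=(y-n)^mz^n$, and $$z^nx^m=\sum_{k=0}^{\min\{m,n\}}\beta^{(m-k)(n-k)}b^k\begin{bmatrix}n\\k\end{bmatrix}_\beta\begin{bmatrix}m\\k\end{bmatrix}_\beta[k]_\beta!\,x^{m-k}z^{n-k}.$$ If scalars $W^{(m)}_{n,k}\in\Bbbk$ are defined by $z^nx^m=\sum_{k=0}^{\min\{m,n\}}x^{m-k}W^{(m)}_{n,k}z^{n-k}$, then $W^{(m)}_{0,0}=1$, $W^{(m)}_{0,k}=0$ ($k\ge1$), and $W^{(m)}_{n+1,k}=\beta^{m-k}W^{(m)}_{n,k}+b[m-k+1]_\beta W^{(m)}_{n,k-1}$ for $n,k\ge0$, with $W^{(m)}_{n,-1}:=0$. (2) For all $m,n,s\in\mathbb{N}$, $(x^ny^m)^s=x^{ns}\prod_{j=0}^{s-1}(y-jn)^m$ and $(y^nz^m)^s=\left(\prod_{j=0}^{s-1}(y-jm)^n\right)z^{ms}$. Moreover $(x^nz^m)^s=\sum_{\ell=0}^{\min\{ns,ms\}}x^{ns-\ell}U^{(n,m)}_{s,\ell}z^{ms-\ell}$ uniquely with $U^{(n,m)}_{s,\ell}\in\Bbbk$, $U^{(n,m)}_{1,0}=1$,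 $U^{(n,m)}_{1,\ell}=0$ ($\ell\ge1$), and $U^{(n,m)}_{s+1,\ell}=\sum_{k=0}^{\min\{n,\ell\}}U^{(n,m)}_{s,\ell-k}W^{(n)}_{ms-(\ell-k),k}$ for $s\ge1,\ell\ge0$. (3) There exist unique $V_{s,\ell}(y)\in\Bbbk[y]$ ($0\le\ell\le s$) with $(xyz)^s=\sum_{\ell=0}^sx^{s-\ell}V_{s,\ell}(y)z^{s-\ell}$; $V_{1,0}(y)=y$, $V_{1,\ell}(y)=0$ ($\ell\ge1$), and for $s\ge1,\ell\ge0$: $$V_{s+1,\ell}(y)=(y-(s-\ell))\Big(\beta^{s-\ell}V_{s,\ell}(y-1)+b[s-\ell+1]_\beta V_{s,\ell-1}(y)\Big),\quad V_{s,-1}(y):=0.$$ (4) For all $n,m,t,s\in\mathbb{N}$ and $0\le\ell\le\min\{ns,ts\}$ there exist unique $R^{(n,m,t)}_{s,\ell}(y)\in\Bbbk[y]$ with $(x^ny^mz^t)^s=\sum_{\ell=0}^{\min\{ns,ts\}}x^{ns-\ell}R^{(n,m,t)}_{s,\ell}(y)z^{ts-\ell}$; $R^{(n,m,t)}_{1,0}(y)=y^m$, $R^{(n,m,t)}_{1,\ell}(y)=0$ ($\ell\ge1$), and for $s\ge1,\ell\ge0$: $$R^{(n,m,t)}_{s+1,\ell}(y)=(y-(ts-\ell))^m\sum_{k=0}^{\min\{n,\ell\}}R^{(n,m,t)}_{s,\ell-k}\big(y-(n-k)\big)W^{(n)}_{ts-(\ell-k),k}.$$ (5) There exist unique $S_{n,k}(y),T_{n,k}(y)\in\Bbbk[y]$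 with $(x+y)^n=\sum_{k=0}^nx^kS_{n,k}(y)$ and $(y+z)^n=\sum_{k=0}^nT_{n,k}(y)z^k$, characterized by $S_{0,0}=1$, $S_{0,k}=0$ ($k\ge1$), $S_{n+1,k}(y)=S_{n,k-1}(y)+(y-k)S_{n,k}(y)$, and $T_{0,0}=1$, $T_{0,k}=0$ ($k\ge1$), $T_{n+1,k}(y)=yT_{n,k}(y)+T_{n,k-1}(y-1)$. The element $(x+z)^n$ has a unique expansion $(x+z)^n=\sum_{i,k\ge0,\ i+k\le n}x^iE_{n;i,k}z^k$ with $E_{n;i,k}\in\Bbbk[b]$, $E_{0;0,0}=1$, $E_{0;i,k}=0$ for $(i,k)\ne(0,0)$, and $E_{n+1;i,k}=E_{n;i,k-1}+\beta^kE_{n;i-1,k}+b[k+1]_\beta E_{n;i,k+1}$, where $E_{n;i,k}=0$ whenever $i<0$, $k<0$ or $i+k>n$.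
   Context: $\mathbb{N}$ includes $0$. For $q\in\Bbbk^\times$: $[r]_q=1+q+\cdots+q^{r-1}$ ($[0]_q=0$), $[r]_q!=\prod_{j=1}^r[j]_q$ ($[0]_q!=1$), $\begin{bmatrix}r\\k\end{bmatrix}_q=\frac{[r]_q!}{[r-k]_q![k]_q!}$ for $0\le k\le r$ and $0$ if $k>r$. The standard monomials $x^iy^jz^k$ form a $\Bbbk$-basis of $A$ (PBW basis); uniqueness refers to expansions in this basis, with polynomials in $y$ placed between the $x$-power and the $z$-power. Coefficients with a negative index are zero; empty sums are $0$, empty products $1$. -}

module Defs where

open import Level using (Level; _⊔_)
open import Algebra.Bundles using (CommutativeRing; Ring)
open import Algebra.Morphism.Structures using (IsRingHomomorphism)
open import Data.Nat as ℕ using (ℕ; zero; suc; _∸_; _⊓_; _≤ᵇ_; _<_)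
open import Data.Bool using (if_then_else_)
open import Data.List using (List; []; _∷_)
open import Data.Product using (Σ; ∃; _×_)
open import Relation.Nullary using (¬_)

module KOps {c ℓ : Level} (K : CommutativeRing c ℓ) where
  open CommutativeRing K public using ()
    renaming ( Carrier to Kc ; _≈_ to _≈ᵏ_ ; _+_ to _+ᵏ_ ; _*_ to _*ᵏ_
             ; -_ to -ᵏ_ ; 0# to 0ᵏ ; 1# to 1ᵏ )

  infixr 8 _^ᵏ_

  castᵏ : ℕ → Kc
  castᵏ zero    = 0ᵏ
  castᵏ (suc n) = 1ᵏ +ᵏ castᵏ n

  _^ᵏ_ : Kc → ℕ → Kc
  u ^ᵏ zero  = 1ᵏ
  u ^ᵏ suc n = u *ᵏ (u ^ᵏ n)

  record IsField : Set (c ⊔ ℓ) where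
    field
      1≉0     : ¬ (1ᵏ ≈ᵏ 0ᵏ)
      inverse : ∀ u → ¬ (u ≈ᵏ 0ᵏ) → Σ Kc (λ v → (u *ᵏ v) ≈ᵏ 1ᵏ)

  CharZero : Set ℓ
  CharZero = ∀ n → ¬ (castᵏ (suc n) ≈ᵏ 0ᵏ)

  Σᵏ< : ℕ → (ℕ → Kc) → Kc
  Σᵏ< zero    f = 0ᵏ
  Σᵏ< (suc n) f = Σᵏ< n f +ᵏ f n

  Σᵏ≤ : ℕ → (ℕ → Kc) → Kc
  Σᵏ≤ n f = Σᵏ< (suc n) f

  qint : Kc → ℕ → Kc
  qint q r = Σᵏ< r (λ j → q ^ᵏ j)

  qfact : Kc → ℕ → Kc
  qfact q zero    = 1ᵏ
  qfact q (suc r) = qfact q r *ᵏ qint q (suc r)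

  -- Gaussian binomial [r k]_q (q-Pascal rule; equals
  -- [r]_q!/([r-k]_q![k]_q!) whenever the latter is defined, and 0 for k > r)
  qbin : Kc → ℕ → ℕ → Kc
  qbin q r       zero    = 1ᵏ
  qbin q zero    (suc k) = 0ᵏ
  qbin q (suc r) (suc k) = qbin q r k +ᵏ ((q ^ᵏ suc k) *ᵏ qbin q r (suc k))

  δ0 : ℕ → Kc
  δ0 zero    = 1ᵏ
  δ0 (suc _) = 0ᵏ

  -- Polynomials K[X] as coefficient lists (constant term first)

  Poly : Set c
  Poly = List Kc

  coeff : Poly → ℕ → Kc
  coeff []      _       = 0ᵏ
  coeff (a ∷ p) zero    = a
  coeff (a ∷ p) (suc i) = coeff p i

  _≈ₚ_ : Poly → Poly → Set ℓ
  p ≈ₚ q = ∀ i → coeff p i ≈ᵏ coeff q i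

  infixl 6 _⊕_
  infixl 7 _⊗_

  _⊕_ : Poly → Poly → Poly
  []      ⊕ q       = q
  (a ∷ p) ⊕ []      = a ∷ p
  (a ∷ p) ⊕ (b ∷ q) = (a +ᵏ b) ∷ (p ⊕ q)

  scale : Kc → Poly → Poly
  scale u []      = []
  scale u (a ∷ p) = (u *ᵏ a) ∷ scale u p

  _⊗_ : Poly → Poly → Poly
  []      ⊗ q = []
  (a ∷ p) ⊗ q = scale a q ⊕ (0ᵏ ∷ (p ⊗ q))

  C : Kc → Poly
  C u = u ∷ []

  X : Poly
  X = 0ᵏ ∷ 1ᵏ ∷ []

  _^ₚ_ : Poly → ℕ → Poly
  p ^ₚ zero  = C 1ᵏ
  p ^ₚ suc n = p ⊗ (p ^ₚ n)

  X-_ : ℕ → Poly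
  X- n = X ⊕ C (-ᵏ castᵏ n)

  compose : Poly → Poly → Poly
  compose []      q = []
  compose (a ∷ p) q = C a ⊕ (q ⊗ compose p q)

  shift : Poly → ℕ → Poly
  shift p n = compose p (X- n)

  Σₚ< : ℕ → (ℕ → Poly) → Poly
  Σₚ< zero    f = []
  Σₚ< (suc n) f = Σₚ< n f ⊕ f n

  Σₚ≤ : ℕ → (ℕ → Poly) → Poly
  Σₚ≤ n f = Σₚ< (suc n) f

  evalᵏ : Poly → Kc → Kc
  evalᵏ []      u = 0ᵏ
  evalᵏ (a ∷ p) u = a +ᵏ (u *ᵏ evalᵏ p u)

module Setting {c ℓ a ℓa : Level} (K : CommutativeRing c ℓ) (A : Ring a ℓa)
               (ι : CommutativeRing.Carrier K → Ring.Carrier A)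
               (β b : CommutativeRing.Carrier K)
               (x y z : Ring.Carrier A) where
  open KOps K public
  open Ring A public

  IsKAlgebra : Set (c ⊔ ℓ ⊔ a ⊔ ℓa)
  IsKAlgebra = IsRingHomomorphism (CommutativeRing.rawRing K) (Ring.rawRing A) ι
             × (∀ u v → (ι u * v) ≈ (v * ι u))

  infixr 8 _^_

  _^_ : Carrier → ℕ → Carrier
  u ^ zero  = 1#
  u ^ suc n = u * (u ^ n)

  castA : ℕ → Carrier
  castA zero    = 0#
  castA (suc n) = 1# + castA n

  Σ< : ℕ → (ℕ → Carrier) → Carrier
  Σ< zero    f = 0#
  Σ< (suc n) f = Σ< n f + f n

  Σ≤ : ℕ → (ℕ → Carrier) → Carrier
  Σ≤ n f = Σ< (suc n) f

  Π< : ℕ → (ℕ → Carrier) → Carrier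
  Π< zero    f = 1#
  Π< (suc n) f = Π< n f * f n

  ev : Poly → Carrier
  ev []      = 0#
  ev (u ∷ p) = ι u + y * ev p

  Relations : Set ℓa
  Relations = (y * z - z * y ≈ z)
            × (z * x - ι β * x * z ≈ ι b)
            × (x * y - y * x ≈ x)

  mono : ℕ → ℕ → ℕ → Carrier
  mono i j k = x ^ i * y ^ j * z ^ k

  comb : ℕ → (ℕ → ℕ → ℕ → Kc) → Carrier
  comb N f = Σ< N (λ i → Σ< N (λ j → Σ< N (λ k → ι (f i j k) * mono i j k)))

  PBW : Set (c ⊔ ℓ ⊔ a ⊔ ℓa)
  PBW = (∀ u → ∃ λ N → ∃ λ f → u ≈ comb N f)
      × (∀ N f → comb N f ≈ 0# → ∀ i j k → i < N → j < N → k < N → f i j k ≈ᵏ 0ᵏ)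

  -- W^{(m)}_{n,k}  (zero for k > m, as the recursion forces)
  W : ℕ → ℕ → ℕ → Kc
  W m zero    k = δ0 k
  W m (suc n) k = if k ≤ᵇ m
                  then ((β ^ᵏ (m ∸ k)) *ᵏ W m n k) +ᵏ ((b *ᵏ qint β (suc (m ∸ k))) *ᵏ Wprev k)
                  else 0ᵏ
    where
    Wprev : ℕ → Kc
    Wprev zero    = 0ᵏ
    Wprev (suc k) = W m n k

  U : ℕ → ℕ → ℕ → ℕ → Kc
  U n m zero          ℓ = δ0 ℓ
  U n m (suc zero)    ℓ = δ0 ℓ
  U n m (suc (suc s)) ℓ =
    Σᵏ≤ (n ⊓ ℓ) (λ k → U n m (suc s) (ℓ ∸ k) *ᵏ W n ((m ℕ.* suc s) ∸ (ℓ ∸ k)) k)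

  δ0ₚ : ℕ → Poly
  δ0ₚ zero    = C 1ᵏ
  δ0ₚ (suc _) = []

  V : ℕ → ℕ → Poly
  V zero          ℓ       = δ0ₚ ℓ
  V (suc zero)    zero    = X
  V (suc zero)    (suc ℓ) = []
  V (suc (suc s)) ℓ       =
    if ℓ ≤ᵇ suc s
    then (X- (suc s ∸ ℓ)) ⊗ (scale (β ^ᵏ (suc s ∸ ℓ)) (shift (V (suc s) ℓ) 1)
                             ⊕ scale (b *ᵏ qint β (suc (suc s ∸ ℓ))) (Vprev ℓ))
    else []
    where
    Vprev : ℕ → Poly
    Vprev zero    = []
    Vprev (suc ℓ) = V (suc s) ℓ

  R : ℕ → ℕ → ℕ → ℕ → ℕ → Poly
  R n m t zero          ℓ       = δ0ₚ ℓ
  R n m t (suc zero)    zero    = X ^ₚ m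
  R n m t (suc zero)    (suc ℓ) = []
  R n m t (suc (suc s)) ℓ       =
    ((X- ((t ℕ.* suc s) ∸ ℓ)) ^ₚ m)
      ⊗ Σₚ≤ (n ⊓ ℓ) (λ k → scale (W n ((t ℕ.* suc s) ∸ (ℓ ∸ k)) k)
                                  (shift (R n m t (suc s) (ℓ ∸ k)) (n ∸ k)))

  S : ℕ → ℕ → Poly
  S zero    k = δ0ₚ k
  S (suc n) k = Sprev k ⊕ ((X- k) ⊗ S n k)
    where
    Sprev : ℕ → Poly
    Sprev zero    = []
    Sprev (suc k) = S n k

  T : ℕ → ℕ → Poly
  T zero    k = δ0ₚ k
  T (suc n) k = (X ⊗ T n k) ⊕ Tprev k
    where
    Tprev : ℕ → Poly
    Tprev zero    = []
    Tprev (suc k) = shift (T n k) 1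

  -- E_{n;i,k} ∈ K[b], as a polynomial in an indeterminate B (to be
  -- evaluated at B = b); zero whenever i + k > n
  E : ℕ → ℕ → ℕ → Poly
  E zero    i k = if (i ℕ.+ k) ≤ᵇ 0 then C 1ᵏ else []
  E (suc n) i k =
    if (i ℕ.+ k) ≤ᵇ suc n
    then (Ek k ⊕ scale (β ^ᵏ k) (Ei i)) ⊕ (scale (qint β (suc k)) X ⊗ E n i (suc k))
    else []
    where
    Ek : ℕ → Poly
    Ek zero    = []
    Ek (suc k) = E n i k
    Ei : ℕ → Poly
    Ei zero    = []
    Ei (suc i) = E n i k

{-# OPTIONS --safe #-}
-- The commutation rules  y x = x (y - 1),  z y = (y - 1) z  and  z x = β x z + b  move a
-- polynomial p(y) past a power of x or z at the cost of shifting its argument, and turn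
-- z^n x^m into Σ_k x^(m-k) W^(m)_(n,k) z^(n-k).  Each expansion is then proved by induction
-- on the exponent: multiply the normally ordered expansion by one more factor, bring every
-- product back into normal order with these rules and collect terms; the recursions defining
-- W, R, S, T and E are exactly the collected coefficients, and U and V are the cases m = 0
-- and n = m = t = 1 of R.  Uniqueness holds because within each expansion distinct indices
-- give distinct exponent pairs of x and z, so the PBW basis x^i y^j z^k separates them.
module Submission where

open import Level using (Level)
open import Algebra.Bundles using (CommutativeRing; Ring)
open import Algebra.Morphism.Structures using (IsRingHomomorphism)
import Algebra.Morphism.Construct.Identity as IdentityMorphism
import Algebra.Properties.CommutativeSemigroup as CommutativeSemigroupProperties
import Algebra.Properties.AbelianGroup as AbelianGroupProperties
import Algebra.Properties.Group as GroupProperties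
import Algebra.Properties.Ring as RingProperties
import Algebra.Solver.Ring.NaturalCoefficients.Default as NaturalCoefficientSolver
open import Data.Bool as Bool using (true; false; if_then_else_)
open import Data.Empty using (⊥-elim)
open import Data.List using ([]; _∷_; length)
open import Data.Nat as ℕ using (ℕ; zero; suc; _≤_; _<_; z≤n; s≤s; _∸_; _⊓_; _≤′_; ≤′-refl; ≤′-step)
import Data.Nat.Properties as ℕₚ
open import Data.Product using (_×_; _,_; proj₁; proj₂)
open import Data.Sum using (_⊎_; inj₁; inj₂)
open import Data.Unit using (tt)
open import Function using (id; _∘′_)
open import Relation.Binary.Definitions using (tri<; tri≈; tri>)
open import Relation.Binary.PropositionalEquality as ≡ using (_≡_; _≢_)
import Relation.Binary.Reasoning.Setoid as SetoidReasoning
open import Relation.Nullary using (¬_; Dec; yes; no)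
open import Defs

if-≤ᵇ-true : ∀ {p} {S : Set p} {k m} {X Y : S} → k ≤ m → (if k ℕ.≤ᵇ m then X else Y) ≡ X
if-≤ᵇ-true {k = k} {m} k≤m with k ℕ.≤ᵇ m | ℕₚ.≤⇒≤ᵇ k≤m
... | true  | _  = ≡.refl
... | false | ()

if-≤ᵇ-false : ∀ {p} {S : Set p} {k m} {X Y : S} → m < k → (if k ℕ.≤ᵇ m then X else Y) ≡ Y
if-≤ᵇ-false {k = k} {m} m<k with k ℕ.≤ᵇ m in k≤ᵇm
... | false = ≡.refl
... | true  = ⊥-elim (ℕₚ.<⇒≱ m<k (ℕₚ.≤ᵇ⇒≤ k m (≡.subst Bool.T (≡.sym k≤ᵇm) tt)))

m∸n≡1+m∸[1+n] : ∀ m n → n < m → m ∸ n ≡ suc (m ∸ suc n)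
m∸n≡1+m∸[1+n] (suc m) zero    _         = ≡.refl
m∸n≡1+m∸[1+n] (suc m) (suc n) (s≤s n<m) = m∸n≡1+m∸[1+n] m n n<m

n≤m⇒m<n+o⇒m∸n<o : ∀ {m n o} → n ≤ m → m < n ℕ.+ o → m ∸ n < o
n≤m⇒m<n+o⇒m∸n<o {m} {n} {o} n≤m m<n+o =
  ℕₚ.+-cancelˡ-< n (m ∸ n) o (≡.subst (_< n ℕ.+ o) (≡.sym (ℕₚ.m+[n∸m]≡n n≤m)) m<n+o)

m⊓n<o⇒m<o⊎n<o : ∀ {m n o} → m ⊓ n < o → m < o ⊎ n < o
m⊓n<o⇒m<o⊎n<o {m} {n} {o} m⊓n<o with ℕₚ.≤-total m n
... | inj₁ m≤n = inj₁ (≡.subst (_< o) (ℕₚ.m≤n⇒m⊓n≡m m≤n) m⊓n<o)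
... | inj₂ n≤m = inj₂ (≡.subst (_< o) (ℕₚ.m≥n⇒m⊓n≡n n≤m) m⊓n<o)

[m∸n]+[o∸p]≡[m+o]∸[n+p] : ∀ {m n o p} → n ≤ m → p ≤ o → (m ∸ n) ℕ.+ (o ∸ p) ≡ (m ℕ.+ o) ∸ (n ℕ.+ p)
[m∸n]+[o∸p]≡[m+o]∸[n+p] {m} {n} {o} {p} n≤m p≤o = ≡.trans (≡.sym (ℕₚ.+-∸-assoc (m ∸ n) p≤o))
  (≡.trans (≡.cong (_∸ p) (≡.sym (ℕₚ.+-∸-comm o n≤m))) (ℕₚ.∸-+-assoc (m ℕ.+ o) n p))

n[1+s]⊓t[1+s]≤[ns⊓ts]+n : ∀ n t s → (n ℕ.* suc s) ⊓ (t ℕ.* suc s) ≤ ((n ℕ.* s) ⊓ (t ℕ.* s)) ℕ.+ n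
n[1+s]⊓t[1+s]≤[ns⊓ts]+n n t s = ≡.subst ((n ℕ.* suc s) ⊓ (t ℕ.* suc s) ≤_)
  (≡.sym (ℕₚ.+-distribʳ-⊓ n (n ℕ.* s) (t ℕ.* s))) (ℕₚ.⊓-glb bound-n bound-t)
  where
  n[1+s]≡ns+n : n ℕ.* suc s ≡ n ℕ.* s ℕ.+ n
  n[1+s]≡ns+n = ≡.trans (ℕₚ.*-suc n s) (ℕₚ.+-comm n (n ℕ.* s))
  bound-n : (n ℕ.* suc s) ⊓ (t ℕ.* suc s) ≤ n ℕ.* s ℕ.+ n
  bound-n = ℕₚ.≤-trans (ℕₚ.m⊓n≤m _ _) (ℕₚ.≤-reflexive n[1+s]≡ns+n)
  bound-t : (n ℕ.* suc s) ⊓ (t ℕ.* suc s) ≤ t ℕ.* s ℕ.+ n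
  bound-t with t ℕₚ.≤? n
  ... | yes t≤n = ℕₚ.≤-trans (ℕₚ.m⊓n≤n _ _)
    (≡.subst (_≤ t ℕ.* s ℕ.+ n) (≡.sym (≡.trans (ℕₚ.*-suc t s) (ℕₚ.+-comm t (t ℕ.* s)))) (ℕₚ.+-monoʳ-≤ (t ℕ.* s) t≤n))
  ... | no  t≰n = ℕₚ.≤-trans (ℕₚ.m⊓n≤m _ _)
    (ℕₚ.≤-trans (ℕₚ.≤-reflexive n[1+s]≡ns+n) (ℕₚ.+-monoˡ-≤ n (ℕₚ.*-monoˡ-≤ s (ℕₚ.<⇒≤ (ℕₚ.≰⇒> t≰n)))))

Σℕ< : ℕ → (ℕ → ℕ) → ℕ
Σℕ< zero    f = 0
Σℕ< (suc n) f = Σℕ< n f ℕ.+ f n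

≤-Σℕ< : ∀ n (f : ℕ → ℕ) i → i < n → f i ≤ Σℕ< n f
≤-Σℕ< (suc n) f i (s≤s i≤n) with ℕₚ.m≤n⇒m<n∨m≡n i≤n
... | inj₁ i<n    = ℕₚ.≤-trans (≤-Σℕ< n f i i<n) (ℕₚ.m≤m+n _ _)
... | inj₂ ≡.refl = ℕₚ.m≤n+m _ _

module RingLemmas {c ℓ : Level} (R : Ring c ℓ) where
  open Ring R

  +-identityˡ′ : ∀ {a b} → a ≈ 0# → a + b ≈ b
  +-identityˡ′ {b = b} a≈0 = trans (+-congʳ a≈0) (+-identityˡ b)

  +-identityʳ′ : ∀ {a b} → b ≈ 0# → a + b ≈ a
  +-identityʳ′ {a} b≈0 = trans (+-congˡ b≈0) (+-identityʳ a)

  zeroˡ′ : ∀ {a} b → a ≈ 0# → a * b ≈ 0#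
  zeroˡ′ b a≈0 = trans (*-congʳ a≈0) (zeroˡ b)

  zeroʳ′ : ∀ a {b} → b ≈ 0# → a * b ≈ 0#
  zeroʳ′ a b≈0 = trans (*-congˡ b≈0) (zeroʳ a)

  open CommutativeSemigroupProperties +-commutativeSemigroup public
    using () renaming (interchange to +-interchange)

module FiniteSums {c ℓ : Level} (R : Ring c ℓ)
  (σ : ℕ → (ℕ → Ring.Carrier R) → Ring.Carrier R)
  (σ-zero : ∀ f → Ring._≈_ R (σ 0 f) (Ring.0# R))
  (σ-suc : ∀ n f → Ring._≈_ R (σ (suc n) f) (Ring._+_ R (σ n f) (f n))) where
  open Ring R
  open SetoidReasoning setoid
  open RingLemmas R

  σ-cong : ∀ n {f g} → (∀ i → i < n → f i ≈ g i) → σ n f ≈ σ n g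
  σ-cong zero {f} {g} _ = trans (σ-zero f) (sym (σ-zero g))
  σ-cong (suc n) {f} {g} f≈g = begin
    σ (suc n) f  ≈⟨ σ-suc n f ⟩
    σ n f + f n  ≈⟨ +-cong (σ-cong n (λ i i<n → f≈g i (ℕₚ.m≤n⇒m≤1+n i<n))) (f≈g n ℕₚ.≤-refl) ⟩
    σ n g + g n  ≈⟨ σ-suc n g ⟨
    σ (suc n) g  ∎

  σ-cong′ : ∀ n {f g} → (∀ i → f i ≈ g i) → σ n f ≈ σ n g
  σ-cong′ n f≈g = σ-cong n (λ i _ → f≈g i)

  σ-null : ∀ n {f} → (∀ i → i < n → f i ≈ 0#) → σ n f ≈ 0#
  σ-null zero {f} _ = σ-zero f
  σ-null (suc n) {f} f≈0 = begin
    σ (suc n) f  ≈⟨ σ-suc n f ⟩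
    σ n f + f n  ≈⟨ +-cong (σ-null n (λ i i<n → f≈0 i (ℕₚ.m≤n⇒m≤1+n i<n))) (f≈0 n ℕₚ.≤-refl) ⟩
    0# + 0#      ≈⟨ +-identityˡ 0# ⟩
    0#           ∎

  σ-+ : ∀ n f g → σ n (λ i → f i + g i) ≈ σ n f + σ n g
  σ-+ zero f g = trans (σ-zero _) (sym (trans (+-cong (σ-zero f) (σ-zero g)) (+-identityˡ 0#)))
  σ-+ (suc n) f g = begin
    σ (suc n) (λ i → f i + g i)          ≈⟨ σ-suc n _ ⟩
    σ n (λ i → f i + g i) + (f n + g n)  ≈⟨ +-congʳ (σ-+ n f g) ⟩
    (σ n f + σ n g) + (f n + g n)        ≈⟨ +-interchange _ _ _ _ ⟩
    (σ n f + f n) + (σ n g + g n)        ≈⟨ +-cong (σ-suc n f) (σ-suc n g) ⟨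
    σ (suc n) f + σ (suc n) g            ∎

  *-distribˡ-σ : ∀ n u f → u * σ n f ≈ σ n (λ i → u * f i)
  *-distribˡ-σ zero u f = trans (zeroʳ′ u (σ-zero f)) (sym (σ-zero _))
  *-distribˡ-σ (suc n) u f = begin
    u * σ (suc n) f            ≈⟨ *-congˡ (σ-suc n f) ⟩
    u * (σ n f + f n)          ≈⟨ distribˡ u _ _ ⟩
    u * σ n f + u * f n        ≈⟨ +-congʳ (*-distribˡ-σ n u f) ⟩
    σ n (λ i → u * f i) + u * f n  ≈⟨ σ-suc n _ ⟨
    σ (suc n) (λ i → u * f i)  ∎

  *-distribʳ-σ : ∀ n u f → σ n f * u ≈ σ n (λ i → f i * u)
  *-distribʳ-σ zero u f = trans (zeroˡ′ u (σ-zero f)) (sym (σ-zero _))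
  *-distribʳ-σ (suc n) u f = begin
    σ (suc n) f * u            ≈⟨ *-congʳ (σ-suc n f) ⟩
    (σ n f + f n) * u          ≈⟨ distribʳ u _ _ ⟩
    σ n f * u + f n * u        ≈⟨ +-congʳ (*-distribʳ-σ n u f) ⟩
    σ n (λ i → f i * u) + f n * u  ≈⟨ σ-suc n _ ⟨
    σ (suc n) (λ i → f i * u)  ∎

  σ-neg : ∀ n f → σ n (λ i → - f i) ≈ - σ n f
  σ-neg n f = GroupProperties.inverseʳ-unique +-group (σ n f) _ (begin
    σ n f + σ n (λ i → - f i)  ≈⟨ σ-+ n f _ ⟨
    σ n (λ i → f i - f i)      ≈⟨ σ-null n (λ i _ → -‿inverseʳ (f i)) ⟩
    0#                         ∎)

  σ-sucˡ : ∀ n f → σ (suc n) f ≈ f 0 + σ n (λ i → f (suc i))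
  σ-sucˡ zero f = begin
    σ 1 f       ≈⟨ trans (σ-suc 0 f) (+-identityˡ′ (σ-zero f)) ⟩
    f 0         ≈⟨ +-identityʳ′ (σ-zero _) ⟨
    f 0 + σ 0 (λ i → f (suc i))  ∎
  σ-sucˡ (suc n) f = begin
    σ (suc (suc n)) f                          ≈⟨ σ-suc (suc n) f ⟩
    σ (suc n) f + f (suc n)                    ≈⟨ +-congʳ (σ-sucˡ n f) ⟩
    (f 0 + σ n (λ i → f (suc i))) + f (suc n)  ≈⟨ +-assoc _ _ _ ⟩
    f 0 + (σ n (λ i → f (suc i)) + f (suc n))  ≈⟨ +-congˡ (σ-suc n _) ⟨
    f 0 + σ (suc n) (λ i → f (suc i))          ∎

  σ-truncate : ∀ {m n} f → m ≤ n → (∀ i → m ≤ i → i < n → f i ≈ 0#) → σ n f ≈ σ m f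
  σ-truncate {m} f m≤n = go (ℕₚ.≤⇒≤′ m≤n)
    where
    go : ∀ {n} → m ≤′ n → (∀ i → m ≤ i → i < n → f i ≈ 0#) → σ n f ≈ σ m f
    go ≤′-refl _ = refl
    go (≤′-step {n} m≤′n) f≈0 = begin
      σ (suc n) f  ≈⟨ σ-suc n f ⟩
      σ n f + f n  ≈⟨ +-cong (go m≤′n (λ i m≤i i<n → f≈0 i m≤i (ℕₚ.m≤n⇒m≤1+n i<n)))
                             (f≈0 n (ℕₚ.≤′⇒≤ m≤′n) ℕₚ.≤-refl) ⟩
      σ m f + 0#   ≈⟨ +-identityʳ _ ⟩
      σ m f        ∎

  σ-swap : ∀ n m (F : ℕ → ℕ → Carrier) → σ n (λ i → σ m (F i)) ≈ σ m (λ j → σ n (λ i → F i j))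
  σ-swap zero m F = trans (σ-zero _) (sym (σ-null m (λ j _ → σ-zero _)))
  σ-swap (suc n) m F = begin
    σ (suc n) (λ i → σ m (F i))                     ≈⟨ σ-suc n _ ⟩
    σ n (λ i → σ m (F i)) + σ m (F n)               ≈⟨ +-congʳ (σ-swap n m F) ⟩
    σ m (λ j → σ n (λ i → F i j)) + σ m (F n)       ≈⟨ σ-+ m _ _ ⟨
    σ m (λ j → σ n (λ i → F i j) + F n j)           ≈⟨ σ-cong′ m (λ j → σ-suc n _) ⟨
    σ m (λ j → σ (suc n) (λ i → F i j))             ∎

  σ-single : ∀ n t f → t < n → (∀ i → i < n → i ≢ t → f i ≈ 0#) → σ n f ≈ f t
  σ-single (suc n) t f (s≤s t≤n) f≈0 with ℕₚ.m≤n⇒m<n∨m≡n t≤n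
  ... | inj₁ t<n = begin
    σ (suc n) f  ≈⟨ σ-suc n f ⟩
    σ n f + f n  ≈⟨ +-cong (σ-single n t f t<n (λ i i<n → f≈0 i (ℕₚ.m≤n⇒m≤1+n i<n)))
                           (f≈0 n ℕₚ.≤-refl (λ n≡t → ℕₚ.<-irrefl (≡.sym n≡t) t<n)) ⟩
    f t + 0#     ≈⟨ +-identityʳ _ ⟩
    f t          ∎
  ... | inj₂ ≡.refl = begin
    σ (suc n) f  ≈⟨ σ-suc n f ⟩
    σ n f + f n  ≈⟨ +-identityˡ′ (σ-null n (λ i i<n → f≈0 i (ℕₚ.m≤n⇒m≤1+n i<n) (λ i≡n → ℕₚ.<-irrefl i≡n i<n))) ⟩
    f n          ∎

  σ-reverse : ∀ n f → σ (suc n) f ≈ σ (suc n) (λ i → f (n ∸ i))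
  σ-reverse zero f = σ-cong 1 (λ { zero _ → refl ; (suc i) (s≤s ()) })
  σ-reverse (suc n) f = begin
    σ (suc (suc n)) f                         ≈⟨ σ-suc (suc n) f ⟩
    σ (suc n) f + f (suc n)                   ≈⟨ +-comm _ _ ⟩
    f (suc n) + σ (suc n) f                   ≈⟨ +-congˡ (σ-reverse n f) ⟩
    f (suc n) + σ (suc n) (λ i → f (n ∸ i))   ≈⟨ σ-sucˡ (suc n) _ ⟨
    σ (suc (suc n)) (λ i → f (suc n ∸ i))     ∎

  σ-antidiagonal : ∀ M (F : ℕ → ℕ → Carrier) →
    σ (suc M) (λ ℓ → σ (suc ℓ) (λ k → F (ℓ ∸ k) k)) ≈ σ (suc M) (λ l → σ (suc (M ∸ l)) (F l))
  σ-antidiagonal zero F = σ-cong 1 (λ { zero _ → σ-cong 1 (λ { zero _ → refl ; (suc i) (s≤s ()) })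
                                      ; (suc i) (s≤s ()) })
  σ-antidiagonal (suc M) F = begin
    σ (suc (suc M)) (λ ℓ → σ (suc ℓ) (λ k → F (ℓ ∸ k) k))
      ≈⟨ σ-suc (suc M) _ ⟩
    σ (suc M) (λ ℓ → σ (suc ℓ) (λ k → F (ℓ ∸ k) k)) + σ (suc (suc M)) (λ k → F (suc M ∸ k) k)
      ≈⟨ +-cong (σ-antidiagonal M F) lastDiagonal ⟩
    σ (suc M) (λ l → σ (suc (M ∸ l)) (F l)) + σ (suc (suc M)) (λ l → F l (suc M ∸ l))
      ≈⟨ +-congˡ (σ-suc (suc M) _) ⟩
    σ (suc M) (λ l → σ (suc (M ∸ l)) (F l)) + (σ (suc M) (λ l → F l (suc M ∸ l)) + F (suc M) (suc M ∸ suc M))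
      ≈⟨ +-assoc _ _ _ ⟨
    (σ (suc M) (λ l → σ (suc (M ∸ l)) (F l)) + σ (suc M) (λ l → F l (suc M ∸ l))) + F (suc M) (suc M ∸ suc M)
      ≈⟨ +-cong (σ-+ (suc M) _ _) lastRow ⟨
    σ (suc M) (λ l → σ (suc (M ∸ l)) (F l) + F l (suc M ∸ l)) + σ (suc (suc M ∸ suc M)) (F (suc M))
      ≈⟨ +-congʳ (σ-cong (suc M) extendRow) ⟩
    σ (suc M) (λ l → σ (suc (suc M ∸ l)) (F l)) + σ (suc (suc M ∸ suc M)) (F (suc M))
      ≈⟨ σ-suc (suc M) _ ⟨
    σ (suc (suc M)) (λ l → σ (suc (suc M ∸ l)) (F l)) ∎
    where
    lastDiagonal : σ (suc (suc M)) (λ k → F (suc M ∸ k) k) ≈ σ (suc (suc M)) (λ l → F l (suc M ∸ l))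
    lastDiagonal = trans (σ-reverse (suc M) _) (σ-cong (suc (suc M)) (λ i i<2+M →
      reflexive (≡.cong (λ j → F j (suc M ∸ i)) (ℕₚ.m∸[m∸n]≡n (ℕₚ.≤-pred i<2+M)))))
    lastRow : σ (suc (suc M ∸ suc M)) (F (suc M)) ≈ F (suc M) (suc M ∸ suc M)
    lastRow rewrite ℕₚ.n∸n≡0 M = trans (σ-suc 0 _) (+-identityˡ′ (σ-zero _))
    extendRow : ∀ l → l < suc M → σ (suc (M ∸ l)) (F l) + F l (suc M ∸ l) ≈ σ (suc (suc M ∸ l)) (F l)
    extendRow l (s≤s l≤M) rewrite ℕₚ.+-∸-assoc 1 l≤M = sym (σ-suc _ _)

  σ-cauchy : ∀ A B (F : ℕ → ℕ → Carrier) →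
    (∀ l k → A < l → F l k ≈ 0#) → (∀ l k → B < k → F l k ≈ 0#) →
    σ (suc A) (λ l → σ (suc B) (F l)) ≈ σ (suc (A ℕ.+ B)) (λ ℓ → σ (suc ℓ) (λ k → F (ℓ ∸ k) k))
  σ-cauchy A B F F≈0ˡ F≈0ʳ = begin
    σ (suc A) (λ l → σ (suc B) (F l))                      ≈⟨ σ-cong (suc A) widenRow ⟩
    σ (suc A) (λ l → σ (suc (A ℕ.+ B ∸ l)) (F l))          ≈⟨ σ-truncate _ (s≤s (ℕₚ.m≤m+n A B)) emptyRow ⟨
    σ (suc (A ℕ.+ B)) (λ l → σ (suc (A ℕ.+ B ∸ l)) (F l))  ≈⟨ σ-antidiagonal (A ℕ.+ B) F ⟨
    σ (suc (A ℕ.+ B)) (λ ℓ → σ (suc ℓ) (λ k → F (ℓ ∸ k) k)) ∎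
    where
    widenRow : ∀ l → l < suc A → σ (suc B) (F l) ≈ σ (suc (A ℕ.+ B ∸ l)) (F l)
    widenRow l (s≤s l≤A) = sym (σ-truncate (F l) (s≤s B≤A+B∸l) (λ k B<k _ → F≈0ʳ l k B<k))
      where
      B≤A+B∸l : B ≤ A ℕ.+ B ∸ l
      B≤A+B∸l = ≡.subst (B ≤_) (≡.sym (ℕₚ.+-∸-comm B l≤A)) (ℕₚ.m≤n+m B (A ∸ l))
    emptyRow : ∀ l → suc A ≤ l → l < suc (A ℕ.+ B) → σ (suc (A ℕ.+ B ∸ l)) (F l) ≈ 0#
    emptyRow l A<l _ = σ-null _ (λ k _ → F≈0ˡ l k A<l)

module Evaluation {c ℓ c′ ℓ′ : Level} (K : CommutativeRing c ℓ) (R : Ring c′ ℓ′)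
  (φ : CommutativeRing.Carrier K → Ring.Carrier R)
  (φ-hom : IsRingHomomorphism (CommutativeRing.rawRing K) (Ring.rawRing R) φ)
  (φ-central : ∀ u v → Ring._≈_ R (Ring._*_ R (φ u) v) (Ring._*_ R v (φ u))) where
  open KOps K
  open Ring R
  open SetoidReasoning setoid
  open RingLemmas R
  open IsRingHomomorphism φ-hom

  evalAt : Carrier → Poly → Carrier
  evalAt w []      = 0#
  evalAt w (u ∷ p) = φ u + w * evalAt w p

  evalAt-cong : ∀ {w w′} p → w ≈ w′ → evalAt w p ≈ evalAt w′ p
  evalAt-cong []      _    = refl
  evalAt-cong (u ∷ p) w≈w′ = +-congˡ (*-cong w≈w′ (evalAt-cong p w≈w′))

  evalAt-⊕ : ∀ w p q → evalAt w (p ⊕ q) ≈ evalAt w p + evalAt w q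
  evalAt-⊕ w []      q       = sym (+-identityˡ _)
  evalAt-⊕ w (u ∷ p) []      = sym (+-identityʳ _)
  evalAt-⊕ w (u ∷ p) (v ∷ q) = begin
    φ (u +ᵏ v) + w * evalAt w (p ⊕ q)              ≈⟨ +-cong (+-homo u v) (*-congˡ (evalAt-⊕ w p q)) ⟩
    (φ u + φ v) + w * (evalAt w p + evalAt w q)    ≈⟨ +-congˡ (distribˡ w _ _) ⟩
    (φ u + φ v) + (w * evalAt w p + w * evalAt w q) ≈⟨ +-interchange _ _ _ _ ⟩
    (φ u + w * evalAt w p) + (φ v + w * evalAt w q) ∎

  evalAt-scale : ∀ w u p → evalAt w (scale u p) ≈ φ u * evalAt w p
  evalAt-scale w u []      = sym (zeroʳ _)
  evalAt-scale w u (v ∷ p) = begin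
    φ (u *ᵏ v) + w * evalAt w (scale u p)  ≈⟨ +-cong (*-homo u v) (*-congˡ (evalAt-scale w u p)) ⟩
    φ u * φ v + w * (φ u * evalAt w p)     ≈⟨ +-congˡ (*-assoc _ _ _) ⟨
    φ u * φ v + (w * φ u) * evalAt w p     ≈⟨ +-congˡ (*-congʳ (φ-central u w)) ⟨
    φ u * φ v + (φ u * w) * evalAt w p     ≈⟨ +-congˡ (*-assoc _ _ _) ⟩
    φ u * φ v + φ u * (w * evalAt w p)     ≈⟨ distribˡ _ _ _ ⟨
    φ u * (φ v + w * evalAt w p)           ∎

  evalAt-⊗ : ∀ w p q → evalAt w (p ⊗ q) ≈ evalAt w p * evalAt w q
  evalAt-⊗ w []      q = sym (zeroˡ _)
  evalAt-⊗ w (u ∷ p) q = begin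
    evalAt w (scale u q ⊕ (0ᵏ ∷ (p ⊗ q)))                    ≈⟨ evalAt-⊕ w (scale u q) _ ⟩
    evalAt w (scale u q) + (φ 0ᵏ + w * evalAt w (p ⊗ q))     ≈⟨ +-cong (evalAt-scale w u q) (+-identityˡ′ 0#-homo) ⟩
    φ u * evalAt w q + w * evalAt w (p ⊗ q)                   ≈⟨ +-congˡ (*-congˡ (evalAt-⊗ w p q)) ⟩
    φ u * evalAt w q + w * (evalAt w p * evalAt w q)          ≈⟨ +-congˡ (*-assoc _ _ _) ⟨
    φ u * evalAt w q + (w * evalAt w p) * evalAt w q          ≈⟨ distribʳ _ _ _ ⟨
    (φ u + w * evalAt w p) * evalAt w q                       ∎

  evalAt-C : ∀ w u → evalAt w (C u) ≈ φ u
  evalAt-C w u = +-identityʳ′ (zeroʳ w)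

  evalAt-X : ∀ w → evalAt w X ≈ w
  evalAt-X w = begin
    φ 0ᵏ + w * (φ 1ᵏ + w * 0#)  ≈⟨ +-identityˡ′ 0#-homo ⟩
    w * (φ 1ᵏ + w * 0#)         ≈⟨ *-congˡ (+-identityʳ′ (zeroʳ w)) ⟩
    w * φ 1ᵏ                    ≈⟨ *-congˡ 1#-homo ⟩
    w * 1#                      ≈⟨ *-identityʳ w ⟩
    w                           ∎

  evalAt-compose : ∀ w p q → evalAt w (compose p q) ≈ evalAt (evalAt w q) p
  evalAt-compose w []      q = refl
  evalAt-compose w (u ∷ p) q = begin
    evalAt w (C u ⊕ (q ⊗ compose p q))                  ≈⟨ evalAt-⊕ w (C u) (q ⊗ compose p q) ⟩
    evalAt w (C u) + evalAt w (q ⊗ compose p q)         ≈⟨ +-cong (evalAt-C w u) (evalAt-⊗ w q _) ⟩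
    φ u + evalAt w q * evalAt w (compose p q)           ≈⟨ +-congˡ (*-congˡ (evalAt-compose w p q)) ⟩
    φ u + evalAt w q * evalAt (evalAt w q) p            ∎

  evalAt-intertwineʳ : ∀ {w w′ u} p → w * u ≈ u * w′ → evalAt w p * u ≈ u * evalAt w′ p
  evalAt-intertwineʳ {u = u} [] _ = trans (zeroˡ u) (sym (zeroʳ u))
  evalAt-intertwineʳ {w} {w′} {u} (v ∷ p) wu≈uw′ = begin
    (φ v + w * evalAt w p) * u        ≈⟨ distribʳ _ _ _ ⟩
    φ v * u + (w * evalAt w p) * u    ≈⟨ +-cong (φ-central v u) (*-assoc _ _ _) ⟩
    u * φ v + w * (evalAt w p * u)    ≈⟨ +-congˡ (*-congˡ (evalAt-intertwineʳ p wu≈uw′)) ⟩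
    u * φ v + w * (u * evalAt w′ p)   ≈⟨ +-congˡ (*-assoc _ _ _) ⟨
    u * φ v + (w * u) * evalAt w′ p   ≈⟨ +-congˡ (*-congʳ wu≈uw′) ⟩
    u * φ v + (u * w′) * evalAt w′ p  ≈⟨ +-congˡ (*-assoc _ _ _) ⟩
    u * φ v + u * (w′ * evalAt w′ p)  ≈⟨ distribˡ _ _ _ ⟨
    u * (φ v + w′ * evalAt w′ p)      ∎

  evalAt-intertwineˡ : ∀ {w w′ u} p → u * w ≈ w′ * u → u * evalAt w p ≈ evalAt w′ p * u
  evalAt-intertwineˡ {u = u} [] _ = trans (zeroʳ u) (sym (zeroˡ u))
  evalAt-intertwineˡ {w} {w′} {u} (v ∷ p) uw≈w′u = begin
    u * (φ v + w * evalAt w p)        ≈⟨ distribˡ _ _ _ ⟩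
    u * φ v + u * (w * evalAt w p)    ≈⟨ +-cong (φ-central v u) (*-assoc _ _ _) ⟨
    φ v * u + (u * w) * evalAt w p    ≈⟨ +-congˡ (*-congʳ uw≈w′u) ⟩
    φ v * u + (w′ * u) * evalAt w p   ≈⟨ +-congˡ (*-assoc _ _ _) ⟩
    φ v * u + w′ * (u * evalAt w p)   ≈⟨ +-congˡ (*-congˡ (evalAt-intertwineˡ p uw≈w′u)) ⟩
    φ v * u + w′ * (evalAt w′ p * u)  ≈⟨ +-congˡ (*-assoc _ _ _) ⟨
    φ v * u + (w′ * evalAt w′ p) * u  ≈⟨ distribʳ _ _ _ ⟨
    (φ v + w′ * evalAt w′ p) * u      ∎

module QNumbers {c ℓ : Level} (K : CommutativeRing c ℓ) where
  open KOps K
  open CommutativeRing K hiding (zero)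
  open SetoidReasoning setoid
  open RingLemmas ring
  open NaturalCoefficientSolver commutativeSemiring

  ^ᵏ-distribˡ-+-* : ∀ u i j → u ^ᵏ (i ℕ.+ j) ≈ u ^ᵏ i * u ^ᵏ j
  ^ᵏ-distribˡ-+-* u zero    j = sym (*-identityˡ _)
  ^ᵏ-distribˡ-+-* u (suc i) j = trans (*-congˡ (^ᵏ-distribˡ-+-* u i j)) (sym (*-assoc _ _ _))

  ^ᵏ-congʳ : ∀ u {i j} → i ≡ j → u ^ᵏ i ≈ u ^ᵏ j
  ^ᵏ-congʳ u ≡.refl = refl

  qint-suc : ∀ q r → qint q (suc r) ≈ 1# + q * qint q r
  qint-suc q zero    = solve 1 (λ q → con 0 :+ con 1 := con 1 :+ q :* con 0) refl q
  qint-suc q (suc r) = begin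
    qint q (suc r) + q * q ^ᵏ r         ≈⟨ +-congʳ (qint-suc q r) ⟩
    (1# + q * qint q r) + q * q ^ᵏ r    ≈⟨ solve 3 (λ q I E → (con 1 :+ q :* I) :+ q :* E := con 1 :+ q :* (I :+ E))
                                                    refl q (qint q r) (q ^ᵏ r) ⟩
    1# + q * (qint q r + q ^ᵏ r)        ∎

  qint-+ : ∀ q i j → qint q (i ℕ.+ j) ≈ qint q i + q ^ᵏ i * qint q j
  qint-+ q zero    j = solve 1 (λ J → J := con 0 :+ con 1 :* J) refl (qint q j)
  qint-+ q (suc i) j = begin
    qint q (suc (i ℕ.+ j))                         ≈⟨ qint-suc q (i ℕ.+ j) ⟩
    1# + q * qint q (i ℕ.+ j)                      ≈⟨ +-congˡ (*-congˡ (qint-+ q i j)) ⟩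
    1# + q * (qint q i + q ^ᵏ i * qint q j)        ≈⟨ solve 4 (λ q I E J → con 1 :+ q :* (I :+ E :* J)
                                                                       := (con 1 :+ q :* I) :+ (q :* E) :* J)
                                                               refl q (qint q i) (q ^ᵏ i) (qint q j) ⟩
    (1# + q * qint q i) + (q * q ^ᵏ i) * qint q j  ≈⟨ +-congʳ (qint-suc q i) ⟨
    qint q (suc i) + q ^ᵏ suc i * qint q j         ∎

  qbin-vanish : ∀ q r k → r < k → qbin q r k ≈ 0#
  qbin-vanish q zero    (suc k) _         = refl
  qbin-vanish q (suc r) (suc k) (s≤s r<k) =
    trans (+-cong (qbin-vanish q r k r<k) (zeroʳ′ _ (qbin-vanish q r (suc k) (ℕₚ.m≤n⇒m≤1+n r<k))))
          (+-identityʳ 0#)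

  qbin-pascal′ : ∀ q n j → qbin q (suc n) (suc j) ≈ qbin q n (suc j) + q ^ᵏ (n ∸ j) * qbin q n j
  qbin-pascal′ q zero    zero    = solve 1 (λ q → con 1 :+ (q :* con 1) :* con 0 := con 0 :+ con 1 :* con 1) refl q
  qbin-pascal′ q zero    (suc j) = solve 1 (λ E → con 0 :+ E :* con 0 := con 0 :+ con 1 :* con 0) refl (q ^ᵏ suc (suc j))
  qbin-pascal′ q (suc n) zero    = begin
    1# + (q * 1#) * qbin q (suc n) 1                ≈⟨ +-congˡ (*-congˡ (qbin-pascal′ q n zero)) ⟩
    1# + (q * 1#) * (qbin q n 1 + q ^ᵏ n * 1#)      ≈⟨ solve 3 (λ q B E → con 1 :+ (q :* con 1) :* (B :+ E :* con 1)
                                                                     := (con 1 :+ (q :* con 1) :* B) :+ (q :* E) :* con 1)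
                                                             refl q (qbin q n 1) (q ^ᵏ n) ⟩
    (1# + (q * 1#) * qbin q n 1) + (q * q ^ᵏ n) * 1# ∎
  qbin-pascal′ q (suc n) (suc j) = begin
    qbin q (suc n) (suc j) + q² * qbin q (suc n) (suc (suc j))
      ≈⟨ +-cong (qbin-pascal′ q n j) (*-congˡ (qbin-pascal′ q n (suc j))) ⟩
    (B₁ + qᵈ * B₀) + q² * (B₂ + q ^ᵏ (n ∸ suc j) * B₁)
      ≈⟨ solve 6 (λ B₁ B₀ B₂ qᵈ q² qᵉ → (B₁ :+ qᵈ :* B₀) :+ q² :* (B₂ :+ qᵉ :* B₁)
                                      := (B₁ :+ qᵈ :* B₀) :+ (q² :* B₂ :+ q² :* qᵉ :* B₁))
               refl B₁ B₀ B₂ qᵈ q² (q ^ᵏ (n ∸ suc j)) ⟩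
    (B₁ + qᵈ * B₀) + (q² * B₂ + q² * q ^ᵏ (n ∸ suc j) * B₁) ≈⟨ +-congˡ (+-congˡ exponents) ⟩
    (B₁ + qᵈ * B₀) + (q² * B₂ + qᵈ * q¹ * B₁)
      ≈⟨ solve 6 (λ B₁ B₀ B₂ qᵈ q² q¹ → (B₁ :+ qᵈ :* B₀) :+ (q² :* B₂ :+ qᵈ :* q¹ :* B₁)
                                      := (B₁ :+ q² :* B₂) :+ qᵈ :* (B₀ :+ q¹ :* B₁))
               refl B₁ B₀ B₂ qᵈ q² q¹ ⟩
    (B₁ + q² * B₂) + qᵈ * (B₀ + q¹ * B₁) ∎
    where
    B₀ = qbin q n j
    B₁ = qbin q n (suc j)
    B₂ = qbin q n (suc (suc j))
    qᵈ = q ^ᵏ (n ∸ j)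
    q¹ = q ^ᵏ suc j
    q² = q ^ᵏ suc (suc j)
    exponents : q² * q ^ᵏ (n ∸ suc j) * B₁ ≈ qᵈ * q¹ * B₁
    exponents with ℕₚ.<-cmp j n
    ... | tri< j<n _ _ = *-congʳ (begin
      q * q¹ * q ^ᵏ (n ∸ suc j)  ≈⟨ solve 3 (λ q a e → q :* a :* e := (q :* e) :* a) refl q q¹ (q ^ᵏ (n ∸ suc j)) ⟩
      q ^ᵏ suc (n ∸ suc j) * q¹  ≈⟨ *-congʳ (^ᵏ-congʳ q (≡.sym (ℕₚ.+-∸-assoc 1 j<n))) ⟩
      qᵈ * q¹                    ∎)
    ... | tri≈ _ ≡.refl _ = trans (zeroʳ′ _ (qbin-vanish q n (suc n) ℕₚ.≤-refl))
                                  (sym (zeroʳ′ _ (qbin-vanish q n (suc n) ℕₚ.≤-refl)))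
    ... | tri> _ _ n<j = trans (zeroʳ′ _ (qbin-vanish q n (suc j) (ℕₚ.m≤n⇒m≤1+n n<j)))
                               (sym (zeroʳ′ _ (qbin-vanish q n (suc j) (ℕₚ.m≤n⇒m≤1+n n<j))))

  qfalling : Kc → ℕ → ℕ → Kc
  qfalling q m zero    = 1#
  qfalling q m (suc k) = qfalling q m k * qint q (m ∸ k)

  qfalling-vanish : ∀ q m k → m < k → qfalling q m k ≈ 0#
  qfalling-vanish q m (suc k) (s≤s m≤k) with ℕₚ.m≤n⇒m<n∨m≡n m≤k
  ... | inj₁ m<k    = zeroˡ′ _ (qfalling-vanish q m k m<k)
  ... | inj₂ ≡.refl = zeroʳ′ _ (reflexive (≡.cong (qint q) (ℕₚ.n∸n≡0 m)))

  qfalling-suc : ∀ q m j → qfalling q (suc m) (suc j) ≈ qint q (suc m) * qfalling q m j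
  qfalling-suc q m zero    = *-comm _ _
  qfalling-suc q m (suc j) = trans (*-congʳ (qfalling-suc q m j)) (*-assoc _ _ _)

  qbin*qfact≈qfalling : ∀ q m k → qbin q m k * qfact q k ≈ qfalling q m k
  qbin*qfact≈qfalling q zero    zero    = *-identityˡ _
  qbin*qfact≈qfalling q zero    (suc k) = trans (zeroˡ _) (sym (zeroʳ′ _ (reflexive (≡.cong (qint q) (ℕₚ.0∸n≡0 k)))))
  qbin*qfact≈qfalling q (suc m) zero    = *-identityˡ _
  qbin*qfact≈qfalling q (suc m) (suc j) = begin
    (qbin q m j + q ^ᵏ suc j * qbin q m (suc j)) * (qfact q j * qint q (suc j))
      ≈⟨ solve 5 (λ A E B F I → (A :+ E :* B) :* (F :* I) := (A :* F) :* I :+ E :* (B :* (F :* I))) refl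
               (qbin q m j) (q ^ᵏ suc j) (qbin q m (suc j)) (qfact q j) (qint q (suc j)) ⟩
    (qbin q m j * qfact q j) * qint q (suc j) + q ^ᵏ suc j * (qbin q m (suc j) * qfact q (suc j))
      ≈⟨ +-cong (*-congʳ (qbin*qfact≈qfalling q m j)) (*-congˡ (qbin*qfact≈qfalling q m (suc j))) ⟩
    qfalling q m j * qint q (suc j) + q ^ᵏ suc j * (qfalling q m j * qint q (m ∸ j))
      ≈⟨ solve 4 (λ g i e k → g :* i :+ e :* (g :* k) := (i :+ e :* k) :* g) refl
               (qfalling q m j) (qint q (suc j)) (q ^ᵏ suc j) (qint q (m ∸ j)) ⟩
    (qint q (suc j) + q ^ᵏ suc j * qint q (m ∸ j)) * qfalling q m j ≈⟨ splitLast ⟩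
    qint q (suc m) * qfalling q m j                                 ≈⟨ qfalling-suc q m j ⟨
    qfalling q (suc m) (suc j)                                      ∎
    where
    splitLast : (qint q (suc j) + q ^ᵏ suc j * qint q (m ∸ j)) * qfalling q m j ≈ qint q (suc m) * qfalling q m j
    splitLast with j ℕₚ.≤? m
    ... | yes j≤m = *-congʳ (trans (sym (qint-+ q (suc j) (m ∸ j)))
                                   (reflexive (≡.cong (qint q ∘′ suc) (ℕₚ.m+[n∸m]≡n j≤m))))
    ... | no  j≰m = trans (zeroʳ′ _ (qfalling-vanish q m j (ℕₚ.≰⇒> j≰m)))
                          (sym (zeroʳ′ _ (qfalling-vanish q m j (ℕₚ.≰⇒> j≰m))))

  qbin*qfact-suc : ∀ q m k → qbin q m (suc k) * qfact q (suc k) ≈ (qbin q m k * qfact q k) * qint q (m ∸ k)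
  qbin*qfact-suc q m k = trans (qbin*qfact≈qfalling q m (suc k)) (*-congʳ (sym (qbin*qfact≈qfalling q m k)))

module Basics {c ℓ c′ ℓ′ : Level} (K : CommutativeRing c ℓ) (A : Ring c′ ℓ′)
  (ι : CommutativeRing.Carrier K → Ring.Carrier A)
  (β b : CommutativeRing.Carrier K) (x y z : Ring.Carrier A)
  (isAlg : Setting.IsKAlgebra K A ι β b x y z) where

  open Setting K A ι β b x y z hiding (zero)
  open SetoidReasoning setoid
  open RingLemmas A public
  open RingProperties A using (x[y-z]≈xy-xz; [y-z]x≈yx-zx; -‿distribˡ-*) public
  module K = CommutativeRing K
  open IsRingHomomorphism (proj₁ isAlg) public
    renaming (⟦⟧-cong to ι-cong; +-homo to ι-+; *-homo to ι-*; 0#-homo to ι-0; 1#-homo to ι-1; -‿homo to ι-neg)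

  ι-central : ∀ u v → ι u * v ≈ v * ι u
  ι-central = proj₂ isAlg

  module ΣA = FiniteSums A Σ< (λ _ → refl) (λ _ _ → refl)
  module ΣK = FiniteSums K.ring Σᵏ< (λ _ → K.refl) (λ _ _ → K.refl)
  module EvA = Evaluation K A ι (proj₁ isAlg) ι-central
  open EvA public using (evalAt)

  ev≡evalAt : ∀ p → ev p ≡ evalAt y p
  ev≡evalAt []      = ≡.refl
  ev≡evalAt (u ∷ p) = ≡.cong (λ t → ι u + y * t) (ev≡evalAt p)

  ι-σ : ∀ n f → ι (Σᵏ< n f) ≈ Σ< n (λ i → ι (f i))
  ι-σ zero    f = ι-0
  ι-σ (suc n) f = trans (ι-+ _ _) (+-congʳ (ι-σ n f))

  castA≈ι∘castᵏ : ∀ n → castA n ≈ ι (castᵏ n)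
  castA≈ι∘castᵏ zero    = sym ι-0
  castA≈ι∘castᵏ (suc n) = trans (+-cong (sym ι-1) (castA≈ι∘castᵏ n)) (sym (ι-+ _ _))

  castA-central : ∀ n v → castA n * v ≈ v * castA n
  castA-central n v = trans (*-congʳ (castA≈ι∘castᵏ n)) (trans (ι-central _ v) (*-congˡ (sym (castA≈ι∘castᵏ n))))

  [u-v]-w≈u-[v+w] : ∀ u v w → (u - v) - w ≈ u - (v + w)
  [u-v]-w≈u-[v+w] u v w = trans (+-assoc _ _ _)
    (+-congˡ (sym (trans (GroupProperties.⁻¹-anti-homo-∙ +-group v w) (+-comm _ _))))

  x-y≈z⇒x≈z+y : ∀ {u v w} → u - v ≈ w → u ≈ w + v
  x-y≈z⇒x≈z+y {u} {v} {w} u-v≈w = begin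
    u             ≈⟨ +-identityʳ′ (-‿inverseˡ v) ⟨
    u + (- v + v) ≈⟨ +-assoc _ _ _ ⟨
    (u - v) + v   ≈⟨ +-congʳ u-v≈w ⟩
    w + v         ∎

  x-y≈z⇒y≈x-z : ∀ {u v w} → u - v ≈ w → v ≈ u - w
  x-y≈z⇒y≈x-z {u} {v} {w} u-v≈w = begin
    v               ≈⟨ +-identityˡ′ (-‿inverseʳ u) ⟨
    (u - u) + v     ≈⟨ +-assoc _ _ _ ⟩
    u + (- u + v)   ≈⟨ +-congˡ (+-comm _ _) ⟩
    u + (v - u)     ≈⟨ +-congˡ (AbelianGroupProperties.⁻¹-anti-homo‿- +-abelianGroup u v) ⟨
    u - (u - v)     ≈⟨ +-congˡ (-‿cong u-v≈w) ⟩
    u - w           ∎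

  y-_ : ℕ → Carrier
  y- d = y - castA d

  w-castA0≈w : ∀ w → w - castA 0 ≈ w
  w-castA0≈w w = trans (+-congˡ (GroupProperties.ε⁻¹≈ε +-group)) (+-identityʳ w)

  [y-c][y-d]≈[y-d][y-c] : ∀ c d → (y- c) * (y- d) ≈ (y- d) * (y- c)
  [y-c][y-d]≈[y-d][y-c] c d = begin
    (y - castA c) * (y- d)            ≈⟨ [y-z]x≈yx-zx (y- d) y _ ⟩
    y * (y- d) - castA c * (y- d)     ≈⟨ +-cong y*y-d (-‿cong (castA-central c (y- d))) ⟩
    (y- d) * y - (y- d) * castA c     ≈⟨ x[y-z]≈xy-xz (y- d) y _ ⟨
    (y- d) * (y - castA c)            ∎
    where
    y*y-d : y * (y- d) ≈ (y- d) * y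
    y*y-d = begin
      y * (y - castA d)          ≈⟨ x[y-z]≈xy-xz y y _ ⟩
      y * y - y * castA d        ≈⟨ +-congˡ (-‿cong (castA-central d y)) ⟨
      y * y - castA d * y        ≈⟨ [y-z]x≈yx-zx y y _ ⟨
      (y - castA d) * y          ∎

  ^-distribˡ-+-* : ∀ u i j → u ^ (i ℕ.+ j) ≈ u ^ i * u ^ j
  ^-distribˡ-+-* u zero    j = sym (*-identityˡ _)
  ^-distribˡ-+-* u (suc i) j = trans (*-congˡ (^-distribˡ-+-* u i j)) (sym (*-assoc _ _ _))

  ^-congʳ : ∀ u {i j} → i ≡ j → u ^ i ≈ u ^ j
  ^-congʳ u ≡.refl = refl

  ^-congˡ : ∀ {u v} n → u ≈ v → u ^ n ≈ v ^ n
  ^-congˡ zero    _   = refl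
  ^-congˡ (suc n) u≈v = *-cong u≈v (^-congˡ n u≈v)

  ^-sucʳ : ∀ u n → u ^ suc n ≈ u ^ n * u
  ^-sucʳ u n = trans (^-congʳ u (ℕₚ.+-comm 1 n)) (trans (^-distribˡ-+-* u n 1) (*-congˡ (*-identityʳ u)))

  ^-intertwineʳ : ∀ {w w′ u} n → w * u ≈ u * w′ → w ^ n * u ≈ u * w′ ^ n
  ^-intertwineʳ zero _ = trans (*-identityˡ _) (sym (*-identityʳ _))
  ^-intertwineʳ {w} {w′} {u} (suc n) wu≈uw′ = begin
    (w * w ^ n) * u     ≈⟨ *-assoc _ _ _ ⟩
    w * (w ^ n * u)     ≈⟨ *-congˡ (^-intertwineʳ n wu≈uw′) ⟩
    w * (u * w′ ^ n)    ≈⟨ *-assoc _ _ _ ⟨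
    (w * u) * w′ ^ n    ≈⟨ *-congʳ wu≈uw′ ⟩
    (u * w′) * w′ ^ n   ≈⟨ *-assoc _ _ _ ⟩
    u * (w′ * w′ ^ n)   ∎

  ^-intertwineˡ : ∀ {w w′ u} n → u * w ≈ w′ * u → u * w ^ n ≈ w′ ^ n * u
  ^-intertwineˡ zero _ = trans (*-identityʳ _) (sym (*-identityˡ _))
  ^-intertwineˡ {w} {w′} {u} (suc n) uw≈w′u = begin
    u * (w * w ^ n)     ≈⟨ *-assoc _ _ _ ⟨
    (u * w) * w ^ n     ≈⟨ *-congʳ uw≈w′u ⟩
    (w′ * u) * w ^ n    ≈⟨ *-assoc _ _ _ ⟩
    w′ * (u * w ^ n)    ≈⟨ *-congˡ (^-intertwineˡ n uw≈w′u) ⟩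
    w′ * (w′ ^ n * u)   ≈⟨ *-assoc _ _ _ ⟨
    (w′ * w′ ^ n) * u   ∎

  evalAt-X- : ∀ w n → evalAt w (X- n) ≈ w - castA n
  evalAt-X- w n = begin
    evalAt w (X ⊕ C (-ᵏ castᵏ n))               ≈⟨ EvA.evalAt-⊕ w X (C (-ᵏ castᵏ n)) ⟩
    evalAt w X + evalAt w (C (-ᵏ castᵏ n))      ≈⟨ +-cong (EvA.evalAt-X w) (EvA.evalAt-C w _) ⟩
    w + ι (-ᵏ castᵏ n)                          ≈⟨ +-congˡ (trans (ι-neg _) (-‿cong (sym (castA≈ι∘castᵏ n)))) ⟩
    w - castA n                                 ∎

  evalAt-shift : ∀ w p n → evalAt w (shift p n) ≈ evalAt (w - castA n) p
  evalAt-shift w p n = trans (EvA.evalAt-compose w p (X- n)) (EvA.evalAt-cong p (evalAt-X- w n))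

  evalAt-^ₚ : ∀ w p n → evalAt w (p ^ₚ n) ≈ evalAt w p ^ n
  evalAt-^ₚ w p zero    = trans (EvA.evalAt-C w 1ᵏ) ι-1
  evalAt-^ₚ w p (suc n) = trans (EvA.evalAt-⊗ w p (p ^ₚ n)) (*-congˡ (evalAt-^ₚ w p n))

  evalAt-Σₚ : ∀ w n f → evalAt w (Σₚ< n f) ≈ Σ< n (λ i → evalAt w (f i))
  evalAt-Σₚ w zero    f = refl
  evalAt-Σₚ w (suc n) f = trans (EvA.evalAt-⊕ w (Σₚ< n f) (f n)) (+-congʳ (evalAt-Σₚ w n f))

  ev≈evalAt-y-0 : ∀ p → ev p ≈ evalAt (y- 0) p
  ev≈evalAt-y-0 p = trans (reflexive (ev≡evalAt p)) (EvA.evalAt-cong p (sym (w-castA0≈w y)))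

  ev-C : ∀ u → ev (C u) ≈ ι u
  ev-C u = trans (reflexive (ev≡evalAt (C u))) (EvA.evalAt-C y u)

  ι-merge : ∀ s u v → s * ι u * ι v ≈ s * ι (u *ᵏ v)
  ι-merge s u v = trans (*-assoc _ _ _) (*-congˡ (sym (ι-* u v)))

  ι-pull : ∀ s u t v → (s * ι u) * (t * ι v) ≈ (s * t) * ι (u *ᵏ v)
  ι-pull s u t v = begin
    (s * ι u) * (t * ι v)   ≈⟨ *-assoc _ _ _ ⟩
    s * (ι u * (t * ι v))   ≈⟨ *-congˡ (*-assoc _ _ _) ⟨
    s * ((ι u * t) * ι v)   ≈⟨ *-congˡ (*-congʳ (ι-central u t)) ⟩
    s * ((t * ι u) * ι v)   ≈⟨ *-congˡ (ι-merge t u v) ⟩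
    s * (t * ι (u *ᵏ v))    ≈⟨ *-assoc _ _ _ ⟨
    (s * t) * ι (u *ᵏ v)    ∎

  term-+ : ∀ s t u v → s * ι u * t + s * ι v * t ≈ s * ι (u +ᵏ v) * t
  term-+ s t u v = trans (sym (distribʳ t _ _)) (*-congʳ (trans (sym (distribˡ s _ _)) (*-congˡ (sym (ι-+ u v)))))

  term-null : ∀ s t {u} → u ≈ᵏ 0ᵏ → s * ι u * t ≈ 0#
  term-null s t u≈0 = zeroˡ′ t (zeroʳ′ s (trans (ι-cong u≈0) ι-0))

  term-cong : ∀ s t {u v} → u ≈ᵏ v → s * ι u * t ≈ s * ι v * t
  term-cong s t u≈v = *-congʳ (*-congˡ (ι-cong u≈v))

module Coefficients {c ℓ c′ ℓ′ : Level} (K : CommutativeRing c ℓ) (A : Ring c′ ℓ′)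
  (ι : CommutativeRing.Carrier K → Ring.Carrier A)
  (β b : CommutativeRing.Carrier K) (x y z : Ring.Carrier A) where

  open Setting K A ι β b x y z using (W; E)
  open KOps K
  open CommutativeRing K hiding (zero)
  open SetoidReasoning setoid
  open RingLemmas ring
  open QNumbers K
  open NaturalCoefficientSolver commutativeSemiring
  module EvK = Evaluation K ring id (IdentityMorphism.isRingHomomorphism rawRing refl) *-comm

  bqint : ℕ → Kc
  bqint j = b * qint β j

  bqint-suc : ∀ j → bqint (suc j) ≈ β * bqint j + b
  bqint-suc j = trans (*-congˡ (qint-suc β j))
    (solve 3 (λ b β Q → b :* (con 1 :+ β :* Q) := β :* (b :* Q) :+ b) refl b β (qint β j))

  bqint-0 : bqint 0 ≈ 0#
  bqint-0 = zeroʳ b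

  bqint-1 : bqint 1 ≈ b
  bqint-1 = trans (bqint-suc 0) (trans (+-congʳ (zeroʳ′ β bqint-0)) (+-identityˡ b))

  Wpred : ℕ → ℕ → ℕ → Kc
  Wpred m n zero    = 0#
  Wpred m n (suc k) = W m n k

  W-suc : ∀ m n k → k ≤ m → W m (suc n) k ≡ β ^ᵏ (m ∸ k) * W m n k + bqint (suc (m ∸ k)) * Wpred m n k
  W-suc m n zero    _   = ≡.refl
  W-suc m n (suc k) k≤m = if-≤ᵇ-true k≤m

  W-vanishᵐ : ∀ m n k → m < k → W m n k ≈ 0#
  W-vanishᵐ m zero    (suc k) _   = refl
  W-vanishᵐ m (suc n) zero    ()
  W-vanishᵐ m (suc n) (suc k) m<k = reflexive (if-≤ᵇ-false m<k)

  W-vanishⁿ : ∀ m n k → n < k → W m n k ≈ 0#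
  W-vanishⁿ m zero    (suc k) _ = refl
  W-vanishⁿ m (suc n) (suc k) (s≤s n<k) with suc k ℕₚ.≤? m
  ... | no  k≰m = W-vanishᵐ m (suc n) (suc k) (ℕₚ.≰⇒> k≰m)
  ... | yes k<m = begin
    W m (suc n) (suc k)                                           ≡⟨ W-suc m n (suc k) k<m ⟩
    β ^ᵏ (m ∸ suc k) * W m n (suc k) + bqint (suc (m ∸ suc k)) * W m n k
      ≈⟨ +-cong (zeroʳ′ _ (W-vanishⁿ m n (suc k) (ℕₚ.m≤n⇒m≤1+n n<k))) (zeroʳ′ _ (W-vanishⁿ m n k n<k)) ⟩
    0# + 0#                                                       ≈⟨ +-identityˡ 0# ⟩
    0#                                                            ∎

  W-explicit : ℕ → ℕ → ℕ → Kc
  W-explicit m n k = β ^ᵏ ((m ∸ k) ℕ.* (n ∸ k)) * b ^ᵏ k * qbin β n k * qbin β m k * qfact β k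

  β-absorb-W-explicit : ∀ m n j → β ^ᵏ (m ∸ suc j) * W-explicit m n (suc j)
    ≈ β ^ᵏ ((m ∸ suc j) ℕ.* (n ∸ j)) * (b * b ^ᵏ j) * qbin β n (suc j) * qbin β m (suc j) * qfact β (suc j)
  β-absorb-W-explicit m n j with j ℕₚ.<? n
  ... | yes j<n = begin
    β ^ᵏ a * (β ^ᵏ (a ℕ.* (n ∸ suc j)) * B * Qn * Qm * F)
      ≈⟨ solve 6 (λ βᵃ E B Qn Qm F → βᵃ :* (E :* B :* Qn :* Qm :* F) := (βᵃ :* E) :* B :* Qn :* Qm :* F) refl
                 (β ^ᵏ a) (β ^ᵏ (a ℕ.* (n ∸ suc j))) B Qn Qm F ⟩
    (β ^ᵏ a * β ^ᵏ (a ℕ.* (n ∸ suc j))) * B * Qn * Qm * F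
      ≈⟨ *-congʳ (*-congʳ (*-congʳ (*-congʳ (trans (sym (^ᵏ-distribˡ-+-* β a _))
            (^ᵏ-congʳ β (≡.trans (≡.sym (ℕₚ.*-suc a (n ∸ suc j))) (≡.cong (a ℕ.*_) (≡.sym (m∸n≡1+m∸[1+n] n j j<n))))))))) ⟩
    β ^ᵏ (a ℕ.* (n ∸ j)) * B * Qn * Qm * F ∎
    where
    a = m ∸ suc j
    B = b * b ^ᵏ j
    Qn = qbin β n (suc j)
    Qm = qbin β m (suc j)
    F = qfact β (suc j)
  ... | no j≮n = trans (zeroʳ′ _ (vanishing _)) (sym (vanishing _))
    where
    vanishing : ∀ E → E * (b * b ^ᵏ j) * qbin β n (suc j) * qbin β m (suc j) * qfact β (suc j) ≈ 0#
    vanishing E = trans (*-congʳ (*-congʳ (*-congˡ (qbin-vanish β n (suc j) (s≤s (ℕₚ.≮⇒≥ j≮n))))))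
                        (solve 4 (λ E B M F → E :* B :* con 0 :* M :* F := con 0) refl E (b * b ^ᵏ j) (qbin β m (suc j)) (qfact β (suc j)))

  W-explicit-suc : ∀ m n j → j < m →
    W-explicit m (suc n) (suc j) ≈ β ^ᵏ (m ∸ suc j) * W-explicit m n (suc j) + bqint (suc (m ∸ suc j)) * W-explicit m n j
  W-explicit-suc m n j j<m = sym (begin
    β ^ᵏ a * W-explicit m n (suc j) + (b * I) * W-explicit m n j
      ≈⟨ +-cong (β-absorb-W-explicit m n j) (*-congˡ lastTerm) ⟩
    E₁ * (b * Bʲ) * Qn₁ * Qm₁ * F₁ + (b * I) * ((βᵈ * E₁) * Bʲ * Qn₀ * Qm₀ * F₀)
      ≈⟨ +-congˡ (solve 8 (λ b I βᵈ E₁ Bʲ Qn₀ Qm₀ F₀ →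
             (b :* I) :* ((βᵈ :* E₁) :* Bʲ :* Qn₀ :* Qm₀ :* F₀) := E₁ :* b :* Bʲ :* βᵈ :* Qn₀ :* (Qm₀ :* F₀ :* I))
             refl b I βᵈ E₁ Bʲ Qn₀ Qm₀ F₀) ⟩
    E₁ * (b * Bʲ) * Qn₁ * Qm₁ * F₁ + E₁ * b * Bʲ * βᵈ * Qn₀ * (Qm₀ * F₀ * I)
      ≈⟨ +-congˡ (*-congˡ (sym qbin*qfact-step)) ⟩
    E₁ * (b * Bʲ) * Qn₁ * Qm₁ * F₁ + E₁ * b * Bʲ * βᵈ * Qn₀ * (Qm₁ * F₁)
      ≈⟨ solve 8 (λ E₁ b Bʲ Qn₁ Qm₁ F₁ βᵈ Qn₀ →
             E₁ :* (b :* Bʲ) :* Qn₁ :* Qm₁ :* F₁ :+ E₁ :* b :* Bʲ :* βᵈ :* Qn₀ :* (Qm₁ :* F₁)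
             := E₁ :* (b :* Bʲ) :* (Qn₁ :+ βᵈ :* Qn₀) :* Qm₁ :* F₁) refl E₁ b Bʲ Qn₁ Qm₁ F₁ βᵈ Qn₀ ⟩
    E₁ * (b * Bʲ) * (Qn₁ + βᵈ * Qn₀) * Qm₁ * F₁
      ≈⟨ *-congʳ (*-congʳ (*-congˡ (sym (qbin-pascal′ β n j)))) ⟩
    W-explicit m (suc n) (suc j) ∎)
    where
    a = m ∸ suc j
    I = qint β (suc a)
    E₁ = β ^ᵏ (a ℕ.* (n ∸ j))
    βᵈ = β ^ᵏ (n ∸ j)
    Bʲ = b ^ᵏ j
    Qn₀ = qbin β n j
    Qn₁ = qbin β n (suc j)
    Qm₀ = qbin β m j
    Qm₁ = qbin β m (suc j)
    F₀ = qfact β j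
    F₁ = qfact β (suc j)
    m∸j≡1+a : m ∸ j ≡ suc a
    m∸j≡1+a = m∸n≡1+m∸[1+n] m j j<m
    qbin*qfact-step : Qm₁ * F₁ ≈ Qm₀ * F₀ * I
    qbin*qfact-step = trans (qbin*qfact-suc β m j) (*-congˡ (reflexive (≡.cong (qint β) m∸j≡1+a)))
    lastTerm : W-explicit m n j ≈ (βᵈ * E₁) * Bʲ * Qn₀ * Qm₀ * F₀
    lastTerm = *-congʳ (*-congʳ (*-congʳ (*-congʳ
      (trans (^ᵏ-congʳ β (≡.cong (ℕ._* (n ∸ j)) m∸j≡1+a)) (^ᵏ-distribˡ-+-* β (n ∸ j) (a ℕ.* (n ∸ j)))))))

  W≈W-explicit : ∀ m n k → k ≤ m → W m n k ≈ W-explicit m n k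
  W≈W-explicit m zero zero _ = begin
    1#                          ≈⟨ solve 0 (con 1 := con 1 :* con 1 :* con 1 :* con 1 :* con 1) refl ⟩
    1# * 1# * 1# * 1# * 1#      ≈⟨ *-congʳ (*-congʳ (*-congʳ (*-congʳ (^ᵏ-congʳ β (≡.sym (ℕₚ.*-zeroʳ m)))))) ⟩
    W-explicit m zero zero      ∎
  W≈W-explicit m zero (suc k) _ = sym (solve 4 (λ P B M F → P :* B :* con 0 :* M :* F := con 0) refl
                                        (β ^ᵏ ((m ∸ suc k) ℕ.* 0)) (b ^ᵏ suc k) (qbin β m (suc k)) (qfact β (suc k)))
  W≈W-explicit m (suc n) zero _ = begin
    W m (suc n) zero                                              ≡⟨ W-suc m n zero z≤n ⟩
    β ^ᵏ m * W m n zero + bqint (suc m) * 0#                      ≈⟨ +-congʳ (*-congˡ (W≈W-explicit m n zero z≤n)) ⟩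
    β ^ᵏ m * (β ^ᵏ (m ℕ.* n) * 1# * 1# * 1# * 1#) + bqint (suc m) * 0#
      ≈⟨ solve 3 (λ E₁ E₂ Q → E₁ :* (E₂ :* con 1 :* con 1 :* con 1 :* con 1) :+ Q :* con 0
                            := (E₁ :* E₂) :* con 1 :* con 1 :* con 1 :* con 1) refl
                (β ^ᵏ m) (β ^ᵏ (m ℕ.* n)) (bqint (suc m)) ⟩
    (β ^ᵏ m * β ^ᵏ (m ℕ.* n)) * 1# * 1# * 1# * 1#
      ≈⟨ *-congʳ (*-congʳ (*-congʳ (*-congʳ (trans (sym (^ᵏ-distribˡ-+-* β m (m ℕ.* n)))
                                                   (^ᵏ-congʳ β (≡.sym (ℕₚ.*-suc m n))))))) ⟩
    W-explicit m (suc n) zero                                     ∎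
  W≈W-explicit m (suc n) (suc j) j<m = begin
    W m (suc n) (suc j)                                                    ≡⟨ W-suc m n (suc j) j<m ⟩
    β ^ᵏ (m ∸ suc j) * W m n (suc j) + bqint (suc (m ∸ suc j)) * W m n j
      ≈⟨ +-cong (*-congˡ (W≈W-explicit m n (suc j) j<m)) (*-congˡ (W≈W-explicit m n j (ℕₚ.<⇒≤ j<m))) ⟩
    β ^ᵏ (m ∸ suc j) * W-explicit m n (suc j) + bqint (suc (m ∸ suc j)) * W-explicit m n j
      ≈⟨ W-explicit-suc m n j j<m ⟨
    W-explicit m (suc n) (suc j)                                           ∎

  W¹₀ : ∀ n → W 1 n 0 ≈ β ^ᵏ n
  W¹₀ zero    = refl
  W¹₀ (suc n) = begin
    W 1 (suc n) 0                           ≡⟨ W-suc 1 n 0 z≤n ⟩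
    (β * 1#) * W 1 n 0 + bqint 2 * 0#       ≈⟨ +-cong (*-cong (*-identityʳ β) (W¹₀ n)) (zeroʳ _) ⟩
    β * β ^ᵏ n + 0#                         ≈⟨ +-identityʳ _ ⟩
    β ^ᵏ suc n                              ∎

  W¹₁ : ∀ n → W 1 n 1 ≈ bqint n
  W¹₁ zero    = sym (zeroʳ b)
  W¹₁ (suc n) = begin
    W 1 (suc n) 1                           ≡⟨ W-suc 1 n 1 (s≤s z≤n) ⟩
    1# * W 1 n 1 + bqint 1 * W 1 n 0        ≈⟨ +-cong (*-congˡ (W¹₁ n)) (*-cong bqint-1 (W¹₀ n)) ⟩
    1# * (b * qint β n) + b * β ^ᵏ n        ≈⟨ solve 3 (λ b Q E → con 1 :* (b :* Q) :+ b :* E := b :* (Q :+ E))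
                                                       refl b (qint β n) (β ^ᵏ n) ⟩
    bqint (suc n)                           ∎

  Epredᵏ Epredⁱ : ℕ → ℕ → ℕ → Poly
  Epredᵏ n i zero    = []
  Epredᵏ n i (suc k) = E n i k
  Epredⁱ n zero    k = []
  Epredⁱ n (suc i) k = E n i k

  E-suc : ∀ n i k → E (suc n) i k ≡ (if (i ℕ.+ k) ℕ.≤ᵇ suc n
            then (Epredᵏ n i k ⊕ scale (β ^ᵏ k) (Epredⁱ n i k)) ⊕ (scale (qint β (suc k)) X ⊗ E n i (suc k))
            else [])
  E-suc n zero    zero    = ≡.refl
  E-suc n zero    (suc k) = ≡.refl
  E-suc n (suc i) zero    = ≡.refl
  E-suc n (suc i) (suc k) = ≡.refl

  E-vanish : ∀ n i k → n < i ℕ.+ k → evalᵏ (E n i k) b ≈ 0#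
  E-vanish zero    i k n<i+k = reflexive (≡.cong (λ p → evalᵏ p b) (if-≤ᵇ-false {X = C 1ᵏ} n<i+k))
  E-vanish (suc n) i k n<i+k = reflexive (≡.cong (λ p → evalᵏ p b) (≡.trans (E-suc n i k) (if-≤ᵇ-false n<i+k)))

  evalᵏ≡evalAt : ∀ p u → evalᵏ p u ≡ EvK.evalAt u p
  evalᵏ≡evalAt []      u = ≡.refl
  evalᵏ≡evalAt (v ∷ p) u = ≡.cong (λ t → v + (u * t)) (evalᵏ≡evalAt p u)

  evalᵏ-E-shape : ∀ P₁ P₂ P₃ c d → evalᵏ ((P₁ ⊕ scale c P₂) ⊕ (scale d X ⊗ P₃)) b
                                    ≈ (evalᵏ P₁ b + c * evalᵏ P₂ b) + (d * b) * evalᵏ P₃ b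
  evalᵏ-E-shape P₁ P₂ P₃ c d = begin
    evalᵏ ((P₁ ⊕ scale c P₂) ⊕ (scale d X ⊗ P₃)) b
      ≡⟨ evalᵏ≡evalAt ((P₁ ⊕ scale c P₂) ⊕ (scale d X ⊗ P₃)) b ⟩
    ev ((P₁ ⊕ scale c P₂) ⊕ (scale d X ⊗ P₃))
      ≈⟨ EvK.evalAt-⊕ b (P₁ ⊕ scale c P₂) (scale d X ⊗ P₃) ⟩
    ev (P₁ ⊕ scale c P₂) + ev (scale d X ⊗ P₃)
      ≈⟨ +-cong (EvK.evalAt-⊕ b P₁ (scale c P₂)) (EvK.evalAt-⊗ b (scale d X) P₃) ⟩
    (ev P₁ + ev (scale c P₂)) + ev (scale d X) * ev P₃
      ≈⟨ +-cong (+-congˡ (EvK.evalAt-scale b c P₂))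
                (*-congʳ (trans (EvK.evalAt-scale b d X) (*-congˡ (EvK.evalAt-X b)))) ⟩
    (ev P₁ + c * ev P₂) + (d * b) * ev P₃
      ≈⟨ +-cong (+-cong (evalᵏ≈ev P₁) (*-congˡ (evalᵏ≈ev P₂))) (*-congˡ (evalᵏ≈ev P₃)) ⟨
    (evalᵏ P₁ b + c * evalᵏ P₂ b) + (d * b) * evalᵏ P₃ b ∎
    where
    ev : Poly → Kc
    ev = EvK.evalAt b
    evalᵏ≈ev : ∀ p → evalᵏ p b ≈ ev p
    evalᵏ≈ev p = reflexive (evalᵏ≡evalAt p b)

  E-recurrence : ∀ n i k → evalᵏ (E (suc n) i k) b
    ≈ (evalᵏ (Epredᵏ n i k) b + β ^ᵏ k * evalᵏ (Epredⁱ n i k) b) + (qint β (suc k) * b) * evalᵏ (E n i (suc k)) b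
  E-recurrence n i k with (i ℕ.+ k) ℕₚ.≤? suc n
  ... | yes i+k≤1+n = trans (reflexive (≡.cong (λ p → evalᵏ p b) (≡.trans (E-suc n i k) (if-≤ᵇ-true i+k≤1+n))))
                            (evalᵏ-E-shape (Epredᵏ n i k) (Epredⁱ n i k) (E n i (suc k)) (β ^ᵏ k) (qint β (suc k)))
  ... | no  i+k≰1+n = begin
    evalᵏ (E (suc n) i k) b
      ≡⟨ ≡.cong (λ p → evalᵏ p b) (≡.trans (E-suc n i k) (if-≤ᵇ-false 1+n<i+k)) ⟩
    0#
      ≈⟨ sym (trans (+-identityʳ′ (zeroʳ′ _ (E-vanish n i (suc k) n<i+1+k)))
                    (trans (+-identityʳ′ (zeroʳ′ _ (predⁱ-vanish i 1+n<i+k))) (predᵏ-vanish k 1+n<i+k))) ⟩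
    (evalᵏ (Epredᵏ n i k) b + β ^ᵏ k * evalᵏ (Epredⁱ n i k) b) + (qint β (suc k) * b) * evalᵏ (E n i (suc k)) b ∎
    where
    1+n<i+k : suc n < i ℕ.+ k
    1+n<i+k = ℕₚ.≰⇒> i+k≰1+n
    n<i+1+k : n < i ℕ.+ suc k
    n<i+1+k = ≡.subst (n <_) (≡.sym (ℕₚ.+-suc i k)) (ℕₚ.m<n⇒m<1+n (ℕₚ.≤-trans (ℕₚ.n≤1+n _) 1+n<i+k))
    predᵏ-vanish : ∀ k → suc n < i ℕ.+ k → evalᵏ (Epredᵏ n i k) b ≈ 0#
    predᵏ-vanish zero    _  = refl
    predᵏ-vanish (suc k) lt = E-vanish n i k (ℕₚ.≤-pred (≡.subst (suc n <_) (ℕₚ.+-suc i k) lt))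
    predⁱ-vanish : ∀ i → suc n < i ℕ.+ k → evalᵏ (Epredⁱ n i k) b ≈ 0#
    predⁱ-vanish zero    _  = refl
    predⁱ-vanish (suc i) lt = E-vanish n i k (ℕₚ.≤-pred lt)

module Identities {c ℓ c′ ℓ′ : Level} (K : CommutativeRing c ℓ) (A : Ring c′ ℓ′)
  (ι : CommutativeRing.Carrier K → Ring.Carrier A)
  (β b : CommutativeRing.Carrier K) (x y z : Ring.Carrier A)
  (isAlg : Setting.IsKAlgebra K A ι β b x y z)
  (rels : Setting.Relations K A ι β b x y z) where

  open Setting K A ι β b x y z hiding (zero)
  open SetoidReasoning setoid
  open Basics K A ι β b x y z isAlg
  open Coefficients K A ι β b x y z

  yx≈x[y-1] : y * x ≈ x * (y - 1#)
  yx≈x[y-1] = trans (x-y≈z⇒y≈x-z (proj₂ (proj₂ rels)))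
    (trans (+-congˡ (-‿cong (sym (*-identityʳ x)))) (sym (x[y-z]≈xy-xz x y 1#)))

  zy≈[y-1]z : z * y ≈ (y - 1#) * z
  zy≈[y-1]z = trans (x-y≈z⇒y≈x-z (proj₁ rels))
    (trans (+-congˡ (-‿cong (sym (*-identityˡ z)))) (sym ([y-z]x≈yx-zx z y 1#)))

  zx≈xβz+b : z * x ≈ x * ι β * z + ι b
  zx≈xβz+b = trans (x-y≈z⇒x≈z+y (proj₁ (proj₂ rels))) (trans (+-comm _ _) (+-congʳ (*-congʳ (ι-central β x))))

  [y-d]x≈x[y-1-d] : ∀ d → (y- d) * x ≈ x * (y- suc d)
  [y-d]x≈x[y-1-d] d = begin
    (y - castA d) * x             ≈⟨ [y-z]x≈yx-zx x y (castA d) ⟩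
    y * x - castA d * x           ≈⟨ +-cong yx≈x[y-1] (-‿cong (castA-central d x)) ⟩
    x * (y - 1#) - x * castA d    ≈⟨ x[y-z]≈xy-xz x _ _ ⟨
    x * ((y - 1#) - castA d)      ≈⟨ *-congˡ ([u-v]-w≈u-[v+w] y 1# (castA d)) ⟩
    x * (y- suc d)                ∎

  z[y-d]≈[y-1-d]z : ∀ d → z * (y- d) ≈ (y- suc d) * z
  z[y-d]≈[y-1-d]z d = begin
    z * (y - castA d)             ≈⟨ x[y-z]≈xy-xz z y (castA d) ⟩
    z * y - z * castA d           ≈⟨ +-cong zy≈[y-1]z (-‿cong (sym (castA-central d z))) ⟩
    (y - 1#) * z - castA d * z    ≈⟨ [y-z]x≈yx-zx z _ _ ⟨
    ((y - 1#) - castA d) * z      ≈⟨ *-congʳ ([u-v]-w≈u-[v+w] y 1# (castA d)) ⟩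
    (y- suc d) * z                ∎

  [y-d]xʲ≈xʲ[y-j-d] : ∀ j d → (y- d) * x ^ j ≈ x ^ j * (y- (j ℕ.+ d))
  [y-d]xʲ≈xʲ[y-j-d] zero    d = trans (*-identityʳ _) (sym (*-identityˡ _))
  [y-d]xʲ≈xʲ[y-j-d] (suc j) d = begin
    (y- d) * (x * x ^ j)              ≈⟨ *-assoc _ _ _ ⟨
    ((y- d) * x) * x ^ j              ≈⟨ *-congʳ ([y-d]x≈x[y-1-d] d) ⟩
    (x * (y- suc d)) * x ^ j          ≈⟨ *-assoc _ _ _ ⟩
    x * ((y- suc d) * x ^ j)          ≈⟨ *-congˡ ([y-d]xʲ≈xʲ[y-j-d] j (suc d)) ⟩
    x * (x ^ j * (y- (j ℕ.+ suc d)))  ≈⟨ *-assoc _ _ _ ⟨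
    (x * x ^ j) * (y- (j ℕ.+ suc d))  ≡⟨ ≡.cong (λ e → x ^ suc j * (y- e)) (ℕₚ.+-suc j d) ⟩
    x ^ suc j * (y- (suc j ℕ.+ d))    ∎

  zʲ[y-d]≈[y-j-d]zʲ : ∀ j d → z ^ j * (y- d) ≈ (y- (j ℕ.+ d)) * z ^ j
  zʲ[y-d]≈[y-j-d]zʲ zero    d = trans (*-identityˡ _) (sym (*-identityʳ _))
  zʲ[y-d]≈[y-j-d]zʲ (suc j) d = begin
    (z * z ^ j) * (y- d)              ≈⟨ *-assoc _ _ _ ⟩
    z * (z ^ j * (y- d))              ≈⟨ *-congˡ (zʲ[y-d]≈[y-j-d]zʲ j d) ⟩
    z * ((y- (j ℕ.+ d)) * z ^ j)      ≈⟨ *-assoc _ _ _ ⟨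
    (z * (y- (j ℕ.+ d))) * z ^ j      ≈⟨ *-congʳ (z[y-d]≈[y-1-d]z (j ℕ.+ d)) ⟩
    ((y- (suc j ℕ.+ d)) * z) * z ^ j  ≈⟨ *-assoc _ _ _ ⟩
    (y- (suc j ℕ.+ d)) * (z * z ^ j)  ∎

  yxʲ≈xʲ[y-j] : ∀ j → y * x ^ j ≈ x ^ j * (y- j)
  yxʲ≈xʲ[y-j] j = trans (*-congʳ (sym (w-castA0≈w y)))
    (trans ([y-d]xʲ≈xʲ[y-j-d] j 0) (*-congˡ (reflexive (≡.cong y-_ (ℕₚ.+-identityʳ j)))))

  zʲy≈[y-j]zʲ : ∀ j → z ^ j * y ≈ (y- j) * z ^ j
  zʲy≈[y-j]zʲ j = trans (*-congˡ (sym (w-castA0≈w y)))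
    (trans (zʲ[y-d]≈[y-j-d]zʲ j 0) (*-congʳ (reflexive (≡.cong y-_ (ℕₚ.+-identityʳ j)))))

  yⁿxᵐ≈xᵐ[y-m]ⁿ : ∀ m n → y ^ n * x ^ m ≈ x ^ m * (y - castA m) ^ n
  yⁿxᵐ≈xᵐ[y-m]ⁿ m n = ^-intertwineʳ n (yxʲ≈xʲ[y-j] m)

  zⁿyᵐ≈[y-n]ᵐzⁿ : ∀ m n → z ^ n * y ^ m ≈ (y - castA n) ^ m * z ^ n
  zⁿyᵐ≈[y-n]ᵐzⁿ m n = ^-intertwineˡ m (zʲy≈[y-j]zʲ n)

  p[y-d]xʲ≈xʲp[y-j-d] : ∀ j d p → evalAt (y- d) p * x ^ j ≈ x ^ j * evalAt (y- (j ℕ.+ d)) p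
  p[y-d]xʲ≈xʲp[y-j-d] j d p = EvA.evalAt-intertwineʳ p ([y-d]xʲ≈xʲ[y-j-d] j d)

  zxʲ≈xʲβʲz+xʲ⁻¹[j]b : ∀ j → z * x ^ j ≈ x ^ j * ι (β ^ᵏ j) * z + x ^ (j ∸ 1) * ι (bqint j)
  zxʲ≈xʲβʲz+xʲ⁻¹[j]b zero = begin
    z * 1#                                   ≈⟨ trans (*-identityʳ z) (sym (*-identityˡ z)) ⟩
    1# * z                                   ≈⟨ *-congʳ (sym (trans (*-congˡ ι-1) (*-identityʳ 1#))) ⟩
    1# * ι 1ᵏ * z                            ≈⟨ +-identityʳ′ (zeroʳ′ 1# (trans (ι-cong bqint-0) ι-0)) ⟨
    1# * ι 1ᵏ * z + 1# * ι (bqint 0)         ∎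
  zxʲ≈xʲβʲz+xʲ⁻¹[j]b (suc j) = begin
    z * (x * x ^ j)                                                   ≈⟨ *-assoc _ _ _ ⟨
    (z * x) * x ^ j                                                   ≈⟨ *-congʳ zx≈xβz+b ⟩
    (x * ι β * z + ι b) * x ^ j                                       ≈⟨ distribʳ _ _ _ ⟩
    (x * ι β * z) * x ^ j + ι b * x ^ j                               ≈⟨ +-congʳ (*-assoc _ _ _) ⟩
    (x * ι β) * (z * x ^ j) + ι b * x ^ j                             ≈⟨ +-congʳ (*-congˡ (zxʲ≈xʲβʲz+xʲ⁻¹[j]b j)) ⟩
    (x * ι β) * (x ^ j * ι (β ^ᵏ j) * z + x ^ (j ∸ 1) * ι (bqint j)) + ι b * x ^ j
      ≈⟨ +-congʳ (distribˡ _ _ _) ⟩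
    ((x * ι β) * (x ^ j * ι (β ^ᵏ j) * z) + (x * ι β) * (x ^ (j ∸ 1) * ι (bqint j))) + ι b * x ^ j
      ≈⟨ +-congʳ (+-cong (trans (sym (*-assoc _ _ _)) (*-congʳ (ι-pull x β (x ^ j) (β ^ᵏ j)))) (ι-pull x β _ (bqint j))) ⟩
    (x ^ suc j * ι (β ^ᵏ suc j) * z + (x * x ^ (j ∸ 1)) * ι (β *ᵏ bqint j)) + ι b * x ^ j
      ≈⟨ +-assoc _ _ _ ⟩
    x ^ suc j * ι (β ^ᵏ suc j) * z + ((x * x ^ (j ∸ 1)) * ι (β *ᵏ bqint j) + ι b * x ^ j)
      ≈⟨ +-congˡ (bPart j) ⟩
    x ^ suc j * ι (β ^ᵏ suc j) * z + x ^ j * ι (bqint (suc j))        ∎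
    where
    bPart : ∀ j → (x * x ^ (j ∸ 1)) * ι (β *ᵏ bqint j) + ι b * x ^ j ≈ x ^ j * ι (bqint (suc j))
    bPart zero = begin
      (x * 1#) * ι (β *ᵏ bqint 0) + ι b * 1#   ≈⟨ +-identityˡ′ (zeroʳ′ _ (trans (ι-cong (K.trans (K.*-congˡ bqint-0) (K.zeroʳ β))) ι-0)) ⟩
      ι b * 1#                                 ≈⟨ ι-central b 1# ⟩
      1# * ι b                                 ≈⟨ *-congˡ (ι-cong (K.sym bqint-1)) ⟩
      1# * ι (bqint 1)                         ∎
    bPart (suc j) = begin
      x ^ suc j * ι (β *ᵏ bqint (suc j)) + ι b * x ^ suc j        ≈⟨ +-congˡ (ι-central b _) ⟩
      x ^ suc j * ι (β *ᵏ bqint (suc j)) + x ^ suc j * ι b        ≈⟨ distribˡ _ _ _ ⟨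
      x ^ suc j * (ι (β *ᵏ bqint (suc j)) + ι b)                  ≈⟨ *-congˡ (ι-+ _ _) ⟨
      x ^ suc j * ι (β *ᵏ bqint (suc j) +ᵏ b)                     ≈⟨ *-congˡ (ι-cong (K.sym (bqint-suc (suc j)))) ⟩
      x ^ suc j * ι (bqint (suc (suc j)))                         ∎

  Wterm : ℕ → ℕ → ℕ → Carrier
  Wterm m n k = x ^ (m ∸ k) * ι (W m n k) * z ^ (n ∸ k)

  z*Wterm : ∀ m n k → z * Wterm m n k
    ≈ x ^ (m ∸ k) * ι (β ^ᵏ (m ∸ k) *ᵏ W m n k) * z ^ suc (n ∸ k) + x ^ (m ∸ k ∸ 1) * ι (bqint (m ∸ k) *ᵏ W m n k) * z ^ (n ∸ k)
  z*Wterm m n k = begin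
    z * (x ^ j * ι w * z ^ e)                                             ≈⟨ *-assoc _ _ _ ⟨
    (z * (x ^ j * ι w)) * z ^ e                                           ≈⟨ *-congʳ (*-assoc _ _ _) ⟨
    ((z * x ^ j) * ι w) * z ^ e                                           ≈⟨ *-congʳ (*-congʳ (zxʲ≈xʲβʲz+xʲ⁻¹[j]b j)) ⟩
    ((x ^ j * ι (β ^ᵏ j) * z + x ^ (j ∸ 1) * ι (bqint j)) * ι w) * z ^ e   ≈⟨ trans (*-congʳ (distribʳ _ _ _)) (distribʳ _ _ _) ⟩
    ((x ^ j * ι (β ^ᵏ j) * z) * ι w) * z ^ e + ((x ^ (j ∸ 1) * ι (bqint j)) * ι w) * z ^ e
      ≈⟨ +-cong βPart (*-congʳ (ι-merge _ _ _)) ⟩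
    x ^ j * ι (β ^ᵏ j *ᵏ w) * z ^ suc e + x ^ (j ∸ 1) * ι (bqint j *ᵏ w) * z ^ e ∎
    where
    j = m ∸ k
    w = W m n k
    e = n ∸ k
    βPart : ((x ^ j * ι (β ^ᵏ j) * z) * ι w) * z ^ e ≈ x ^ j * ι (β ^ᵏ j *ᵏ w) * z ^ suc e
    βPart = begin
      ((x ^ j * ι (β ^ᵏ j) * z) * ι w) * z ^ e      ≈⟨ *-congʳ (*-assoc _ _ _) ⟩
      ((x ^ j * ι (β ^ᵏ j)) * (z * ι w)) * z ^ e    ≈⟨ *-congʳ (*-congˡ (ι-central w z)) ⟨
      ((x ^ j * ι (β ^ᵏ j)) * (ι w * z)) * z ^ e    ≈⟨ *-congʳ (*-assoc _ _ _) ⟨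
      ((x ^ j * ι (β ^ᵏ j)) * ι w * z) * z ^ e      ≈⟨ *-congʳ (*-congʳ (ι-merge _ _ _)) ⟩
      (x ^ j * ι (β ^ᵏ j *ᵏ w) * z) * z ^ e         ≈⟨ *-assoc _ _ _ ⟩
      x ^ j * ι (β ^ᵏ j *ᵏ w) * z ^ suc e           ∎

  z*ΣWterm≈ΣWterm-suc : ∀ m n → z * Σ< (suc m) (Wterm m n) ≈ Σ< (suc m) (Wterm m (suc n))
  z*ΣWterm≈ΣWterm-suc m n = begin
    z * Σ< (suc m) (Wterm m n)                     ≈⟨ ΣA.*-distribˡ-σ (suc m) z _ ⟩
    Σ< (suc m) (λ k → z * Wterm m n k)             ≈⟨ ΣA.σ-cong′ (suc m) (z*Wterm m n) ⟩
    Σ< (suc m) (λ k → βTerm k + bTerm k)           ≈⟨ ΣA.σ-+ (suc m) βTerm bTerm ⟩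
    Σ< (suc m) βTerm + Σ< (suc m) bTerm            ≈⟨ +-cong (ΣA.σ-cong (suc m) βTerm≈) Σ-bTerm≈ ⟩
    Σ< (suc m) βTerm′ + Σ< (suc m) bTerm′          ≈⟨ ΣA.σ-+ (suc m) βTerm′ bTerm′ ⟨
    Σ< (suc m) (λ k → βTerm′ k + bTerm′ k)         ≈⟨ ΣA.σ-cong (suc m) recurrence ⟩
    Σ< (suc m) (Wterm m (suc n))                   ∎
    where
    βTerm bTerm βTerm′ bTerm′ : ℕ → Carrier
    βTerm k  = x ^ (m ∸ k) * ι (β ^ᵏ (m ∸ k) *ᵏ W m n k) * z ^ suc (n ∸ k)
    bTerm k  = x ^ (m ∸ k ∸ 1) * ι (bqint (m ∸ k) *ᵏ W m n k) * z ^ (n ∸ k)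
    βTerm′ k = x ^ (m ∸ k) * ι (β ^ᵏ (m ∸ k) *ᵏ W m n k) * z ^ (suc n ∸ k)
    bTerm′ k = x ^ (m ∸ k) * ι (bqint (suc (m ∸ k)) *ᵏ Wpred m n k) * z ^ (suc n ∸ k)
    βTerm≈ : ∀ k → k < suc m → βTerm k ≈ βTerm′ k
    βTerm≈ k _ with k ℕₚ.≤? n
    ... | yes k≤n = *-congˡ (^-congʳ z (≡.sym (ℕₚ.+-∸-assoc 1 k≤n)))
    ... | no  k≰n = trans (term-null _ _ W≈0) (sym (term-null _ _ W≈0))
      where
      W≈0 : β ^ᵏ (m ∸ k) *ᵏ W m n k ≈ᵏ 0ᵏ
      W≈0 = K.trans (K.*-congˡ (W-vanishⁿ m n k (ℕₚ.≰⇒> k≰n))) (K.zeroʳ _)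
    Σ-bTerm≈ : Σ< (suc m) bTerm ≈ Σ< (suc m) bTerm′
    Σ-bTerm≈ = begin
      Σ< m bTerm + bTerm m                     ≈⟨ +-identityʳ′ (term-null _ _ (K.trans (K.*-congʳ
                                                    (K.trans (K.*-congˡ (K.reflexive (≡.cong (qint β) (ℕₚ.n∸n≡0 m)))) bqint-0)) (K.zeroˡ _))) ⟩
      Σ< m bTerm                               ≈⟨ ΣA.σ-cong m reindex ⟩
      Σ< m (λ k → bTerm′ (suc k))              ≈⟨ +-identityˡ′ (term-null _ _ (K.zeroʳ _)) ⟨
      bTerm′ 0 + Σ< m (λ k → bTerm′ (suc k))   ≈⟨ ΣA.σ-sucˡ m bTerm′ ⟨
      Σ< (suc m) bTerm′                        ∎
      where
      reindex : ∀ k → k < m → bTerm k ≈ bTerm′ (suc k)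
      reindex k k<m = *-cong (*-cong (^-congʳ x (≡.trans (ℕₚ.∸-+-assoc m k 1) (≡.cong (m ∸_) (ℕₚ.+-comm k 1))))
        (ι-cong (K.*-congʳ (K.*-congˡ (K.reflexive (≡.cong (qint β) (m∸n≡1+m∸[1+n] m k k<m))))))) refl
    recurrence : ∀ k → k < suc m → βTerm′ k + bTerm′ k ≈ Wterm m (suc n) k
    recurrence k (s≤s k≤m) = trans (term-+ _ _ _ _) (term-cong _ _ (K.reflexive (≡.sym (W-suc m n k k≤m))))

  zⁿxᵐ≈ΣWterm : ∀ m n → z ^ n * x ^ m ≈ Σ< (suc m) (Wterm m n)
  zⁿxᵐ≈ΣWterm m zero = begin
    1# * x ^ m                                     ≈⟨ *-identityˡ _ ⟩
    x ^ m                                          ≈⟨ trans (*-identityʳ _) (trans (*-congˡ ι-1) (*-identityʳ _)) ⟨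
    Wterm m zero zero                              ≈⟨ +-identityʳ′ (ΣA.σ-null m (λ k _ → term-null _ _ K.refl)) ⟨
    Wterm m zero zero + Σ< m (λ k → Wterm m zero (suc k))  ≈⟨ ΣA.σ-sucˡ m _ ⟨
    Σ< (suc m) (Wterm m zero)                      ∎
  zⁿxᵐ≈ΣWterm m (suc n) = begin
    (z * z ^ n) * x ^ m                            ≈⟨ *-assoc _ _ _ ⟩
    z * (z ^ n * x ^ m)                            ≈⟨ *-congˡ (zⁿxᵐ≈ΣWterm m n) ⟩
    z * Σ< (suc m) (Wterm m n)                     ≈⟨ z*ΣWterm≈ΣWterm-suc m n ⟩
    Σ< (suc m) (Wterm m (suc n))                   ∎

  zⁿxᵐ≈ΣxWz : ∀ m n → z ^ n * x ^ m ≈ Σ≤ (m ⊓ n) (λ k → x ^ (m ∸ k) * ι (W m n k) * z ^ (n ∸ k))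
  zⁿxᵐ≈ΣxWz m n = trans (zⁿxᵐ≈ΣWterm m n) (ΣA.σ-truncate (Wterm m n) (s≤s (ℕₚ.m⊓n≤m m n)) beyond-n)
    where
    beyond-n : ∀ i → suc (m ⊓ n) ≤ i → i < suc m → Wterm m n i ≈ 0#
    beyond-n i m⊓n<i (s≤s i≤m) with n ℕₚ.<? i
    ... | yes n<i = term-null _ _ (W-vanishⁿ m n i n<i)
    ... | no  n≮i = ⊥-elim (ℕₚ.<⇒≱ m⊓n<i (ℕₚ.⊓-glb i≤m (ℕₚ.≮⇒≥ n≮i)))

  zⁿxᵐ≈ΣW-explicit : ∀ m n → z ^ n * x ^ m ≈ Σ≤ (m ⊓ n) (λ k → ι (W-explicit m n k) * x ^ (m ∸ k) * z ^ (n ∸ k))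
  zⁿxᵐ≈ΣW-explicit m n = trans (zⁿxᵐ≈ΣxWz m n) (ΣA.σ-cong (suc (m ⊓ n)) (λ k k≤m⊓n → *-congʳ
    (trans (*-congˡ (ι-cong (W≈W-explicit m n k (ℕₚ.≤-trans (ℕₚ.≤-pred k≤m⊓n) (ℕₚ.m⊓n≤m m n))))) (sym (ι-central _ _)))))

  Π<-commute : ∀ {u} s (f : ℕ → Carrier) → (∀ j → u * f j ≈ f j * u) → u * Π< s f ≈ Π< s f * u
  Π<-commute zero f _ = trans (*-identityʳ _) (sym (*-identityˡ _))
  Π<-commute {u} (suc s) f commutes = begin
    u * (Π< s f * f s)      ≈⟨ *-assoc _ _ _ ⟨
    (u * Π< s f) * f s      ≈⟨ *-congʳ (Π<-commute s f commutes) ⟩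
    (Π< s f * u) * f s      ≈⟨ *-assoc _ _ _ ⟩
    Π< s f * (u * f s)      ≈⟨ *-congˡ (commutes s) ⟩
    Π< s f * (f s * u)      ≈⟨ *-assoc _ _ _ ⟨
    Π< s f * f s * u        ∎

  [y-c]ᵐ[y-d]ᵐ≈[y-d]ᵐ[y-c]ᵐ : ∀ c d m → (y- c) ^ m * (y- d) ^ m ≈ (y- d) ^ m * (y- c) ^ m
  [y-c]ᵐ[y-d]ᵐ≈[y-d]ᵐ[y-c]ᵐ c d m = ^-intertwineʳ m (^-intertwineˡ m ([y-c][y-d]≈[y-d][y-c] c d))

  [xⁿyᵐ]ˢ≈xⁿˢΠ[y-jn]ᵐ : ∀ m n s → (x ^ n * y ^ m) ^ s ≈ x ^ (n ℕ.* s) * Π< s (λ j → (y - castA (j ℕ.* n)) ^ m)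
  [xⁿyᵐ]ˢ≈xⁿˢΠ[y-jn]ᵐ m n zero    = sym (trans (*-identityʳ _) (^-congʳ x (ℕₚ.*-zeroʳ n)))
  [xⁿyᵐ]ˢ≈xⁿˢΠ[y-jn]ᵐ m n (suc s) = begin
    (x ^ n * y ^ m) * (x ^ n * y ^ m) ^ s                 ≈⟨ *-congˡ ([xⁿyᵐ]ˢ≈xⁿˢΠ[y-jn]ᵐ m n s) ⟩
    (x ^ n * y ^ m) * (x ^ (n ℕ.* s) * Πₛ)                 ≈⟨ *-assoc _ _ _ ⟨
    ((x ^ n * y ^ m) * x ^ (n ℕ.* s)) * Πₛ                 ≈⟨ *-congʳ (*-assoc _ _ _) ⟩
    (x ^ n * (y ^ m * x ^ (n ℕ.* s))) * Πₛ                 ≈⟨ *-congʳ (*-congˡ (yⁿxᵐ≈xᵐ[y-m]ⁿ (n ℕ.* s) m)) ⟩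
    (x ^ n * (x ^ (n ℕ.* s) * (y- (n ℕ.* s)) ^ m)) * Πₛ    ≈⟨ *-congʳ (*-assoc _ _ _) ⟨
    ((x ^ n * x ^ (n ℕ.* s)) * (y- (n ℕ.* s)) ^ m) * Πₛ    ≈⟨ *-assoc _ _ _ ⟩
    (x ^ n * x ^ (n ℕ.* s)) * ((y- (n ℕ.* s)) ^ m * Πₛ)
      ≈⟨ *-cong (trans (sym (^-distribˡ-+-* x n (n ℕ.* s))) (^-congʳ x (≡.sym (ℕₚ.*-suc n s))))
                (Π<-commute s _ (λ j → [y-c]ᵐ[y-d]ᵐ≈[y-d]ᵐ[y-c]ᵐ (n ℕ.* s) (j ℕ.* n) m)) ⟩
    x ^ (n ℕ.* suc s) * (Πₛ * (y- (n ℕ.* s)) ^ m)          ≡⟨ ≡.cong (λ e → x ^ (n ℕ.* suc s) * (Πₛ * (y- e) ^ m)) (ℕₚ.*-comm n s) ⟩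
    x ^ (n ℕ.* suc s) * Π< (suc s) (λ j → (y - castA (j ℕ.* n)) ^ m) ∎
    where
    Πₛ = Π< s (λ j → (y - castA (j ℕ.* n)) ^ m)

  [yⁿzᵐ]ˢ≈Π[y-jm]ⁿzᵐˢ : ∀ m n s → (y ^ n * z ^ m) ^ s ≈ Π< s (λ j → (y - castA (j ℕ.* m)) ^ n) * z ^ (m ℕ.* s)
  [yⁿzᵐ]ˢ≈Π[y-jm]ⁿzᵐˢ m n zero    = sym (trans (*-identityˡ _) (^-congʳ z (ℕₚ.*-zeroʳ m)))
  [yⁿzᵐ]ˢ≈Π[y-jm]ⁿzᵐˢ m n (suc s) = begin
    (y ^ n * z ^ m) ^ suc s                                ≈⟨ ^-sucʳ _ s ⟩
    (y ^ n * z ^ m) ^ s * (y ^ n * z ^ m)                  ≈⟨ *-congʳ ([yⁿzᵐ]ˢ≈Π[y-jm]ⁿzᵐˢ m n s) ⟩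
    (Πₛ * z ^ (m ℕ.* s)) * (y ^ n * z ^ m)                 ≈⟨ *-assoc _ _ _ ⟩
    Πₛ * (z ^ (m ℕ.* s) * (y ^ n * z ^ m))                 ≈⟨ *-congˡ (*-assoc _ _ _) ⟨
    Πₛ * ((z ^ (m ℕ.* s) * y ^ n) * z ^ m)                 ≈⟨ *-congˡ (*-congʳ (zⁿyᵐ≈[y-n]ᵐzⁿ n (m ℕ.* s))) ⟩
    Πₛ * (((y- (m ℕ.* s)) ^ n * z ^ (m ℕ.* s)) * z ^ m)    ≈⟨ *-congˡ (*-assoc _ _ _) ⟩
    Πₛ * ((y- (m ℕ.* s)) ^ n * (z ^ (m ℕ.* s) * z ^ m))    ≈⟨ *-assoc _ _ _ ⟨
    (Πₛ * (y- (m ℕ.* s)) ^ n) * (z ^ (m ℕ.* s) * z ^ m)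
      ≈⟨ *-cong (*-congˡ (reflexive (≡.cong (λ e → (y- e) ^ n) (ℕₚ.*-comm m s))))
                (trans (sym (^-distribˡ-+-* z (m ℕ.* s) m)) (^-congʳ z (≡.trans (ℕₚ.+-comm (m ℕ.* s) m) (≡.sym (ℕₚ.*-suc m s))))) ⟩
    Π< (suc s) (λ j → (y - castA (j ℕ.* m)) ^ n) * z ^ (m ℕ.* suc s) ∎
    where
    Πₛ = Π< s (λ j → (y - castA (j ℕ.* m)) ^ n)

  p[y-c][y-d]ᵐ≈[y-d]ᵐp[y-c] : ∀ c d m p → evalAt (y- c) p * (y- d) ^ m ≈ (y- d) ^ m * evalAt (y- c) p
  p[y-c][y-d]ᵐ≈[y-d]ᵐp[y-c] c d m p = EvA.evalAt-intertwineʳ p (^-intertwineˡ m ([y-c][y-d]≈[y-d][y-c] c d))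

  normalOrder : ∀ m a j e t u p → x ^ a * (ev p * ((x ^ j * ι u * z ^ e) * y ^ m)) * z ^ t
                ≈ x ^ (a ℕ.+ j) * ((y- e) ^ m * (ι u * evalAt (y- j) p)) * z ^ (e ℕ.+ t)
  normalOrder m a j e t u p = begin
    x ^ a * (ev p * ((x ^ j * ι u * z ^ e) * y ^ m)) * z ^ t  ≈⟨ *-congʳ (*-congˡ inner) ⟩
    x ^ a * (x ^ j * (Y * z ^ e)) * z ^ t                     ≈⟨ *-congʳ (*-assoc _ _ _) ⟨
    (x ^ a * x ^ j) * (Y * z ^ e) * z ^ t                     ≈⟨ *-congʳ (*-congʳ (^-distribˡ-+-* x a j)) ⟨
    x ^ (a ℕ.+ j) * (Y * z ^ e) * z ^ t                       ≈⟨ trans (*-assoc _ _ _) (*-congˡ (*-assoc _ _ _)) ⟩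
    x ^ (a ℕ.+ j) * (Y * (z ^ e * z ^ t))                     ≈⟨ *-congˡ (*-congˡ (^-distribˡ-+-* z e t)) ⟨
    x ^ (a ℕ.+ j) * (Y * z ^ (e ℕ.+ t))                       ≈⟨ *-assoc _ _ _ ⟨
    x ^ (a ℕ.+ j) * Y * z ^ (e ℕ.+ t)                         ∎
    where
    Sᵐ = (y- e) ^ m
    P′ = evalAt (y- j) p
    Y = Sᵐ * (ι u * P′)
    pxʲ≈xʲp′ : ev p * x ^ j ≈ x ^ j * P′
    pxʲ≈xʲp′ = trans (*-congʳ (ev≈evalAt-y-0 p)) (trans (p[y-d]xʲ≈xʲp[y-j-d] j 0 p)
                 (*-congˡ (reflexive (≡.cong (λ d → evalAt (y- d) p) (ℕₚ.+-identityʳ j)))))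
    inner : ev p * ((x ^ j * ι u * z ^ e) * y ^ m) ≈ x ^ j * (Y * z ^ e)
    inner = begin
      ev p * ((x ^ j * ι u * z ^ e) * y ^ m)  ≈⟨ *-congˡ (*-assoc _ _ _) ⟩
      ev p * ((x ^ j * ι u) * (z ^ e * y ^ m)) ≈⟨ *-congˡ (*-congˡ (zⁿyᵐ≈[y-n]ᵐzⁿ m e)) ⟩
      ev p * ((x ^ j * ι u) * (Sᵐ * z ^ e))   ≈⟨ trans (sym (*-assoc _ _ _)) (*-congʳ (sym (*-assoc _ _ _))) ⟩
      ((ev p * x ^ j) * ι u) * (Sᵐ * z ^ e)   ≈⟨ *-congʳ (*-congʳ pxʲ≈xʲp′) ⟩
      ((x ^ j * P′) * ι u) * (Sᵐ * z ^ e)     ≈⟨ trans (*-congʳ (*-assoc _ _ _)) (*-assoc _ _ _) ⟩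
      x ^ j * ((P′ * ι u) * (Sᵐ * z ^ e))     ≈⟨ *-congˡ (*-assoc _ _ _) ⟨
      x ^ j * (((P′ * ι u) * Sᵐ) * z ^ e)     ≈⟨ *-congˡ (*-congʳ regroup) ⟩
      x ^ j * (Y * z ^ e)                     ∎
      where
      regroup : (P′ * ι u) * Sᵐ ≈ Sᵐ * (ι u * P′)
      regroup = begin
        (P′ * ι u) * Sᵐ   ≈⟨ *-congʳ (ι-central u P′) ⟨
        (ι u * P′) * Sᵐ   ≈⟨ *-assoc _ _ _ ⟩
        ι u * (P′ * Sᵐ)   ≈⟨ *-congˡ (p[y-c][y-d]ᵐ≈[y-d]ᵐp[y-c] j e m p) ⟩
        ι u * (Sᵐ * P′)   ≈⟨ *-assoc _ _ _ ⟨
        (ι u * Sᵐ) * P′   ≈⟨ *-congʳ (ι-central u Sᵐ) ⟩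
        (Sᵐ * ι u) * P′   ≈⟨ *-assoc _ _ _ ⟩
        Sᵐ * (ι u * P′)   ∎

  module PowerExpansion (n m t : ℕ) where

    g : Carrier
    g = x ^ n * y ^ m * z ^ t

    Rterm : ℕ → ℕ → Carrier
    Rterm s l = x ^ ((n ℕ.* s) ∸ l) * ev (R n m t s l) * z ^ ((t ℕ.* s) ∸ l)

    Rsummand : Carrier → ℕ → ℕ → ℕ → Carrier
    Rsummand w s ℓ k = ι (W n ((t ℕ.* s) ∸ (ℓ ∸ k)) k) * evalAt (w - castA (n ∸ k)) (R n m t s (ℓ ∸ k))

    evalAt-R-suc : ∀ s ℓ w → evalAt w (R n m t (suc (suc s)) ℓ)
                   ≈ (w - castA ((t ℕ.* suc s) ∸ ℓ)) ^ m * Σ≤ (n ⊓ ℓ) (Rsummand w (suc s) ℓ)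
    evalAt-R-suc s ℓ w = begin
      evalAt w ((X- e) ^ₚ m ⊗ Σₚ≤ (n ⊓ ℓ) f)                   ≈⟨ EvA.evalAt-⊗ w ((X- e) ^ₚ m) (Σₚ≤ (n ⊓ ℓ) f) ⟩
      evalAt w ((X- e) ^ₚ m) * evalAt w (Σₚ≤ (n ⊓ ℓ) f)
        ≈⟨ *-cong (trans (evalAt-^ₚ w (X- e) m) (^-congˡ m (evalAt-X- w e))) (evalAt-Σₚ w (suc (n ⊓ ℓ)) f) ⟩
      (w - castA e) ^ m * Σ≤ (n ⊓ ℓ) (λ k → evalAt w (f k))
        ≈⟨ *-congˡ (ΣA.σ-cong′ (suc (n ⊓ ℓ)) (λ k →
             trans (EvA.evalAt-scale w _ (shift (R n m t (suc s) (ℓ ∸ k)) (n ∸ k))) (*-congˡ (evalAt-shift w (R n m t (suc s) (ℓ ∸ k)) (n ∸ k))))) ⟩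
      (w - castA e) ^ m * Σ≤ (n ⊓ ℓ) (Rsummand w (suc s) ℓ)    ∎
      where
      e = (t ℕ.* suc s) ∸ ℓ
      f : ℕ → Poly
      f k = scale (W n ((t ℕ.* suc s) ∸ (ℓ ∸ k)) k) (shift (R n m t (suc s) (ℓ ∸ k)) (n ∸ k))

    Rsummand-vanish : ∀ s ℓ k w → (∀ l w → (n ℕ.* suc s) ⊓ (t ℕ.* suc s) < l → evalAt w (R n m t (suc s) l) ≈ 0#) →
                      k ≤ n ⊓ ℓ → (n ℕ.* suc (suc s)) ⊓ (t ℕ.* suc (suc s)) < ℓ → Rsummand w (suc s) ℓ k ≈ 0#
    Rsummand-vanish s ℓ k w R-vanishₛ k≤n⊓ℓ ℓ>L with m⊓n<o⇒m<o⊎n<o ℓ>L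
    ... | inj₁ n[1+σ]<ℓ = zeroʳ′ _ (R-vanishₛ (ℓ ∸ k) _ (ℕₚ.≤-<-trans (ℕₚ.m⊓n≤m _ _) nσ<ℓ∸k))
      where
      σ = suc s
      nσ<ℓ∸k : n ℕ.* σ < ℓ ∸ k
      nσ<ℓ∸k = ℕₚ.m+n≤o⇒m≤o∸n (suc (n ℕ.* σ)) (ℕₚ.≤-trans (ℕₚ.+-monoʳ-≤ (suc (n ℕ.* σ)) (ℕₚ.≤-trans k≤n⊓ℓ (ℕₚ.m⊓n≤m n ℓ)))
                 (≡.subst (λ v → suc v ≤ ℓ) (≡.trans (ℕₚ.*-suc n σ) (ℕₚ.+-comm n (n ℕ.* σ))) n[1+σ]<ℓ))
    ... | inj₂ t[1+σ]<ℓ with (n ℕ.* suc s) ⊓ (t ℕ.* suc s) ℕₚ.<? ℓ ∸ k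
    ... | yes L<ℓ∸k = zeroʳ′ _ (R-vanishₛ (ℓ ∸ k) _ L<ℓ∸k)
    ... | no  L≮ℓ∸k = zeroˡ′ _ (trans (ι-cong (W-vanishⁿ n _ k (n≤m⇒m<n+o⇒m∸n<o ℓ∸k≤tσ tσ<ℓ∸k+k))) ι-0)
      where
      σ = suc s
      ℓ∸k≤tσ : ℓ ∸ k ≤ t ℕ.* σ
      ℓ∸k≤tσ = ℕₚ.≤-trans (ℕₚ.≮⇒≥ L≮ℓ∸k) (ℕₚ.m⊓n≤n _ _)
      tσ<ℓ∸k+k : t ℕ.* σ < (ℓ ∸ k) ℕ.+ k
      tσ<ℓ∸k+k = ≡.subst (t ℕ.* σ <_) (≡.sym (ℕₚ.m∸n+n≡m (ℕₚ.≤-trans k≤n⊓ℓ (ℕₚ.m⊓n≤n n ℓ))))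
                   (ℕₚ.≤-<-trans (ℕₚ.m≤n+m (t ℕ.* σ) t) (≡.subst (_< ℓ) (ℕₚ.*-suc t σ) t[1+σ]<ℓ))

    R-vanish : ∀ s l w → (n ℕ.* s) ⊓ (t ℕ.* s) < l → evalAt w (R n m t s l) ≈ 0#
    R-vanish zero          (suc l) w _   = refl
    R-vanish (suc zero)    (suc l) w _   = refl
    R-vanish (suc (suc s)) ℓ       w ℓ>L = trans (evalAt-R-suc s ℓ w) (zeroʳ′ _ (ΣA.σ-null _ (λ k k<1+n⊓ℓ →
      Rsummand-vanish s ℓ k w (R-vanish (suc s)) (ℕₚ.≤-pred k<1+n⊓ℓ) ℓ>L)))

    -- The (l, k) term of g^σ * g: the l-th term of g^σ times the k-th term of z^(tσ-l) x^n, in normal order.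
    Rcontribution : ℕ → ℕ → ℕ → Carrier
    Rcontribution σ l k = x ^ ((n ℕ.* suc σ) ∸ (l ℕ.+ k))
                        * ((y- ((t ℕ.* σ) ∸ (l ℕ.+ k))) ^ m * (ι (W n ((t ℕ.* σ) ∸ l) k) * evalAt (y- (n ∸ k)) (R n m t σ l)))
                        * z ^ ((t ℕ.* suc σ) ∸ (l ℕ.+ k))

    Rcontribution-normalOrder : ∀ σ l k → l ≤ (n ℕ.* σ) ⊓ (t ℕ.* σ) → k ≤ n →
      x ^ ((n ℕ.* σ) ∸ l) * (ev (R n m t σ l) * (Wterm n ((t ℕ.* σ) ∸ l) k * y ^ m)) * z ^ t ≈ Rcontribution σ l k
    Rcontribution-normalOrder σ l k l≤L k≤n = begin
      x ^ a * (ev Rₗ * (Wterm n e k * y ^ m)) * z ^ t         ≈⟨ normalOrder m a (n ∸ k) (e ∸ k) t (W n e k) Rₗ ⟩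
      x ^ (a ℕ.+ (n ∸ k)) * ((y- (e ∸ k)) ^ m * Y) * z ^ ((e ∸ k) ℕ.+ t)
        ≈⟨ *-congʳ (*-cong (^-congʳ x xExponent) (*-congʳ (reflexive (≡.cong (λ d → (y- d) ^ m) (ℕₚ.∸-+-assoc (t ℕ.* σ) l k))))) ⟩
      x ^ ((n ℕ.* suc σ) ∸ (l ℕ.+ k)) * ((y- ((t ℕ.* σ) ∸ (l ℕ.+ k))) ^ m * Y) * z ^ ((e ∸ k) ℕ.+ t)
        ≈⟨ zExponent ⟩
      Rcontribution σ l k                                      ∎
      where
      a = (n ℕ.* σ) ∸ l
      e = (t ℕ.* σ) ∸ l
      Rₗ = R n m t σ l
      Y = ι (W n e k) * evalAt (y- (n ∸ k)) Rₗ
      xExponent : a ℕ.+ (n ∸ k) ≡ (n ℕ.* suc σ) ∸ (l ℕ.+ k)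
      xExponent = ≡.trans ([m∸n]+[o∸p]≡[m+o]∸[n+p] (ℕₚ.≤-trans l≤L (ℕₚ.m⊓n≤m _ _)) k≤n)
                          (≡.cong (_∸ (l ℕ.+ k)) (≡.trans (ℕₚ.+-comm (n ℕ.* σ) n) (≡.sym (ℕₚ.*-suc n σ))))
      zExponent : x ^ ((n ℕ.* suc σ) ∸ (l ℕ.+ k)) * ((y- ((t ℕ.* σ) ∸ (l ℕ.+ k))) ^ m * Y) * z ^ ((e ∸ k) ℕ.+ t)
                ≈ Rcontribution σ l k
      zExponent with (l ℕ.+ k) ℕₚ.≤? t ℕ.* σ
      ... | yes l+k≤tσ = *-congˡ (^-congʳ z (≡.trans (≡.cong (ℕ._+ t) (ℕₚ.∸-+-assoc (t ℕ.* σ) l k))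
            (≡.trans (≡.sym (ℕₚ.+-∸-comm t l+k≤tσ))
                     (≡.cong (_∸ (l ℕ.+ k)) (≡.trans (ℕₚ.+-comm (t ℕ.* σ) t) (≡.sym (ℕₚ.*-suc t σ)))))))
      ... | no  l+k≰tσ = trans (vanishes ((e ∸ k) ℕ.+ t)) (sym (vanishes ((t ℕ.* suc σ) ∸ (l ℕ.+ k))))
        where
        vanishes : ∀ q → x ^ ((n ℕ.* suc σ) ∸ (l ℕ.+ k)) * ((y- ((t ℕ.* σ) ∸ (l ℕ.+ k))) ^ m * Y) * z ^ q ≈ 0#
        vanishes q = zeroˡ′ _ (zeroʳ′ _ (zeroʳ′ _ (zeroˡ′ _ (trans (ι-cong (W-vanishⁿ n e k
          (n≤m⇒m<n+o⇒m∸n<o (ℕₚ.≤-trans l≤L (ℕₚ.m⊓n≤n _ _)) (ℕₚ.≰⇒> l+k≰tσ)))) ι-0))))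

    Rterm*g : ∀ σ l → l ≤ (n ℕ.* σ) ⊓ (t ℕ.* σ) → Rterm σ l * g ≈ Σ< (suc n) (Rcontribution σ l)
    Rterm*g σ l l≤L = begin
      Rterm σ l * g                                              ≈⟨ reassociate _ _ _ _ _ _ ⟩
      x ^ a * (ev Rₗ * ((z ^ e * x ^ n) * y ^ m)) * z ^ t        ≈⟨ *-congʳ (*-congˡ (*-congˡ (*-congʳ (zⁿxᵐ≈ΣWterm n e)))) ⟩
      x ^ a * (ev Rₗ * (Σ< (suc n) (Wterm n e) * y ^ m)) * z ^ t
        ≈⟨ *-congʳ (*-congˡ (trans (*-congˡ (ΣA.*-distribʳ-σ (suc n) (y ^ m) (Wterm n e))) (ΣA.*-distribˡ-σ (suc n) (ev Rₗ) _))) ⟩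
      x ^ a * Σ< (suc n) (λ k → ev Rₗ * (Wterm n e k * y ^ m)) * z ^ t
        ≈⟨ trans (*-congʳ (ΣA.*-distribˡ-σ (suc n) (x ^ a) _)) (ΣA.*-distribʳ-σ (suc n) (z ^ t) _) ⟩
      Σ< (suc n) (λ k → x ^ a * (ev Rₗ * (Wterm n e k * y ^ m)) * z ^ t)
        ≈⟨ ΣA.σ-cong (suc n) (λ k k<1+n → Rcontribution-normalOrder σ l k l≤L (ℕₚ.≤-pred k<1+n)) ⟩
      Σ< (suc n) (Rcontribution σ l)                             ∎
      where
      a = (n ℕ.* σ) ∸ l
      e = (t ℕ.* σ) ∸ l
      Rₗ = R n m t σ l
      reassociate : ∀ a₁ a₂ a₃ a₄ a₅ a₆ → (a₁ * a₂ * a₃) * (a₄ * a₅ * a₆) ≈ a₁ * (a₂ * ((a₃ * a₄) * a₅)) * a₆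
      reassociate a₁ a₂ a₃ a₄ a₅ a₆ = begin
        (a₁ * a₂ * a₃) * (a₄ * a₅ * a₆)    ≈⟨ *-assoc _ _ _ ⟨
        ((a₁ * a₂ * a₃) * (a₄ * a₅)) * a₆  ≈⟨ *-congʳ (trans (*-assoc _ _ _) (*-assoc _ _ _)) ⟩
        (a₁ * (a₂ * (a₃ * (a₄ * a₅)))) * a₆ ≈⟨ *-congʳ (*-congˡ (*-congˡ (*-assoc _ _ _))) ⟨
        a₁ * (a₂ * ((a₃ * a₄) * a₅)) * a₆  ∎

    Σ-antidiagonal-Rcontribution : ∀ s ℓ → Σ< (suc ℓ) (λ k → Rcontribution (suc s) (ℓ ∸ k) k) ≈ Rterm (suc (suc s)) ℓ
    Σ-antidiagonal-Rcontribution s ℓ = begin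
      Σ< (suc ℓ) (λ k → Rcontribution σ (ℓ ∸ k) k)
        ≈⟨ ΣA.σ-cong (suc ℓ) (λ k k<1+ℓ → reflexive (≡.cong (λ q → x ^ (N′ ∸ q) * (y- ((t ℕ.* σ) ∸ q) ^ m * Rsummand y σ ℓ k) * z ^ (T′ ∸ q))
                                                            (ℕₚ.m∸n+n≡m (ℕₚ.≤-pred k<1+ℓ)))) ⟩
      Σ< (suc ℓ) (λ k → x ^ (N′ ∸ ℓ) * (Sℓ * Rsummand y σ ℓ k) * z ^ (T′ ∸ ℓ))
        ≈⟨ trans (*-congʳ (trans (*-congˡ (ΣA.*-distribˡ-σ (suc ℓ) Sℓ _)) (ΣA.*-distribˡ-σ (suc ℓ) _ _)))
                 (ΣA.*-distribʳ-σ (suc ℓ) _ _) ⟨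
      x ^ (N′ ∸ ℓ) * (Sℓ * Σ< (suc ℓ) (Rsummand y σ ℓ)) * z ^ (T′ ∸ ℓ)
        ≈⟨ *-congʳ (*-congˡ (*-congˡ (ΣA.σ-truncate (Rsummand y σ ℓ) (s≤s (ℕₚ.m⊓n≤n n ℓ)) beyond-n))) ⟩
      x ^ (N′ ∸ ℓ) * (Sℓ * Σ≤ (n ⊓ ℓ) (Rsummand y σ ℓ)) * z ^ (T′ ∸ ℓ)
        ≈⟨ *-congʳ (*-congˡ (trans (reflexive (ev≡evalAt (R n m t (suc σ) ℓ))) (evalAt-R-suc s ℓ y))) ⟨
      Rterm (suc σ) ℓ ∎
      where
      σ = suc s
      N′ = n ℕ.* suc σ
      T′ = t ℕ.* suc σ
      Sℓ = (y- ((t ℕ.* σ) ∸ ℓ)) ^ m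
      beyond-n : ∀ k → suc (n ⊓ ℓ) ≤ k → k < suc ℓ → Rsummand y σ ℓ k ≈ 0#
      beyond-n k n⊓ℓ<k (s≤s k≤ℓ) with n ℕₚ.<? k
      ... | yes n<k = zeroˡ′ _ (trans (ι-cong (W-vanishᵐ n ((t ℕ.* σ) ∸ (ℓ ∸ k)) k n<k)) ι-0)
      ... | no  n≮k = ⊥-elim (ℕₚ.<⇒≱ n⊓ℓ<k (ℕₚ.⊓-glb (ℕₚ.≮⇒≥ n≮k) k≤ℓ))

    gˢ-suc : ∀ s → g ^ suc s ≈ Σ≤ ((n ℕ.* suc s) ⊓ (t ℕ.* suc s)) (Rterm (suc s))
                 → g ^ suc (suc s) ≈ Σ≤ ((n ℕ.* suc (suc s)) ⊓ (t ℕ.* suc (suc s))) (Rterm (suc (suc s)))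
    gˢ-suc s gˢ≈ = begin
      g ^ suc σ                                                 ≈⟨ ^-sucʳ g σ ⟩
      g ^ σ * g                                                 ≈⟨ *-congʳ gˢ≈ ⟩
      Σ≤ L (Rterm σ) * g                                        ≈⟨ ΣA.*-distribʳ-σ (suc L) g (Rterm σ) ⟩
      Σ≤ L (λ l → Rterm σ l * g)                                ≈⟨ ΣA.σ-cong (suc L) (λ l l≤L → Rterm*g σ l (ℕₚ.≤-pred l≤L)) ⟩
      Σ≤ L (λ l → Σ≤ n (Rcontribution σ l))                     ≈⟨ ΣA.σ-cauchy L n (Rcontribution σ) R≈0 W≈0 ⟩
      Σ≤ (L ℕ.+ n) (λ ℓ → Σ≤ ℓ (λ k → Rcontribution σ (ℓ ∸ k) k)) ≈⟨ ΣA.σ-cong′ (suc (L ℕ.+ n)) (Σ-antidiagonal-Rcontribution s) ⟩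
      Σ≤ (L ℕ.+ n) (Rterm (suc σ))                              ≈⟨ ΣA.σ-truncate (Rterm (suc σ)) (s≤s (n[1+s]⊓t[1+s]≤[ns⊓ts]+n n t σ)) beyond-L′ ⟩
      Σ≤ ((n ℕ.* suc σ) ⊓ (t ℕ.* suc σ)) (Rterm (suc σ))        ∎
      where
      σ = suc s
      L = (n ℕ.* σ) ⊓ (t ℕ.* σ)
      R≈0 : ∀ l k → L < l → Rcontribution σ l k ≈ 0#
      R≈0 l k L<l = zeroˡ′ _ (zeroʳ′ _ (zeroʳ′ _ (zeroʳ′ _ (R-vanish σ l _ L<l))))
      W≈0 : ∀ l k → n < k → Rcontribution σ l k ≈ 0#
      W≈0 l k n<k = zeroˡ′ _ (zeroʳ′ _ (zeroʳ′ _ (zeroˡ′ _ (trans (ι-cong (W-vanishᵐ n ((t ℕ.* σ) ∸ l) k n<k)) ι-0))))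
      beyond-L′ : ∀ i → suc ((n ℕ.* suc σ) ⊓ (t ℕ.* suc σ)) ≤ i → i < suc (L ℕ.+ n) → Rterm (suc σ) i ≈ 0#
      beyond-L′ i L′<i _ = zeroˡ′ _ (zeroʳ′ _ (trans (reflexive (ev≡evalAt (R n m t (suc σ) i))) (R-vanish (suc σ) i y L′<i)))

    gˢ≈ΣRterm : ∀ s → g ^ s ≈ Σ≤ ((n ℕ.* s) ⊓ (t ℕ.* s)) (Rterm s)
    gˢ≈ΣRterm zero = begin
      1#                                   ≈⟨ trans (*-congʳ (trans (*-congʳ (^-congʳ x (ℕₚ.*-zeroʳ n))) (*-identityˡ _)))
                                                    (trans (*-congˡ (^-congʳ z (ℕₚ.*-zeroʳ t))) (*-identityʳ _)) ⟨
      x ^ (n ℕ.* 0) * 1# * z ^ (t ℕ.* 0)    ≈⟨ *-congʳ (*-congˡ (trans (ev-C 1ᵏ) ι-1)) ⟨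
      Rterm 0 0                            ≈⟨ +-identityˡ _ ⟨
      Σ≤ 0 (Rterm 0)                       ≡⟨ ≡.cong (λ L → Σ≤ L (Rterm 0)) (≡.sym (≡.cong₂ _⊓_ (ℕₚ.*-zeroʳ n) (ℕₚ.*-zeroʳ t))) ⟩
      Σ≤ ((n ℕ.* 0) ⊓ (t ℕ.* 0)) (Rterm 0) ∎
    gˢ≈ΣRterm (suc zero) = begin
      g * 1#                               ≈⟨ *-identityʳ g ⟩
      x ^ n * y ^ m * z ^ t                ≈⟨ *-cong (*-cong (^-congʳ x (≡.sym (ℕₚ.*-identityʳ n))) (sym ev-Xᵐ))
                                                     (^-congʳ z (≡.sym (ℕₚ.*-identityʳ t))) ⟩
      Rterm 1 0                            ≈⟨ +-identityʳ′ (ΣA.σ-null ((n ℕ.* 1) ⊓ (t ℕ.* 1)) (λ _ _ → zeroˡ′ _ (zeroʳ′ _ refl))) ⟨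
      Rterm 1 0 + Σ< ((n ℕ.* 1) ⊓ (t ℕ.* 1)) (λ k → Rterm 1 (suc k)) ≈⟨ ΣA.σ-sucˡ ((n ℕ.* 1) ⊓ (t ℕ.* 1)) (Rterm 1) ⟨
      Σ≤ ((n ℕ.* 1) ⊓ (t ℕ.* 1)) (Rterm 1) ∎
      where
      ev-Xᵐ : ev (X ^ₚ m) ≈ y ^ m
      ev-Xᵐ = trans (reflexive (ev≡evalAt (X ^ₚ m))) (trans (evalAt-^ₚ y X m) (^-congˡ m (EvA.evalAt-X y)))
    gˢ≈ΣRterm (suc (suc s)) = gˢ-suc s (gˢ≈ΣRterm (suc s))

  evalAt-R[n,0,t]≈ιU-suc : ∀ n t s → (∀ l w → evalAt w (R n 0 t (suc s) l) ≈ ι (U n t (suc s) l)) →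
                            ∀ ℓ w → evalAt w (R n 0 t (suc (suc s)) ℓ) ≈ ι (U n t (suc (suc s)) ℓ)
  evalAt-R[n,0,t]≈ιU-suc n t s IH ℓ w = begin
    evalAt w (R n 0 t (suc (suc s)) ℓ)                 ≈⟨ evalAt-R-suc s ℓ w ⟩
    1# * Σ≤ (n ⊓ ℓ) (Rsummand w (suc s) ℓ)             ≈⟨ *-identityˡ _ ⟩
    Σ≤ (n ⊓ ℓ) (Rsummand w (suc s) ℓ)                  ≈⟨ ΣA.σ-cong′ (suc (n ⊓ ℓ)) summand≈ ⟩
    Σ≤ (n ⊓ ℓ) (λ k → ι (U n t (suc s) (ℓ ∸ k) *ᵏ W n ((t ℕ.* suc s) ∸ (ℓ ∸ k)) k)) ≈⟨ ι-σ (suc (n ⊓ ℓ)) _ ⟨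
    ι (U n t (suc (suc s)) ℓ)                          ∎
    where
    open PowerExpansion n 0 t using (evalAt-R-suc; Rsummand)
    summand≈ : ∀ k → Rsummand w (suc s) ℓ k ≈ ι (U n t (suc s) (ℓ ∸ k) *ᵏ W n ((t ℕ.* suc s) ∸ (ℓ ∸ k)) k)
    summand≈ k = trans (*-congˡ (IH (ℓ ∸ k) _)) (trans (ι-central _ _) (sym (ι-* _ _)))

  evalAt-R[n,0,t]≈ιU : ∀ n t s l w → evalAt w (R n 0 t s l) ≈ ι (U n t s l)
  evalAt-R[n,0,t]≈ιU n t zero          zero    w = EvA.evalAt-C w 1ᵏ
  evalAt-R[n,0,t]≈ιU n t zero          (suc l) w = sym ι-0
  evalAt-R[n,0,t]≈ιU n t (suc zero)    zero    w = EvA.evalAt-C w 1ᵏ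
  evalAt-R[n,0,t]≈ιU n t (suc zero)    (suc l) w = sym ι-0
  evalAt-R[n,0,t]≈ιU n t (suc (suc s))         = evalAt-R[n,0,t]≈ιU-suc n t s (evalAt-R[n,0,t]≈ιU n t (suc s))

  [xⁿzᵐ]ˢ≈ΣxUz : ∀ n m s → (x ^ n * z ^ m) ^ s
                 ≈ Σ≤ ((n ℕ.* s) ⊓ (m ℕ.* s)) (λ l → x ^ ((n ℕ.* s) ∸ l) * ι (U n m s l) * z ^ ((m ℕ.* s) ∸ l))
  [xⁿzᵐ]ˢ≈ΣxUz n m s = begin
    (x ^ n * z ^ m) ^ s                                  ≈⟨ ^-congˡ s (*-congʳ (sym (*-identityʳ _))) ⟩
    (x ^ n * 1# * z ^ m) ^ s                             ≈⟨ gˢ≈ΣRterm s ⟩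
    Σ≤ ((n ℕ.* s) ⊓ (m ℕ.* s)) (Rterm s)
      ≈⟨ ΣA.σ-cong′ (suc ((n ℕ.* s) ⊓ (m ℕ.* s))) (λ l → *-congʳ (*-congˡ
           (trans (reflexive (ev≡evalAt (R n 0 m s l))) (evalAt-R[n,0,t]≈ιU n m s l y)))) ⟩
    Σ≤ ((n ℕ.* s) ⊓ (m ℕ.* s)) (λ l → x ^ ((n ℕ.* s) ∸ l) * ι (U n m s l) * z ^ ((m ℕ.* s) ∸ l)) ∎
    where open PowerExpansion n 0 m using (gˢ≈ΣRterm; Rterm)

  Vpred : ℕ → ℕ → Poly
  Vpred s zero    = []
  Vpred s (suc l) = V s l

  V-suc : ∀ s l → V (suc (suc s)) l ≡ (if l ℕ.≤ᵇ suc s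
    then (X- (suc s ∸ l)) ⊗ (scale (β ^ᵏ (suc s ∸ l)) (shift (V (suc s) l) 1) ⊕ scale (bqint (suc (suc s ∸ l))) (Vpred (suc s) l))
    else [])
  V-suc s zero    = ≡.refl
  V-suc s (suc l) = ≡.refl

  V-vanish : ∀ s l w → s < l → evalAt w (V s l) ≈ 0#
  V-vanish zero          (suc l) w _   = refl
  V-vanish (suc zero)    (suc l) w _   = refl
  V-vanish (suc (suc s)) l       w s<l = reflexive (≡.cong (evalAt w) (≡.trans (V-suc s l) (if-≤ᵇ-false (ℕₚ.<-trans (ℕₚ.n<1+n _) s<l))))

  evalAt-V-suc : ∀ s l w → l ≤ suc s → evalAt w (V (suc (suc s)) l)
    ≈ (w - castA (suc s ∸ l)) * (ι (β ^ᵏ (suc s ∸ l)) * evalAt (w - castA 1) (V (suc s) l)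
                                 + ι (bqint (suc (suc s ∸ l))) * evalAt w (Vpred (suc s) l))
  evalAt-V-suc s l w l≤1+s = begin
    evalAt w (V (suc (suc s)) l)                      ≡⟨ ≡.cong (evalAt w) (≡.trans (V-suc s l) (if-≤ᵇ-true l≤1+s)) ⟩
    evalAt w ((X- d) ⊗ (P ⊕ Q))                       ≈⟨ EvA.evalAt-⊗ w (X- d) (P ⊕ Q) ⟩
    evalAt w (X- d) * evalAt w (P ⊕ Q)                ≈⟨ *-cong (evalAt-X- w d) (EvA.evalAt-⊕ w P Q) ⟩
    (w - castA d) * (evalAt w P + evalAt w Q)
      ≈⟨ *-congˡ (+-cong (trans (EvA.evalAt-scale w _ (shift (V (suc s) l) 1)) (*-congˡ (evalAt-shift w (V (suc s) l) 1)))
                         (EvA.evalAt-scale w _ (Vpred (suc s) l))) ⟩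
    (w - castA d) * (ι (β ^ᵏ d) * evalAt (w - castA 1) (V (suc s) l) + ι (bqint (suc d)) * evalAt w (Vpred (suc s) l)) ∎
    where
    d = suc s ∸ l
    P = scale (β ^ᵏ d) (shift (V (suc s) l) 1)
    Q = scale (bqint (suc d)) (Vpred (suc s) l)

  Rsummands[1,1,1]≈V-suc : ∀ s → (∀ l w → evalAt w (R 1 1 1 (suc s) l) ≈ evalAt w (V (suc s) l)) → ∀ ℓ w →
    (w - castA (suc s ∸ ℓ)) * Σ≤ (1 ⊓ ℓ) (PowerExpansion.Rsummand 1 1 1 w (suc s) ℓ) ≈ evalAt w (V (suc (suc s)) ℓ)
  Rsummands[1,1,1]≈V-suc s IH zero w = begin
    (w - castA σ) * (0# + Rsummand w σ 0 0)
      ≈⟨ *-congˡ (trans (+-identityˡ _) (*-cong (ι-cong (K.trans (K.reflexive (W¹ 0 0)) (W¹₀ σ))) (IH 0 _))) ⟩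
    (w - castA σ) * (ι (β ^ᵏ σ) * evalAt (w - castA 1) (V σ 0))
      ≈⟨ *-congˡ (+-identityʳ′ (zeroʳ′ _ refl)) ⟨
    (w - castA σ) * (ι (β ^ᵏ σ) * evalAt (w - castA 1) (V σ 0) + ι (bqint (suc σ)) * evalAt w (Vpred σ 0))
      ≈⟨ evalAt-V-suc s 0 w z≤n ⟨
    evalAt w (V (suc σ) 0) ∎
    where
    open PowerExpansion 1 1 1 using (Rsummand)
    σ = suc s
    W¹ : ∀ l k → W 1 ((1 ℕ.* σ) ∸ l) k ≡ W 1 (σ ∸ l) k
    W¹ l k = ≡.cong (λ e → W 1 (e ∸ l) k) (ℕₚ.*-identityˡ σ)
  Rsummands[1,1,1]≈V-suc s IH (suc ℓ) w with suc ℓ ℕₚ.≤? suc s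
  ... | yes ℓ<σ = begin
    (w - castA (σ ∸ suc ℓ)) * ((0# + Rsummand w σ (suc ℓ) 0) + Rsummand w σ (suc ℓ) 1)
      ≈⟨ *-congˡ (+-cong (trans (+-identityˡ _) (*-cong (ι-cong (K.trans (K.reflexive (W¹ (suc ℓ) 0)) (W¹₀ (σ ∸ suc ℓ)))) (IH (suc ℓ) _)))
                         (*-cong (ι-cong (K.trans (K.reflexive (W¹ ℓ 1)) bqint-index)) (trans (IH ℓ _) (EvA.evalAt-cong (V σ ℓ) (w-castA0≈w w))))) ⟩
    (w - castA (σ ∸ suc ℓ)) * (ι (β ^ᵏ (σ ∸ suc ℓ)) * evalAt (w - castA 1) (V σ (suc ℓ)) + ι (bqint (suc (σ ∸ suc ℓ))) * evalAt w (V σ ℓ))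
      ≈⟨ evalAt-V-suc s (suc ℓ) w ℓ<σ ⟨
    evalAt w (V (suc σ) (suc ℓ)) ∎
    where
    open PowerExpansion 1 1 1 using (Rsummand)
    σ = suc s
    W¹ : ∀ l k → W 1 ((1 ℕ.* σ) ∸ l) k ≡ W 1 (σ ∸ l) k
    W¹ l k = ≡.cong (λ e → W 1 (e ∸ l) k) (ℕₚ.*-identityˡ σ)
    bqint-index : W 1 (σ ∸ ℓ) 1 ≈ᵏ bqint (suc (σ ∸ suc ℓ))
    bqint-index = K.trans (W¹₁ (σ ∸ ℓ)) (K.reflexive (≡.cong bqint (m∸n≡1+m∸[1+n] σ ℓ ℓ<σ)))
  ... | no  ℓ≮σ = begin
    (w - castA (σ ∸ suc ℓ)) * ((0# + Rsummand w σ (suc ℓ) 0) + Rsummand w σ (suc ℓ) 1)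
      ≈⟨ zeroʳ′ _ (trans (+-cong (+-identityˡ′ refl) (zeroˡ′ _ (trans (ι-cong W≈0) ι-0)))
                         (trans (+-identityʳ _) (zeroʳ′ _ (trans (IH (suc ℓ) _) (V-vanish σ (suc ℓ) _ (ℕₚ.≰⇒> ℓ≮σ)))))) ⟩
    0#                             ≡⟨ ≡.cong (evalAt w) (≡.trans (V-suc s (suc ℓ)) (if-≤ᵇ-false (ℕₚ.≰⇒> ℓ≮σ))) ⟨
    evalAt w (V (suc σ) (suc ℓ))   ∎
    where
    open PowerExpansion 1 1 1 using (Rsummand)
    σ = suc s
    W≈0 : W 1 ((1 ℕ.* σ) ∸ ℓ) 1 ≈ᵏ 0ᵏ
    W≈0 = K.trans (K.reflexive (≡.cong (λ e → W 1 (e ∸ ℓ) 1) (ℕₚ.*-identityˡ σ))) (W-vanishⁿ 1 (σ ∸ ℓ) 1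
            (≡.subst (_< 1) (≡.sym (ℕₚ.m≤n⇒m∸n≡0 (ℕₚ.≤-pred (ℕₚ.≰⇒> ℓ≮σ)))) (s≤s z≤n)))

  evalAt-R[1,1,1]≈V-suc : ∀ s → (∀ l w → evalAt w (R 1 1 1 (suc s) l) ≈ evalAt w (V (suc s) l)) →
                          ∀ ℓ w → evalAt w (R 1 1 1 (suc (suc s)) ℓ) ≈ evalAt w (V (suc (suc s)) ℓ)
  evalAt-R[1,1,1]≈V-suc s IH ℓ w = begin
    evalAt w (R 1 1 1 (suc (suc s)) ℓ)                                ≈⟨ evalAt-R-suc s ℓ w ⟩
    (w - castA ((1 ℕ.* suc s) ∸ ℓ)) ^ 1 * Σ≤ (1 ⊓ ℓ) (Rsummand w (suc s) ℓ)
      ≈⟨ *-congʳ (trans (*-identityʳ _) (reflexive (≡.cong (λ e → w - castA (e ∸ ℓ)) (ℕₚ.*-identityˡ (suc s))))) ⟩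
    (w - castA (suc s ∸ ℓ)) * Σ≤ (1 ⊓ ℓ) (Rsummand w (suc s) ℓ)        ≈⟨ Rsummands[1,1,1]≈V-suc s IH ℓ w ⟩
    evalAt w (V (suc (suc s)) ℓ)                                      ∎
    where open PowerExpansion 1 1 1 using (evalAt-R-suc; Rsummand)

  evalAt-R[1,1,1]≈V : ∀ s l w → evalAt w (R 1 1 1 s l) ≈ evalAt w (V s l)
  evalAt-R[1,1,1]≈V zero          l       w = refl
  evalAt-R[1,1,1]≈V (suc zero)    zero    w = trans (EvA.evalAt-⊗ w X (C 1ᵏ)) (trans (*-congˡ (trans (EvA.evalAt-C w 1ᵏ) ι-1)) (*-identityʳ _))
  evalAt-R[1,1,1]≈V (suc zero)    (suc l) w = refl
  evalAt-R[1,1,1]≈V (suc (suc s))         = evalAt-R[1,1,1]≈V-suc s (evalAt-R[1,1,1]≈V (suc s))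

  [xyz]ˢ≈ΣxVz : ∀ s → (x * y * z) ^ s ≈ Σ≤ s (λ l → x ^ (s ∸ l) * ev (V s l) * z ^ (s ∸ l))
  [xyz]ˢ≈ΣxVz s = begin
    (x * y * z) ^ s                               ≈⟨ ^-congˡ s (*-cong (*-cong (sym (*-identityʳ x)) (sym (*-identityʳ y))) (sym (*-identityʳ z))) ⟩
    (x ^ 1 * y ^ 1 * z ^ 1) ^ s                   ≈⟨ gˢ≈ΣRterm s ⟩
    Σ≤ ((1 ℕ.* s) ⊓ (1 ℕ.* s)) (Rterm s)          ≡⟨ ≡.cong (λ L → Σ≤ L (Rterm s)) (≡.trans (ℕₚ.⊓-idem (1 ℕ.* s)) (ℕₚ.*-identityˡ s)) ⟩
    Σ≤ s (Rterm s)                                ≈⟨ ΣA.σ-cong′ (suc s) (λ l → *-cong (*-cong (^-congʳ x (≡.cong (_∸ l) (ℕₚ.*-identityˡ s))) (R≈V l))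
                                                                                 (^-congʳ z (≡.cong (_∸ l) (ℕₚ.*-identityˡ s)))) ⟩
    Σ≤ s (λ l → x ^ (s ∸ l) * ev (V s l) * z ^ (s ∸ l)) ∎
    where
    open PowerExpansion 1 1 1 using (gˢ≈ΣRterm; Rterm)
    R≈V : ∀ l → ev (R 1 1 1 s l) ≈ ev (V s l)
    R≈V l = trans (reflexive (ev≡evalAt (R 1 1 1 s l))) (trans (evalAt-R[1,1,1]≈V s l y) (reflexive (≡.sym (ev≡evalAt (V s l)))))

  ev-[X-k]⊗ : ∀ k p → ev ((X- k) ⊗ p) ≈ (y- k) * ev p
  ev-[X-k]⊗ k p = trans (reflexive (ev≡evalAt ((X- k) ⊗ p)))
    (trans (EvA.evalAt-⊗ y (X- k) p) (*-cong (evalAt-X- y k) (reflexive (≡.sym (ev≡evalAt p)))))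

  ev-X⊗ : ∀ p → ev (X ⊗ p) ≈ y * ev p
  ev-X⊗ p = trans (reflexive (ev≡evalAt (X ⊗ p)))
    (trans (EvA.evalAt-⊗ y X p) (*-cong (EvA.evalAt-X y) (reflexive (≡.sym (ev≡evalAt p)))))

  ev-⊕ : ∀ p q → ev (p ⊕ q) ≈ ev p + ev q
  ev-⊕ p q = trans (reflexive (ev≡evalAt (p ⊕ q)))
    (trans (EvA.evalAt-⊕ y p q) (+-cong (reflexive (≡.sym (ev≡evalAt p))) (reflexive (≡.sym (ev≡evalAt q)))))

  z-ev≈ev-shift-z : ∀ p → z * ev p ≈ ev (shift p 1) * z
  z-ev≈ev-shift-z p = begin
    z * ev p                     ≈⟨ *-congˡ (ev≈evalAt-y-0 p) ⟩
    z * evalAt (y- 0) p          ≈⟨ EvA.evalAt-intertwineˡ p (z[y-d]≈[y-1-d]z 0) ⟩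
    evalAt (y- 1) p * z          ≈⟨ *-congʳ (trans (reflexive (ev≡evalAt (shift p 1))) (evalAt-shift y p 1)) ⟨
    ev (shift p 1) * z           ∎

  Spred : ℕ → ℕ → Poly
  Spred n zero    = []
  Spred n (suc k) = S n k

  S-suc : ∀ n k → S (suc n) k ≡ Spred n k ⊕ ((X- k) ⊗ S n k)
  S-suc n zero    = ≡.refl
  S-suc n (suc k) = ≡.refl

  S-vanish : ∀ n k → n < k → ev (S n k) ≈ 0#
  S-vanish zero    (suc k) _         = refl
  S-vanish (suc n) (suc k) (s≤s n<k) = begin
    ev (S n k ⊕ ((X- suc k) ⊗ S n (suc k)))            ≈⟨ ev-⊕ (S n k) _ ⟩
    ev (S n k) + ev ((X- suc k) ⊗ S n (suc k))         ≈⟨ +-cong (S-vanish n k n<k)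
                                                           (trans (ev-[X-k]⊗ (suc k) (S n (suc k))) (zeroʳ′ _ (S-vanish n (suc k) (ℕₚ.m≤n⇒m≤1+n n<k)))) ⟩
    0# + 0#                                             ≈⟨ +-identityˡ _ ⟩
    0#                                                  ∎

  [x+y]ⁿ≈ΣxS : ∀ n → (x + y) ^ n ≈ Σ≤ n (λ k → x ^ k * ev (S n k))
  [x+y]ⁿ≈ΣxS zero = begin
    1#                   ≈⟨ trans (*-identityˡ _) (trans (ev-C 1ᵏ) ι-1) ⟨
    1# * ev (C 1ᵏ)       ≈⟨ +-identityˡ _ ⟨
    Σ≤ 0 (λ k → x ^ k * ev (S 0 k)) ∎
  [x+y]ⁿ≈ΣxS (suc n) = begin
    (x + y) * (x + y) ^ n                       ≈⟨ *-congˡ ([x+y]ⁿ≈ΣxS n) ⟩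
    (x + y) * Σ< (suc n) term                   ≈⟨ ΣA.*-distribˡ-σ (suc n) (x + y) term ⟩
    Σ< (suc n) (λ k → (x + y) * term k)         ≈⟨ ΣA.σ-cong′ (suc n) split ⟩
    Σ< (suc n) (λ k → xTerm k + yTerm k)        ≈⟨ ΣA.σ-+ (suc n) xTerm yTerm ⟩
    Σ< (suc n) xTerm + Σ< (suc n) yTerm         ≈⟨ +-cong Σ-xTerm Σ-yTerm ⟩
    Σ< (suc (suc n)) xTerm′ + Σ< (suc (suc n)) yTerm
                                                ≈⟨ ΣA.σ-+ (suc (suc n)) xTerm′ yTerm ⟨
    Σ< (suc (suc n)) (λ k → xTerm′ k + yTerm k) ≈⟨ ΣA.σ-cong′ (suc (suc n)) recurrence ⟩
    Σ≤ (suc n) (λ k → x ^ k * ev (S (suc n) k)) ∎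
    where
    term xTerm yTerm xTerm′ : ℕ → Carrier
    term k   = x ^ k * ev (S n k)
    xTerm k  = x ^ suc k * ev (S n k)
    yTerm k  = x ^ k * ev ((X- k) ⊗ S n k)
    xTerm′ k = x ^ k * ev (Spred n k)
    split : ∀ k → (x + y) * term k ≈ xTerm k + yTerm k
    split k = begin
      (x + y) * (x ^ k * ev (S n k))                          ≈⟨ distribʳ _ _ _ ⟩
      x * (x ^ k * ev (S n k)) + y * (x ^ k * ev (S n k))     ≈⟨ +-cong (sym (*-assoc _ _ _)) (sym (*-assoc _ _ _)) ⟩
      xTerm k + (y * x ^ k) * ev (S n k)                      ≈⟨ +-congˡ (*-congʳ (yxʲ≈xʲ[y-j] k)) ⟩
      xTerm k + (x ^ k * (y- k)) * ev (S n k)                 ≈⟨ +-congˡ (trans (*-assoc _ _ _) (*-congˡ (sym (ev-[X-k]⊗ k (S n k))))) ⟩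
      xTerm k + yTerm k                                       ∎
    Σ-xTerm : Σ< (suc n) xTerm ≈ Σ< (suc (suc n)) xTerm′
    Σ-xTerm = sym (trans (ΣA.σ-sucˡ (suc n) xTerm′) (+-identityˡ′ (zeroʳ′ _ refl)))
    Σ-yTerm : Σ< (suc n) yTerm ≈ Σ< (suc (suc n)) yTerm
    Σ-yTerm = sym (+-identityʳ′ (zeroʳ′ _ (trans (ev-[X-k]⊗ (suc n) (S n (suc n))) (zeroʳ′ _ (S-vanish n (suc n) ℕₚ.≤-refl)))))
    recurrence : ∀ k → xTerm′ k + yTerm k ≈ x ^ k * ev (S (suc n) k)
    recurrence k = trans (sym (distribˡ _ _ _))
      (*-congˡ (sym (trans (reflexive (≡.cong ev (S-suc n k))) (ev-⊕ (Spred n k) ((X- k) ⊗ S n k)))))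

  Tpred : ℕ → ℕ → Poly
  Tpred n zero    = []
  Tpred n (suc k) = shift (T n k) 1

  T-suc : ∀ n k → T (suc n) k ≡ (X ⊗ T n k) ⊕ Tpred n k
  T-suc n zero    = ≡.refl
  T-suc n (suc k) = ≡.refl

  T-vanish : ∀ n k w → n < k → evalAt w (T n k) ≈ 0#
  T-vanish zero    (suc k) w _         = refl
  T-vanish (suc n) (suc k) w (s≤s n<k) = begin
    evalAt w ((X ⊗ T n (suc k)) ⊕ shift (T n k) 1)                ≈⟨ EvA.evalAt-⊕ w (X ⊗ T n (suc k)) (shift (T n k) 1) ⟩
    evalAt w (X ⊗ T n (suc k)) + evalAt w (shift (T n k) 1)
      ≈⟨ +-cong (trans (EvA.evalAt-⊗ w X (T n (suc k))) (zeroʳ′ _ (T-vanish n (suc k) w (ℕₚ.m≤n⇒m≤1+n n<k))))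
                (trans (evalAt-shift w (T n k) 1) (T-vanish n k _ n<k)) ⟩
    0# + 0#                                                       ≈⟨ +-identityˡ _ ⟩
    0#                                                            ∎

  [y+z]ⁿ≈ΣTz : ∀ n → (y + z) ^ n ≈ Σ≤ n (λ k → ev (T n k) * z ^ k)
  [y+z]ⁿ≈ΣTz zero = begin
    1#                   ≈⟨ trans (*-identityʳ _) (trans (ev-C 1ᵏ) ι-1) ⟨
    ev (C 1ᵏ) * 1#       ≈⟨ +-identityˡ _ ⟨
    Σ≤ 0 (λ k → ev (T 0 k) * z ^ k) ∎
  [y+z]ⁿ≈ΣTz (suc n) = begin
    (y + z) * (y + z) ^ n                       ≈⟨ *-congˡ ([y+z]ⁿ≈ΣTz n) ⟩
    (y + z) * Σ< (suc n) term                   ≈⟨ ΣA.*-distribˡ-σ (suc n) (y + z) term ⟩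
    Σ< (suc n) (λ k → (y + z) * term k)         ≈⟨ ΣA.σ-cong′ (suc n) split ⟩
    Σ< (suc n) (λ k → yTerm k + zTerm k)        ≈⟨ ΣA.σ-+ (suc n) yTerm zTerm ⟩
    Σ< (suc n) yTerm + Σ< (suc n) zTerm         ≈⟨ +-cong Σ-yTerm Σ-zTerm ⟩
    Σ< (suc (suc n)) yTerm + Σ< (suc (suc n)) zTerm′
                                                ≈⟨ ΣA.σ-+ (suc (suc n)) yTerm zTerm′ ⟨
    Σ< (suc (suc n)) (λ k → yTerm k + zTerm′ k) ≈⟨ ΣA.σ-cong′ (suc (suc n)) recurrence ⟩
    Σ≤ (suc n) (λ k → ev (T (suc n) k) * z ^ k) ∎
    where
    term yTerm zTerm zTerm′ : ℕ → Carrier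
    term k   = ev (T n k) * z ^ k
    yTerm k  = ev (X ⊗ T n k) * z ^ k
    zTerm k  = ev (shift (T n k) 1) * z ^ suc k
    zTerm′ k = ev (Tpred n k) * z ^ k
    split : ∀ k → (y + z) * term k ≈ yTerm k + zTerm k
    split k = begin
      (y + z) * (ev (T n k) * z ^ k)                          ≈⟨ distribʳ _ _ _ ⟩
      y * (ev (T n k) * z ^ k) + z * (ev (T n k) * z ^ k)     ≈⟨ +-cong (sym (*-assoc _ _ _)) (sym (*-assoc _ _ _)) ⟩
      (y * ev (T n k)) * z ^ k + (z * ev (T n k)) * z ^ k     ≈⟨ +-cong (*-congʳ (sym (ev-X⊗ (T n k)))) (*-congʳ (z-ev≈ev-shift-z (T n k))) ⟩
      yTerm k + (ev (shift (T n k) 1) * z) * z ^ k            ≈⟨ +-congˡ (*-assoc _ _ _) ⟩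
      yTerm k + zTerm k                                       ∎
    Σ-yTerm : Σ< (suc n) yTerm ≈ Σ< (suc (suc n)) yTerm
    Σ-yTerm = sym (+-identityʳ′ (zeroˡ′ _ (trans (ev-X⊗ (T n (suc n)))
                (zeroʳ′ _ (trans (reflexive (ev≡evalAt (T n (suc n)))) (T-vanish n (suc n) y ℕₚ.≤-refl))))))
    Σ-zTerm : Σ< (suc n) zTerm ≈ Σ< (suc (suc n)) zTerm′
    Σ-zTerm = sym (trans (ΣA.σ-sucˡ (suc n) zTerm′) (+-identityˡ′ (zeroˡ′ _ refl)))
    recurrence : ∀ k → yTerm k + zTerm′ k ≈ ev (T (suc n) k) * z ^ k
    recurrence k = trans (sym (distribʳ _ _ _))
      (*-congʳ (sym (trans (reflexive (≡.cong ev (T-suc n k))) (ev-⊕ (X ⊗ T n k) (Tpred n k)))))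

  Eb : ℕ → ℕ → ℕ → Kc
  Eb n i k = evalᵏ (E n i k) b

  Eterm : ℕ → ℕ → ℕ → Carrier
  Eterm n i k = x ^ i * ι (Eb n i k) * z ^ k

  -- E vanishes outside the triangle i + k ≤ n, so the induction runs over a square of
  -- indices, where shifting i or k needs no boundary bookkeeping.
  Σ² : ℕ → (ℕ → ℕ → Carrier) → Carrier
  Σ² N F = Σ< N (λ i → Σ< N (F i))

  Σ²-+ : ∀ N (F G : ℕ → ℕ → Carrier) → Σ² N (λ i k → F i k + G i k) ≈ Σ² N F + Σ² N G
  Σ²-+ N F G = trans (ΣA.σ-cong′ N (λ i → ΣA.σ-+ N (F i) (G i))) (ΣA.σ-+ N _ _)

  triangle≈square : ∀ n N → n ≤ N → Σ≤ n (λ i → Σ≤ (n ∸ i) (Eterm n i)) ≈ Σ² (suc N) (Eterm n)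
  triangle≈square n N n≤N = begin
    Σ≤ n (λ i → Σ≤ (n ∸ i) (Eterm n i))   ≈⟨ ΣA.σ-cong (suc n) widenRow ⟩
    Σ≤ n (λ i → Σ≤ N (Eterm n i))         ≈⟨ ΣA.σ-truncate _ (s≤s n≤N) emptyRow ⟨
    Σ² (suc N) (Eterm n)                  ∎
    where
    widenRow : ∀ i → i < suc n → Σ≤ (n ∸ i) (Eterm n i) ≈ Σ≤ N (Eterm n i)
    widenRow i (s≤s i≤n) = sym (ΣA.σ-truncate (Eterm n i) (s≤s (ℕₚ.≤-trans (ℕₚ.m∸n≤m n i) n≤N))
      (λ k n∸i<k _ → term-null _ _ (E-vanish n i k (≡.subst (_< i ℕ.+ k) (ℕₚ.m+[n∸m]≡n i≤n) (ℕₚ.+-monoʳ-< i n∸i<k)))))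
    emptyRow : ∀ i → suc n ≤ i → i < suc N → Σ≤ N (Eterm n i) ≈ 0#
    emptyRow i n<i _ = ΣA.σ-null (suc N) (λ k _ → term-null _ _ (E-vanish n i k (ℕₚ.≤-trans n<i (ℕₚ.m≤m+n i k))))

  zᵏx≈xβᵏzᵏ+[k]bzᵏ⁻¹ : ∀ k → z ^ k * x ≈ x * ι (β ^ᵏ k) * z ^ k + ι (bqint k) * z ^ (k ∸ 1)
  zᵏx≈xβᵏzᵏ+[k]bzᵏ⁻¹ k = begin
    z ^ k * x                                                  ≈⟨ *-congˡ (*-identityʳ x) ⟨
    z ^ k * x ^ 1                                              ≈⟨ zⁿxᵐ≈ΣWterm 1 k ⟩
    (0# + x ^ 1 * ι (W 1 k 0) * z ^ k) + 1# * ι (W 1 k 1) * z ^ (k ∸ 1)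
      ≈⟨ +-cong (trans (+-identityˡ _) (*-congʳ (*-cong (*-identityʳ x) (ι-cong (W¹₀ k)))))
                (*-congʳ (trans (*-identityˡ _) (ι-cong (W¹₁ k)))) ⟩
    x * ι (β ^ᵏ k) * z ^ k + ι (bqint k) * z ^ (k ∸ 1)        ∎

  module Eterm-suc (n : ℕ) where

    xPart bPart zPart βEpredⁱ bEnext Epredᵏterm : ℕ → ℕ → Carrier
    xPart i k      = x ^ suc i * ι (Eb n i k *ᵏ β ^ᵏ k) * z ^ k
    bPart i k      = x ^ i * ι (Eb n i k *ᵏ bqint k) * z ^ (k ∸ 1)
    zPart i k      = x ^ i * ι (Eb n i k) * z ^ suc k
    βEpredⁱ i k    = x ^ i * ι (β ^ᵏ k *ᵏ evalᵏ (Epredⁱ n i k) b) * z ^ k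
    bEnext i k     = x ^ i * ι ((qint β (suc k) *ᵏ b) *ᵏ Eb n i (suc k)) * z ^ k
    Epredᵏterm i k = x ^ i * ι (evalᵏ (Epredᵏ n i k) b) * z ^ k

    Eterm*[x+z] : ∀ i k → Eterm n i k * (x + z) ≈ (xPart i k + bPart i k) + zPart i k
    Eterm*[x+z] i k = begin
      Eterm n i k * (x + z)                                   ≈⟨ distribˡ _ _ _ ⟩
      Eterm n i k * x + Eterm n i k * z                       ≈⟨ +-cong (*-assoc _ _ _) (trans (*-assoc _ _ _) (*-congˡ (sym (^-sucʳ z k)))) ⟩
      (x ^ i * ι e) * (z ^ k * x) + zPart i k                 ≈⟨ +-congʳ (*-congˡ (zᵏx≈xβᵏzᵏ+[k]bzᵏ⁻¹ k)) ⟩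
      (x ^ i * ι e) * (x * ι (β ^ᵏ k) * z ^ k + ι (bqint k) * z ^ (k ∸ 1)) + zPart i k
        ≈⟨ +-congʳ (distribˡ _ _ _) ⟩
      ((x ^ i * ι e) * (x * ι (β ^ᵏ k) * z ^ k) + (x ^ i * ι e) * (ι (bqint k) * z ^ (k ∸ 1))) + zPart i k
        ≈⟨ +-congʳ (+-cong (trans (sym (*-assoc _ _ _)) (*-congʳ (trans (ι-pull _ _ _ _) (*-congʳ (sym (^-sucʳ x i))))))
                           (trans (sym (*-assoc _ _ _)) (*-congʳ (ι-merge _ _ _)))) ⟩
      (xPart i k + bPart i k) + zPart i k                     ∎
      where
      e = Eb n i k

    Eterm-recurrence : ∀ i k → Eterm (suc n) i k ≈ (Epredᵏterm i k + βEpredⁱ i k) + bEnext i k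
    Eterm-recurrence i k = trans (term-cong _ _ (E-recurrence n i k)) (sym (trans (+-congʳ (term-+ _ _ _ _)) (term-+ _ _ _ _)))

    Σ²-xPart : Σ² (suc n) xPart ≈ Σ² (suc (suc n)) βEpredⁱ
    Σ²-xPart = sym (begin
      Σ² (suc (suc n)) βEpredⁱ
        ≈⟨ ΣA.σ-sucˡ (suc n) _ ⟩
      Σ< (suc (suc n)) (βEpredⁱ 0) + Σ< (suc n) (λ i → Σ< (suc (suc n)) (βEpredⁱ (suc i)))
        ≈⟨ +-identityˡ′ (ΣA.σ-null (suc (suc n)) (λ k _ → term-null (x ^ 0) (z ^ k) (K.zeroʳ (β ^ᵏ k)))) ⟩
      Σ< (suc n) (λ i → Σ< (suc (suc n)) (βEpredⁱ (suc i)))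
        ≈⟨ ΣA.σ-cong′ (suc n) (λ i → trans (ΣA.σ-truncate (βEpredⁱ (suc i)) (ℕₚ.n≤1+n (suc n))
                 (λ k n<k _ → term-null _ _ (K.trans (K.*-congˡ (E-vanish n i k (ℕₚ.≤-trans n<k (ℕₚ.m≤n+m k i)))) (K.zeroʳ _))))
               (ΣA.σ-cong′ (suc n) (λ k → term-cong _ _ (K.*-comm _ _)))) ⟩
      Σ² (suc n) xPart ∎)

    Σ²-zPart : Σ² (suc n) zPart ≈ Σ² (suc (suc n)) Epredᵏterm
    Σ²-zPart = sym (begin
      Σ² (suc (suc n)) Epredᵏterm
        ≈⟨ ΣA.σ-truncate (λ i → Σ< (suc (suc n)) (Epredᵏterm i)) (ℕₚ.n≤1+n (suc n))
                         (λ i n<i _ → ΣA.σ-null (suc (suc n)) (λ k _ → emptyRow i n<i k)) ⟩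
      Σ< (suc n) (λ i → Σ< (suc (suc n)) (Epredᵏterm i))
        ≈⟨ ΣA.σ-cong′ (suc n) (λ i → trans (ΣA.σ-sucˡ (suc n) (Epredᵏterm i)) (+-identityˡ′ (term-null _ _ K.refl))) ⟩
      Σ² (suc n) zPart ∎)
      where
      emptyRow : ∀ i → suc n ≤ i → ∀ k → Epredᵏterm i k ≈ 0#
      emptyRow i n<i zero    = term-null _ _ K.refl
      emptyRow i n<i (suc k) = term-null _ _ (E-vanish n i k (ℕₚ.≤-trans n<i (ℕₚ.m≤m+n i k)))

    Σ²-bPart : Σ² (suc n) bPart ≈ Σ² (suc (suc n)) bEnext
    Σ²-bPart = sym (begin
      Σ² (suc (suc n)) bEnext
        ≈⟨ ΣA.σ-truncate (λ i → Σ< (suc (suc n)) (bEnext i)) (ℕₚ.n≤1+n (suc n)) (λ i n<i _ → ΣA.σ-null (suc (suc n))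
             (λ k _ → term-null (x ^ i) (z ^ k) (K.trans (K.*-congˡ (E-vanish n i (suc k) (ℕₚ.≤-trans n<i (ℕₚ.m≤m+n i (suc k))))) (K.zeroʳ _)))) ⟩
      Σ< (suc n) (λ i → Σ< (suc (suc n)) (bEnext i))
        ≈⟨ ΣA.σ-cong′ (suc n) row ⟩
      Σ² (suc n) bPart ∎)
      where
      row : ∀ i → Σ< (suc (suc n)) (bEnext i) ≈ Σ< (suc n) (bPart i)
      row i = begin
        Σ< (suc (suc n)) (bEnext i)
          ≈⟨ ΣA.σ-truncate (bEnext i) (ℕₚ.≤-trans (ℕₚ.n≤1+n n) (ℕₚ.n≤1+n (suc n)))
               (λ k n≤k _ → term-null _ _ (K.trans (K.*-congˡ (E-vanish n i (suc k) (ℕₚ.≤-trans (s≤s n≤k) (ℕₚ.m≤n+m (suc k) i)))) (K.zeroʳ _))) ⟩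
        Σ< n (bEnext i)                             ≈⟨ ΣA.σ-cong′ n (λ k → term-cong _ _ (K.trans (K.*-congʳ (K.*-comm _ _)) (K.*-comm _ _))) ⟩
        Σ< n (λ k → bPart i (suc k))                ≈⟨ +-identityˡ′ (term-null _ _ (K.trans (K.*-congˡ bqint-0) (K.zeroʳ _))) ⟨
        bPart i 0 + Σ< n (λ k → bPart i (suc k))    ≈⟨ ΣA.σ-sucˡ n (bPart i) ⟨
        Σ< (suc n) (bPart i)                        ∎

  [x+z]ⁿ≈square : ∀ n → (x + z) ^ n ≈ Σ² (suc n) (Eterm n)
  [x+z]ⁿ≈square zero = begin
    1#                        ≈⟨ trans (*-identityʳ _) (trans (*-identityˡ _)
                                   (trans (ι-cong (K.trans (K.+-congˡ (K.zeroʳ b)) (K.+-identityʳ 1ᵏ))) ι-1)) ⟨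
    1# * ι (Eb 0 0 0) * 1#    ≈⟨ trans (+-identityˡ _) (+-identityˡ _) ⟨
    Σ² 1 (Eterm 0)            ∎
  [x+z]ⁿ≈square (suc n) = begin
    (x + z) ^ suc n                                                  ≈⟨ ^-sucʳ _ n ⟩
    (x + z) ^ n * (x + z)                                            ≈⟨ *-congʳ ([x+z]ⁿ≈square n) ⟩
    Σ² (suc n) (Eterm n) * (x + z)
      ≈⟨ trans (ΣA.*-distribʳ-σ (suc n) (x + z) _) (ΣA.σ-cong′ (suc n) (λ i → ΣA.*-distribʳ-σ (suc n) (x + z) _)) ⟩
    Σ² (suc n) (λ i k → Eterm n i k * (x + z))
      ≈⟨ ΣA.σ-cong′ (suc n) (λ i → ΣA.σ-cong′ (suc n) (Eterm*[x+z] i)) ⟩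
    Σ² (suc n) (λ i k → (xPart i k + bPart i k) + zPart i k)          ≈⟨ trans (Σ²-+ (suc n) _ zPart) (+-congʳ (Σ²-+ (suc n) xPart bPart)) ⟩
    (Σ² (suc n) xPart + Σ² (suc n) bPart) + Σ² (suc n) zPart          ≈⟨ +-cong (+-cong Σ²-xPart Σ²-bPart) Σ²-zPart ⟩
    (Σ² (suc (suc n)) βEpredⁱ + Σ² (suc (suc n)) bEnext) + Σ² (suc (suc n)) Epredᵏterm
      ≈⟨ trans (+-comm _ _) (sym (+-assoc _ _ _)) ⟩
    (Σ² (suc (suc n)) Epredᵏterm + Σ² (suc (suc n)) βEpredⁱ) + Σ² (suc (suc n)) bEnext
      ≈⟨ trans (Σ²-+ (suc (suc n)) _ bEnext) (+-congʳ (Σ²-+ (suc (suc n)) Epredᵏterm βEpredⁱ)) ⟨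
    Σ² (suc (suc n)) (λ i k → (Epredᵏterm i k + βEpredⁱ i k) + bEnext i k)
      ≈⟨ ΣA.σ-cong′ (suc (suc n)) (λ i → ΣA.σ-cong′ (suc (suc n)) (λ k → sym (Eterm-recurrence i k))) ⟩
    Σ² (suc (suc n)) (Eterm (suc n))                                 ∎
    where open Eterm-suc n

  [x+z]ⁿ≈ΣxEz : ∀ n → (x + z) ^ n ≈ Σ≤ n (λ i → Σ≤ (n ∸ i) (λ k → x ^ i * ι (evalᵏ (E n i k) b) * z ^ k))
  [x+z]ⁿ≈ΣxEz n = trans ([x+z]ⁿ≈square n) (sym (triangle≈square n n ℕₚ.≤-refl))

  [xⁿyᵐzᵗ]ˢ≈ΣxRz : ∀ n m t s → (x ^ n * y ^ m * z ^ t) ^ s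
                    ≈ Σ≤ ((n ℕ.* s) ⊓ (t ℕ.* s)) (λ l → x ^ ((n ℕ.* s) ∸ l) * ev (R n m t s l) * z ^ ((t ℕ.* s) ∸ l))
  [xⁿyᵐzᵗ]ˢ≈ΣxRz n m t = PowerExpansion.gˢ≈ΣRterm n m t

module Uniqueness {c ℓ c′ ℓ′ : Level} (K : CommutativeRing c ℓ) (A : Ring c′ ℓ′)
  (ι : CommutativeRing.Carrier K → Ring.Carrier A)
  (β b : CommutativeRing.Carrier K) (x y z : Ring.Carrier A)
  (isAlg : Setting.IsKAlgebra K A ι β b x y z)
  (pbw : Setting.PBW K A ι β b x y z) where

  open Setting K A ι β b x y z hiding (zero)
  open SetoidReasoning setoid
  open Basics K A ι β b x y z isAlg

  ifEq : ℕ → ℕ → Kc → Kc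
  ifEq p q v with p ℕₚ.≟ q
  ... | yes _ = v
  ... | no  _ = 0ᵏ

  ifEq-refl : ∀ p v → ifEq p p v ≡ v
  ifEq-refl p v with p ℕₚ.≟ p
  ... | yes _  = ≡.refl
  ... | no p≢p = ⊥-elim (p≢p ≡.refl)

  ifEq-≢ : ∀ {p q} v → p ≢ q → ifEq p q v ≡ 0ᵏ
  ifEq-≢ {p} {q} v p≢q with p ℕₚ.≟ q
  ... | yes p≡q = ⊥-elim (p≢q p≡q)
  ... | no  _   = ≡.refl

  ifEq-0 : ∀ p q → ifEq p q 0ᵏ ≡ 0ᵏ
  ifEq-0 p q with p ℕₚ.≟ q
  ... | yes _ = ≡.refl
  ... | no  _ = ≡.refl

  coeff-beyond-length : ∀ p j → length p ≤ j → coeff p j ≈ᵏ 0ᵏ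
  coeff-beyond-length []      j       _         = K.refl
  coeff-beyond-length (u ∷ p) (suc j) (s≤s len≤j) = coeff-beyond-length p j len≤j

  ev≈Σcoeff : ∀ p N → length p ≤ N → ev p ≈ Σ< N (λ j → ι (coeff p j) * y ^ j)
  ev≈Σcoeff []      N       _         = sym (ΣA.σ-null N (λ j _ → zeroˡ′ _ ι-0))
  ev≈Σcoeff (u ∷ p) (suc N) (s≤s len≤N) = begin
    ι u + y * ev p                                          ≈⟨ +-cong (sym (*-identityʳ _)) (*-congˡ (ev≈Σcoeff p N len≤N)) ⟩
    ι u * 1# + y * Σ< N (λ j → ι (coeff p j) * y ^ j)       ≈⟨ +-congˡ (ΣA.*-distribˡ-σ N y _) ⟩
    ι u * 1# + Σ< N (λ j → y * (ι (coeff p j) * y ^ j))     ≈⟨ +-congˡ (ΣA.σ-cong′ N (λ j → trans (sym (*-assoc _ _ _))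
                                                                  (trans (*-congʳ (sym (ι-central _ y))) (*-assoc _ _ _)))) ⟩
    ι u * 1# + Σ< N (λ j → ι (coeff p j) * (y * y ^ j))     ≈⟨ ΣA.σ-sucˡ N _ ⟨
    Σ< (suc N) (λ j → ι (coeff (u ∷ p) j) * y ^ j)          ∎

  xᵃpzᶜ≈Σmono : ∀ p N a c → length p ≤ N → x ^ a * ev p * z ^ c ≈ Σ< N (λ j → ι (coeff p j) * mono a j c)
  xᵃpzᶜ≈Σmono p N a c len≤N = begin
    x ^ a * ev p * z ^ c                                    ≈⟨ *-congʳ (*-congˡ (ev≈Σcoeff p N len≤N)) ⟩
    x ^ a * Σ< N (λ j → ι (coeff p j) * y ^ j) * z ^ c      ≈⟨ trans (*-congʳ (ΣA.*-distribˡ-σ N _ _)) (ΣA.*-distribʳ-σ N _ _) ⟩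
    Σ< N (λ j → x ^ a * (ι (coeff p j) * y ^ j) * z ^ c)    ≈⟨ ΣA.σ-cong′ N (λ j → begin
        x ^ a * (ι (coeff p j) * y ^ j) * z ^ c             ≈⟨ *-congʳ (*-assoc _ _ _) ⟨
        (x ^ a * ι (coeff p j)) * y ^ j * z ^ c             ≈⟨ *-congʳ (*-congʳ (ι-central _ _)) ⟨
        (ι (coeff p j) * x ^ a) * y ^ j * z ^ c             ≈⟨ trans (*-congʳ (*-assoc _ _ _)) (*-assoc _ _ _) ⟩
        ι (coeff p j) * (x ^ a * y ^ j * z ^ c)             ∎) ⟩
    Σ< N (λ j → ι (coeff p j) * mono a j c)                 ∎

  Σ³-single : ∀ N a₀ c₀ (v : ℕ → Kc) → a₀ < N → c₀ < N →
    Σ< N (λ i → Σ< N (λ j → Σ< N (λ k → ι (ifEq a₀ i (ifEq c₀ k (v j))) * mono i j k)))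
      ≈ Σ< N (λ j → ι (v j) * mono a₀ j c₀)
  Σ³-single N a₀ c₀ v a₀<N c₀<N = begin
    Σ< N (λ i → Σ< N (λ j → Σ< N (λ k → ι (ifEq a₀ i (ifEq c₀ k (v j))) * mono i j k)))
      ≈⟨ ΣA.σ-cong′ N (λ i → ΣA.σ-cong′ N (λ j → ΣA.σ-single N c₀ _ c₀<N (λ k _ k≢c₀ → zeroˡ′ _
            (trans (ι-cong (K.reflexive (≡.trans (≡.cong (ifEq a₀ i) (ifEq-≢ (v j) (k≢c₀ ∘′ ≡.sym))) (ifEq-0 a₀ i)))) ι-0)))) ⟩
    Σ< N (λ i → Σ< N (λ j → ι (ifEq a₀ i (ifEq c₀ c₀ (v j))) * mono i j c₀))
      ≈⟨ ΣA.σ-swap N N _ ⟩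
    Σ< N (λ j → Σ< N (λ i → ι (ifEq a₀ i (ifEq c₀ c₀ (v j))) * mono i j c₀))
      ≈⟨ ΣA.σ-cong′ N (λ j → ΣA.σ-single N a₀ _ a₀<N (λ i _ i≢a₀ → zeroˡ′ _
            (trans (ι-cong (K.reflexive (ifEq-≢ _ (i≢a₀ ∘′ ≡.sym)))) ι-0))) ⟩
    Σ< N (λ j → ι (ifEq a₀ a₀ (ifEq c₀ c₀ (v j))) * mono a₀ j c₀)
      ≈⟨ ΣA.σ-cong′ N (λ j → *-congʳ (ι-cong (K.reflexive (≡.trans (ifEq-refl a₀ _) (ifEq-refl c₀ (v j)))))) ⟩
    Σ< N (λ j → ι (v j) * mono a₀ j c₀) ∎

  comb-- : ∀ N (f g : ℕ → ℕ → ℕ → Kc) → comb N (λ i j k → f i j k +ᵏ (-ᵏ g i j k)) ≈ comb N f - comb N g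
  comb-- N f g = begin
    comb N (λ i j k → f i j k +ᵏ (-ᵏ g i j k))
      ≈⟨ ΣA.σ-cong′ N (λ i → ΣA.σ-cong′ N (λ j → ΣA.σ-cong′ N (λ k → term i j k))) ⟩
    Σ< N (λ i → Σ< N (λ j → Σ< N (λ k → F i j k - G i j k)))
      ≈⟨ ΣA.σ-cong′ N (λ i → ΣA.σ-cong′ N (λ j → σ-- N)) ⟩
    Σ< N (λ i → Σ< N (λ j → Σ< N (F i j) - Σ< N (G i j)))
      ≈⟨ ΣA.σ-cong′ N (λ i → σ-- N) ⟩
    Σ< N (λ i → Σ< N (λ j → Σ< N (F i j)) - Σ< N (λ j → Σ< N (G i j)))
      ≈⟨ σ-- N ⟩
    comb N f - comb N g ∎
    where
    F G : ℕ → ℕ → ℕ → Carrier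
    F i j k = ι (f i j k) * mono i j k
    G i j k = ι (g i j k) * mono i j k
    σ-- : ∀ N {φ ψ : ℕ → Carrier} → Σ< N (λ i → φ i - ψ i) ≈ Σ< N φ - Σ< N ψ
    σ-- N = trans (ΣA.σ-+ N _ _) (+-congˡ (ΣA.σ-neg N _))
    term : ∀ i j k → ι (f i j k +ᵏ (-ᵏ g i j k)) * mono i j k ≈ F i j k - G i j k
    term i j k = trans (*-congʳ (trans (ι-+ _ _) (+-congˡ (ι-neg _))))
                       (trans (distribʳ _ _ _) (+-congˡ (sym (-‿distribˡ-* _ _))))

  module Family (L : ℕ) (L₂ : ℕ → ℕ) (a c : ℕ → ℕ → ℕ) where

    ΣxPz : (ℕ → ℕ → Poly) → Carrier
    ΣxPz P = Σ≤ L (λ i → Σ≤ (L₂ i) (λ k → x ^ a i k * ev (P i k) * z ^ c i k))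

    pbwCoeff : (ℕ → ℕ → Poly) → ℕ → ℕ → ℕ → Kc
    pbwCoeff P i′ j k′ = Σᵏ≤ L (λ i → Σᵏ≤ (L₂ i) (λ k → ifEq (a i k) i′ (ifEq (c i k) k′ (coeff (P i k) j))))

    BoundedBy : ℕ → (ℕ → ℕ → Poly) → Set
    BoundedBy N P = ∀ i k → i < suc L → k < suc (L₂ i) → a i k < N × c i k < N × length (P i k) ≤ N

    ExponentsInjective : Set
    ExponentsInjective = ∀ i k i′ k′ → i < suc L → k < suc (L₂ i) → i′ < suc L → k′ < suc (L₂ i′) →
                         a i k ≡ a i′ k′ → c i k ≡ c i′ k′ → i ≡ i′ × k ≡ k′

    ΣxPz≈comb : ∀ N P → BoundedBy N P → ΣxPz P ≈ comb N (pbwCoeff P)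
    ΣxPz≈comb N P bounded = begin
      ΣxPz P
        ≈⟨ ΣA.σ-cong (suc L) (λ i i≤L → ΣA.σ-cong (suc (L₂ i)) (λ k k≤L₂ →
             xᵃpzᶜ≈Σmono (P i k) N (a i k) (c i k) (proj₂ (proj₂ (bounded i k i≤L k≤L₂))))) ⟩
      Σ≤ L (λ i → Σ≤ (L₂ i) (λ k → Σ< N (λ j → ι (coeff (P i k) j) * mono (a i k) j (c i k))))
        ≈⟨ ΣA.σ-cong (suc L) (λ i i≤L → ΣA.σ-cong (suc (L₂ i)) (λ k k≤L₂ →
             Σ³-single N (a i k) (c i k) (coeff (P i k)) (proj₁ (bounded i k i≤L k≤L₂)) (proj₁ (proj₂ (bounded i k i≤L k≤L₂))))) ⟨
      Σ≤ L (λ i → Σ≤ (L₂ i) (λ k → Σ< N (λ i′ → Σ< N (λ j → Σ< N (λ k′ → G i k i′ j k′)))))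
        ≈⟨ pull-out _ ⟨
      Σ< N (λ i′ → Σ≤ L (λ i → Σ≤ (L₂ i) (λ k → Σ< N (λ j → Σ< N (λ k′ → G i k i′ j k′)))))
        ≈⟨ ΣA.σ-cong′ N (λ i′ → sym (pull-out _)) ⟩
      Σ< N (λ i′ → Σ< N (λ j → Σ≤ L (λ i → Σ≤ (L₂ i) (λ k → Σ< N (λ k′ → G i k i′ j k′)))))
        ≈⟨ ΣA.σ-cong′ N (λ i′ → ΣA.σ-cong′ N (λ j → sym (pull-out _))) ⟩
      Σ< N (λ i′ → Σ< N (λ j → Σ< N (λ k′ → Σ≤ L (λ i → Σ≤ (L₂ i) (λ k → G i k i′ j k′)))))
        ≈⟨ ΣA.σ-cong′ N (λ i′ → ΣA.σ-cong′ N (λ j → ΣA.σ-cong′ N (λ k′ → sym (ι-pbwCoeff i′ j k′)))) ⟩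
      comb N (pbwCoeff P) ∎
      where
      G : ℕ → ℕ → ℕ → ℕ → ℕ → Carrier
      G i k i′ j k′ = ι (ifEq (a i k) i′ (ifEq (c i k) k′ (coeff (P i k) j))) * mono i′ j k′
      pull-out : ∀ (F : ℕ → ℕ → ℕ → Carrier) →
        Σ< N (λ u → Σ≤ L (λ i → Σ≤ (L₂ i) (F u i))) ≈ Σ≤ L (λ i → Σ≤ (L₂ i) (λ k → Σ< N (λ u → F u i k)))
      pull-out F = trans (ΣA.σ-swap N (suc L) _) (ΣA.σ-cong′ (suc L) (λ i → ΣA.σ-swap N (suc (L₂ i)) _))
      ι-pbwCoeff : ∀ i′ j k′ → ι (pbwCoeff P i′ j k′) * mono i′ j k′ ≈ Σ≤ L (λ i → Σ≤ (L₂ i) (λ k → G i k i′ j k′))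
      ι-pbwCoeff i′ j k′ = trans (*-congʳ (trans (ι-σ (suc L) _) (ΣA.σ-cong′ (suc L) (λ i → ι-σ (suc (L₂ i)) _))))
                                 (trans (ΣA.*-distribʳ-σ (suc L) _ _) (ΣA.σ-cong′ (suc L) (λ i → ΣA.*-distribʳ-σ (suc (L₂ i)) _ _)))

    pbwCoeff-at : ∀ P → ExponentsInjective → ∀ i k j → i < suc L → k < suc (L₂ i) →
                  pbwCoeff P (a i k) j (c i k) ≈ᵏ coeff (P i k) j
    pbwCoeff-at P injective i k j i≤L k≤L₂ =
      K.trans (ΣK.σ-single (suc L) i _ i≤L (λ i₀ i₀≤L i₀≢i → ΣK.σ-null _ (λ k₀ k₀≤ → other i₀ k₀ i₀≤L k₀≤ (i₀≢i ∘′ proj₁))))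
        (K.trans (ΣK.σ-single (suc (L₂ i)) k _ k≤L₂ (λ k₀ k₀≤ k₀≢k → other i k₀ i≤L k₀≤ (k₀≢k ∘′ proj₂)))
          (K.reflexive (≡.trans (ifEq-refl (a i k) _) (ifEq-refl (c i k) _))))
      where
      other : ∀ i₀ k₀ → i₀ < suc L → k₀ < suc (L₂ i₀) → ¬ (i₀ ≡ i × k₀ ≡ k) →
              ifEq (a i₀ k₀) (a i k) (ifEq (c i₀ k₀) (c i k) (coeff (P i₀ k₀) j)) ≈ᵏ 0ᵏ
      other i₀ k₀ i₀≤L k₀≤ ≢ = byCases (a i₀ k₀ ℕₚ.≟ a i k) (c i₀ k₀ ℕₚ.≟ c i k)
        where
        byCases : Dec (a i₀ k₀ ≡ a i k) → Dec (c i₀ k₀ ≡ c i k) →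
                  ifEq (a i₀ k₀) (a i k) (ifEq (c i₀ k₀) (c i k) (coeff (P i₀ k₀) j)) ≈ᵏ 0ᵏ
        byCases (no  a≢) _        = K.reflexive (ifEq-≢ _ a≢)
        byCases (yes _)  (no c≢)  = K.reflexive (≡.trans (≡.cong (ifEq (a i₀ k₀) (a i k)) (ifEq-≢ _ c≢)) (ifEq-0 (a i₀ k₀) (a i k)))
        byCases (yes a≡) (yes c≡) = ⊥-elim (≢ (injective i₀ k₀ i k i₀≤L k₀≤ i≤L k≤L₂ a≡ c≡))

    ΣxPz-injective-bounded : ∀ N P Q → BoundedBy N P → BoundedBy N Q → ExponentsInjective → ΣxPz P ≈ ΣxPz Q →
                             ∀ i k → i < suc L → k < suc (L₂ i) → P i k ≈ₚ Q i k
    ΣxPz-injective-bounded N P Q boundedP boundedQ injective P≈Q i k i≤L k≤L₂ j with j ℕₚ.<? N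
    ... | yes j<N = K.trans (K.sym (pbwCoeff-at P injective i k j i≤L k≤L₂))
                      (K.trans (pbwCoeffs≈ (a i k) j (c i k) (proj₁ (boundedP i k i≤L k≤L₂)) j<N (proj₁ (proj₂ (boundedP i k i≤L k≤L₂))))
                               (pbwCoeff-at Q injective i k j i≤L k≤L₂))
      where
      comb≈0 : comb N (λ i j k → pbwCoeff P i j k +ᵏ (-ᵏ pbwCoeff Q i j k)) ≈ 0#
      comb≈0 = trans (comb-- N (pbwCoeff P) (pbwCoeff Q))
                 (trans (+-cong (sym (ΣxPz≈comb N P boundedP)) (-‿cong (sym (ΣxPz≈comb N Q boundedQ))))
                        (trans (+-congʳ P≈Q) (-‿inverseʳ _)))
      pbwCoeffs≈ : ∀ i′ j k′ → i′ < N → j < N → k′ < N → pbwCoeff P i′ j k′ ≈ᵏ pbwCoeff Q i′ j k′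
      pbwCoeffs≈ i′ j k′ i′<N j<N k′<N =
        GroupProperties.x∙y⁻¹≈ε⇒x≈y K.+-group _ _ (proj₂ pbw N _ comb≈0 i′ j k′ i′<N j<N k′<N)
    ... | no  j≮N = K.trans (coeff-beyond-length (P i k) j (ℕₚ.≤-trans (proj₂ (proj₂ (boundedP i k i≤L k≤L₂))) (ℕₚ.≮⇒≥ j≮N)))
                            (K.sym (coeff-beyond-length (Q i k) j (ℕₚ.≤-trans (proj₂ (proj₂ (boundedQ i k i≤L k≤L₂))) (ℕₚ.≮⇒≥ j≮N))))

    ΣxPz-injective : ∀ P Q → ExponentsInjective → ΣxPz P ≈ ΣxPz Q →
                     ∀ i k → i < suc L → k < suc (L₂ i) → P i k ≈ₚ Q i k
    ΣxPz-injective P Q = ΣxPz-injective-bounded (suc total) P Q boundedP boundedQ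
      where
      size : ℕ → ℕ → ℕ
      size i k = a i k ℕ.+ c i k ℕ.+ length (P i k) ℕ.+ length (Q i k)
      total = Σℕ< (suc L) (λ i → Σℕ< (suc (L₂ i)) (size i))
      size≤total : ∀ i k → i < suc L → k < suc (L₂ i) → size i k ≤ total
      size≤total i k i≤L k≤L₂ = ℕₚ.≤-trans (≤-Σℕ< (suc (L₂ i)) (size i) k k≤L₂) (≤-Σℕ< (suc L) _ i i≤L)
      boundedP : BoundedBy (suc total) P
      boundedP i k i≤L k≤L₂ =
        s≤s (ℕₚ.≤-trans (ℕₚ.m≤m+n (a i k) _) (ℕₚ.≤-trans (ℕₚ.m≤m+n _ (length (P i k))) (ℕₚ.≤-trans (ℕₚ.m≤m+n _ (length (Q i k))) s≤t))) ,
        s≤s (ℕₚ.≤-trans (ℕₚ.m≤n+m (c i k) (a i k)) (ℕₚ.≤-trans (ℕₚ.m≤m+n _ (length (P i k))) (ℕₚ.≤-trans (ℕₚ.m≤m+n _ (length (Q i k))) s≤t))) ,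
        ℕₚ.≤-trans (ℕₚ.m≤n+m (length (P i k)) (a i k ℕ.+ c i k)) (ℕₚ.≤-trans (ℕₚ.m≤m+n _ (length (Q i k))) (ℕₚ.m≤n⇒m≤1+n s≤t))
        where s≤t = size≤total i k i≤L k≤L₂
      boundedQ : BoundedBy (suc total) Q
      boundedQ i k i≤L k≤L₂ = proj₁ (boundedP i k i≤L k≤L₂) , proj₁ (proj₂ (boundedP i k i≤L k≤L₂)) ,
        ℕₚ.≤-trans (ℕₚ.m≤n+m (length (Q i k)) (a i k ℕ.+ c i k ℕ.+ length (P i k))) (ℕₚ.m≤n⇒m≤1+n (size≤total i k i≤L k≤L₂))

  ΣxPz-injective₁ : ∀ L (a c : ℕ → ℕ) (P Q : ℕ → Poly) → (∀ i i′ → i ≤ L → i′ ≤ L → a i ≡ a i′ → c i ≡ c i′ → i ≡ i′) →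
    Σ≤ L (λ i → x ^ a i * ev (P i) * z ^ c i) ≈ Σ≤ L (λ i → x ^ a i * ev (Q i) * z ^ c i) →
    ∀ i → i ≤ L → P i ≈ₚ Q i
  ΣxPz-injective₁ L a c P Q injective P≈Q i i≤L =
    ΣxPz-injective (λ i _ → P i) (λ i _ → Q i) injective₂ (trans (σ₁ P) (trans P≈Q (sym (σ₁ Q)))) i 0 (s≤s i≤L) (s≤s z≤n)
    where
    open Family L (λ _ → 0) (λ i _ → a i) (λ i _ → c i)
    injective₂ : ExponentsInjective
    injective₂ i k i′ k′ (s≤s i≤L) (s≤s z≤n) (s≤s i′≤L) (s≤s z≤n) a≡ c≡ = injective i i′ i≤L i′≤L a≡ c≡ , ≡.refl
    σ₁ : ∀ P → ΣxPz (λ i _ → P i) ≈ Σ≤ L (λ i → x ^ a i * ev (P i) * z ^ c i)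
    σ₁ P = ΣA.σ-cong′ (suc L) (λ i → +-identityˡ _)

  ΣxιUz-injective₁ : ∀ L (a c : ℕ → ℕ) (u v : ℕ → Kc) → (∀ i i′ → i ≤ L → i′ ≤ L → a i ≡ a i′ → c i ≡ c i′ → i ≡ i′) →
    Σ≤ L (λ i → x ^ a i * ι (u i) * z ^ c i) ≈ Σ≤ L (λ i → x ^ a i * ι (v i) * z ^ c i) →
    ∀ i → i ≤ L → u i ≈ᵏ v i
  ΣxιUz-injective₁ L a c u v injective u≈v i i≤L =
    ΣxPz-injective₁ L a c (λ i → C (u i)) (λ i → C (v i)) injective (trans (sym (asC u)) (trans u≈v (asC v))) i i≤L 0
    where
    asC : ∀ w → Σ≤ L (λ i → x ^ a i * ι (w i) * z ^ c i) ≈ Σ≤ L (λ i → x ^ a i * ev (C (w i)) * z ^ c i)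
    asC w = ΣA.σ-cong′ (suc L) (λ i → *-congʳ (*-congˡ (sym (ev-C (w i)))))

M∸-injective : ∀ M L → L ≤ M → ∀ (c : ℕ → ℕ) i i′ → i ≤ L → i′ ≤ L → M ∸ i ≡ M ∸ i′ → c i ≡ c i′ → i ≡ i′
M∸-injective M L L≤M _ i i′ i≤L i′≤L M∸i≡M∸i′ _ = ℕₚ.∸-cancelˡ-≡ (ℕₚ.≤-trans i≤L L≤M) (ℕₚ.≤-trans i′≤L L≤M) M∸i≡M∸i′

module UniqueCoefficients {c ℓ c′ ℓ′ : Level} (K : CommutativeRing c ℓ) (A : Ring c′ ℓ′)
  (ι : CommutativeRing.Carrier K → Ring.Carrier A)
  (β b : CommutativeRing.Carrier K) (x y z : Ring.Carrier A)
  (isAlg : Setting.IsKAlgebra K A ι β b x y z)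
  (rels : Setting.Relations K A ι β b x y z)
  (pbw : Setting.PBW K A ι β b x y z) where

  open Setting K A ι β b x y z hiding (zero)
  open Basics K A ι β b x y z isAlg using (module ΣA; ev-C)
  open Identities K A ι β b x y z isAlg rels
  open Uniqueness K A ι β b x y z isAlg pbw

  W-unique : ∀ m n (W′ : ℕ → Kc) →
    z ^ n * x ^ m ≈ Σ≤ (m ⊓ n) (λ k → x ^ (m ∸ k) * ι (W′ k) * z ^ (n ∸ k)) →
    ∀ k → k ≤ m ⊓ n → W′ k ≈ᵏ W m n k
  W-unique m n W′ expansion = ΣxιUz-injective₁ (m ⊓ n) (m ∸_) (n ∸_) W′ (W m n)
    (M∸-injective m (m ⊓ n) (ℕₚ.m⊓n≤m m n) (n ∸_)) (trans (sym expansion) (zⁿxᵐ≈ΣxWz m n))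

  U-unique : ∀ n m s (U′ : ℕ → Kc) →
    (x ^ n * z ^ m) ^ s ≈ Σ≤ ((n ℕ.* s) ⊓ (m ℕ.* s)) (λ l → x ^ ((n ℕ.* s) ∸ l) * ι (U′ l) * z ^ ((m ℕ.* s) ∸ l)) →
    ∀ l → l ≤ (n ℕ.* s) ⊓ (m ℕ.* s) → U′ l ≈ᵏ U n m s l
  U-unique n m s U′ expansion = ΣxιUz-injective₁ ((n ℕ.* s) ⊓ (m ℕ.* s)) ((n ℕ.* s) ∸_) ((m ℕ.* s) ∸_) U′ (U n m s)
    (M∸-injective (n ℕ.* s) _ (ℕₚ.m⊓n≤m _ _) ((m ℕ.* s) ∸_)) (trans (sym expansion) ([xⁿzᵐ]ˢ≈ΣxUz n m s))

  V-unique : ∀ s (V′ : ℕ → Poly) →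
    (x * y * z) ^ s ≈ Σ≤ s (λ l → x ^ (s ∸ l) * ev (V′ l) * z ^ (s ∸ l)) →
    ∀ l → l ≤ s → V′ l ≈ₚ V s l
  V-unique s V′ expansion = ΣxPz-injective₁ s (s ∸_) (s ∸_) V′ (V s)
    (M∸-injective s s ℕₚ.≤-refl (s ∸_)) (trans (sym expansion) ([xyz]ˢ≈ΣxVz s))

  R-unique : ∀ n m t s (R′ : ℕ → Poly) →
    (x ^ n * y ^ m * z ^ t) ^ s ≈ Σ≤ ((n ℕ.* s) ⊓ (t ℕ.* s)) (λ l → x ^ ((n ℕ.* s) ∸ l) * ev (R′ l) * z ^ ((t ℕ.* s) ∸ l)) →
    ∀ l → l ≤ (n ℕ.* s) ⊓ (t ℕ.* s) → R′ l ≈ₚ R n m t s l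
  R-unique n m t s R′ expansion = ΣxPz-injective₁ ((n ℕ.* s) ⊓ (t ℕ.* s)) ((n ℕ.* s) ∸_) ((t ℕ.* s) ∸_) R′ (R n m t s)
    (M∸-injective (n ℕ.* s) _ (ℕₚ.m⊓n≤m _ _) ((t ℕ.* s) ∸_)) (trans (sym expansion) ([xⁿyᵐzᵗ]ˢ≈ΣxRz n m t s))

  S-unique : ∀ n (S′ : ℕ → Poly) → (x + y) ^ n ≈ Σ≤ n (λ k → x ^ k * ev (S′ k)) → ∀ k → k ≤ n → S′ k ≈ₚ S n k
  S-unique n S′ expansion = ΣxPz-injective₁ n id (λ _ → 0) S′ (S n) (λ _ _ _ _ i≡i′ _ → i≡i′)
    (trans (withZ S′) (trans (sym expansion) (trans ([x+y]ⁿ≈ΣxS n) (sym (withZ (S n))))))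
    where
    withZ : ∀ P → Σ≤ n (λ k → x ^ k * ev (P k) * 1#) ≈ Σ≤ n (λ k → x ^ k * ev (P k))
    withZ P = ΣA.σ-cong′ (suc n) (λ k → *-identityʳ _)

  T-unique : ∀ n (T′ : ℕ → Poly) → (y + z) ^ n ≈ Σ≤ n (λ k → ev (T′ k) * z ^ k) → ∀ k → k ≤ n → T′ k ≈ₚ T n k
  T-unique n T′ expansion = ΣxPz-injective₁ n (λ _ → 0) id T′ (T n) (λ _ _ _ _ _ i≡i′ → i≡i′)
    (trans (withX T′) (trans (sym expansion) (trans ([y+z]ⁿ≈ΣTz n) (sym (withX (T n))))))
    where
    withX : ∀ P → Σ≤ n (λ k → 1# * ev (P k) * z ^ k) ≈ Σ≤ n (λ k → ev (P k) * z ^ k)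
    withX P = ΣA.σ-cong′ (suc n) (λ k → *-congʳ (*-identityˡ _))

  E-unique : ∀ n (E′ : ℕ → ℕ → Kc) →
    (x + z) ^ n ≈ Σ≤ n (λ i → Σ≤ (n ∸ i) (λ k → x ^ i * ι (E′ i k) * z ^ k)) →
    ∀ i k → i ℕ.+ k ≤ n → E′ i k ≈ᵏ evalᵏ (E n i k) b
  E-unique n E′ expansion i k i+k≤n =
    ΣxPz-injective (λ i k → C (E′ i k)) (λ i k → C (evalᵏ (E n i k) b)) (λ _ _ _ _ _ _ _ _ i≡i′ k≡k′ → i≡i′ , k≡k′)
      (trans (sym (asC E′)) (trans (sym expansion) (trans ([x+z]ⁿ≈ΣxEz n) (asC (λ i k → evalᵏ (E n i k) b)))))
      i k (s≤s (ℕₚ.m+n≤o⇒m≤o i i+k≤n)) (s≤s (ℕₚ.m+n≤o⇒m≤o∸n k (≡.subst (_≤ n) (ℕₚ.+-comm i k) i+k≤n))) 0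
    where
    open Family n (n ∸_) (λ i k → i) (λ i k → k)
    asC : ∀ (w : ℕ → ℕ → Kc) → Σ≤ n (λ i → Σ≤ (n ∸ i) (λ k → x ^ i * ι (w i k) * z ^ k)) ≈ ΣxPz (λ i k → C (w i k))
    asC w = ΣA.σ-cong′ (suc n) (λ i → ΣA.σ-cong′ (suc (n ∸ i)) (λ k → *-congʳ (*-congˡ (sym (ev-C (w i k))))))

proposition3p3 :
  ∀ {c ℓ a ℓa : Level}
    (K : CommutativeRing c ℓ) (A : Ring a ℓa)
    (ι : CommutativeRing.Carrier K → Ring.Carrier A)
    (β b : CommutativeRing.Carrier K) (x y z : Ring.Carrier A) →
  let open Setting K A ι β b x y z in
  IsField → CharZero → IsKAlgebra → ¬ (β ≈ᵏ 0ᵏ) → Relations → PBW →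
  -- (1)
  ( (∀ m n → y ^ n * x ^ m ≈ x ^ m * (y - castA m) ^ n)
  × (∀ m n → z ^ n * y ^ m ≈ (y - castA n) ^ m * z ^ n)
  × (∀ m n → z ^ n * x ^ m
             ≈ Σ≤ (m ⊓ n) (λ k → ι ((β ^ᵏ ((m ∸ k) ℕ.* (n ∸ k))) *ᵏ (b ^ᵏ k)
                                    *ᵏ qbin β n k *ᵏ qbin β m k *ᵏ qfact β k)
                                * x ^ (m ∸ k) * z ^ (n ∸ k)))
  × (∀ m n → z ^ n * x ^ m ≈ Σ≤ (m ⊓ n) (λ k → x ^ (m ∸ k) * ι (W m n k) * z ^ (n ∸ k)))
  × (∀ m n (W′ : ℕ → Kc) →
       z ^ n * x ^ m ≈ Σ≤ (m ⊓ n) (λ k → x ^ (m ∸ k) * ι (W′ k) * z ^ (n ∸ k)) →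
       ∀ k → k ≤ m ⊓ n → W′ k ≈ᵏ W m n k) )
  -- (2)
  × ( (∀ m n s → (x ^ n * y ^ m) ^ s ≈ x ^ (n ℕ.* s) * Π< s (λ j → (y - castA (j ℕ.* n)) ^ m))
    × (∀ m n s → (y ^ n * z ^ m) ^ s ≈ Π< s (λ j → (y - castA (j ℕ.* m)) ^ n) * z ^ (m ℕ.* s))
    × (∀ n m s → (x ^ n * z ^ m) ^ s
                 ≈ Σ≤ ((n ℕ.* s) ⊓ (m ℕ.* s))
                      (λ l → x ^ ((n ℕ.* s) ∸ l) * ι (U n m s l) * z ^ ((m ℕ.* s) ∸ l)))
    × (∀ n m s (U′ : ℕ → Kc) →
         (x ^ n * z ^ m) ^ s
           ≈ Σ≤ ((n ℕ.* s) ⊓ (m ℕ.* s))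
                (λ l → x ^ ((n ℕ.* s) ∸ l) * ι (U′ l) * z ^ ((m ℕ.* s) ∸ l)) →
         ∀ l → l ≤ (n ℕ.* s) ⊓ (m ℕ.* s) → U′ l ≈ᵏ U n m s l) )
  -- (3)
  × ( (∀ s → (x * y * z) ^ s ≈ Σ≤ s (λ l → x ^ (s ∸ l) * ev (V s l) * z ^ (s ∸ l)))
    × (∀ s (V′ : ℕ → Poly) →
         (x * y * z) ^ s ≈ Σ≤ s (λ l → x ^ (s ∸ l) * ev (V′ l) * z ^ (s ∸ l)) →
         ∀ l → l ≤ s → V′ l ≈ₚ V s l) )
  -- (4)
  × ( (∀ n m t s → (x ^ n * y ^ m * z ^ t) ^ s
                   ≈ Σ≤ ((n ℕ.* s) ⊓ (t ℕ.* s))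
                        (λ l → x ^ ((n ℕ.* s) ∸ l) * ev (R n m t s l) * z ^ ((t ℕ.* s) ∸ l)))
    × (∀ n m t s (R′ : ℕ → Poly) →
         (x ^ n * y ^ m * z ^ t) ^ s
           ≈ Σ≤ ((n ℕ.* s) ⊓ (t ℕ.* s))
                (λ l → x ^ ((n ℕ.* s) ∸ l) * ev (R′ l) * z ^ ((t ℕ.* s) ∸ l)) →
         ∀ l → l ≤ (n ℕ.* s) ⊓ (t ℕ.* s) → R′ l ≈ₚ R n m t s l) )
  -- (5)
  × ( (∀ n → (x + y) ^ n ≈ Σ≤ n (λ k → x ^ k * ev (S n k)))
    × (∀ n (S′ : ℕ → Poly) →
         (x + y) ^ n ≈ Σ≤ n (λ k → x ^ k * ev (S′ k)) → ∀ k → k ≤ n → S′ k ≈ₚ S n k)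
    × (∀ n → (y + z) ^ n ≈ Σ≤ n (λ k → ev (T n k) * z ^ k))
    × (∀ n (T′ : ℕ → Poly) →
         (y + z) ^ n ≈ Σ≤ n (λ k → ev (T′ k) * z ^ k) → ∀ k → k ≤ n → T′ k ≈ₚ T n k)
    × (∀ n → (x + z) ^ n
             ≈ Σ≤ n (λ i → Σ≤ (n ∸ i) (λ k → x ^ i * ι (evalᵏ (E n i k) b) * z ^ k)))
    × (∀ n (E′ : ℕ → ℕ → Kc) →
         (x + z) ^ n ≈ Σ≤ n (λ i → Σ≤ (n ∸ i) (λ k → x ^ i * ι (E′ i k) * z ^ k)) →
         ∀ i k → i ℕ.+ k ≤ n → E′ i k ≈ᵏ evalᵏ (E n i k) b) )

proposition3p3 K A ι β b x y z _ _ isAlg _ rels pbw =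
  ( (yⁿxᵐ≈xᵐ[y-m]ⁿ , zⁿyᵐ≈[y-n]ᵐzⁿ , zⁿxᵐ≈ΣW-explicit , zⁿxᵐ≈ΣxWz , W-unique)
  , ([xⁿyᵐ]ˢ≈xⁿˢΠ[y-jn]ᵐ , [yⁿzᵐ]ˢ≈Π[y-jm]ⁿzᵐˢ , [xⁿzᵐ]ˢ≈ΣxUz , U-unique)
  , ([xyz]ˢ≈ΣxVz , V-unique)
  , ([xⁿyᵐzᵗ]ˢ≈ΣxRz , R-unique)
  , ([x+y]ⁿ≈ΣxS , S-unique , [y+z]ⁿ≈ΣTz , T-unique , [x+z]ⁿ≈ΣxEz , E-unique) )
  where
  open Identities K A ι β b x y z isAlg rels
  open UniqueCoefficients K A ι β b x y z isAlg rels pbw
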